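{- Let $\omega\in\mathbb C$. For any integers $m,n\geq 0$, the $\mathfrak K_\omega$-module $L_m\otimes L_n$ (with $\mathfrak K_\omega$ acting via the comultiplication $\Delta$) is isomorphic to $\bigoplus_{p=0}^{\min\{m,n\}}L_{m+n-2p}$.
   Context: All algebras are unital associative over $\mathbb C$ and $[x,y]=xy-yx$. $\mathrm U(\mathfrak{sl}_2)$ is the algebra generated by $E,F,H$ with $[H,E]=2E$, $[H,F]=-2F$, $[E,F]=H$. For $\omega\in\mathbb C$, $\mathfrak K_\omega$ is the algebra generated by $A,B$ subject to $A^2B-2ABA+BA^2=B+\omega A$ and $B^2A-2BAB+AB^2=A+\omega B$, and $C=[A,B]$. The comultiplication $\Delta\colon\mathfrak K_\omega\to\mathfrak K_\omega\otimes\mathfrak K_\omega$ is the algebra homomorphism with $\Delta(X)=X\otimes1+1\otimes X$ for $X\in\{A,B,C\}$; a tensor product of $\mathfrak K_\omega$-modules is a $\mathfrak K_\omega$-module via $\Delta$. There is an algebra homomorphism $\zeta\colon\mathfrak K_\omega\to\mathrm U(\mathfrak{sl}_2)$ with $A\mapsto \frac{1+\omega}{2}E+\frac{1-\omega}{2}F-\frac{\omega}{2}H$, $B\mapsto \frac12H$. For $n\ge0$, $L_n$ is the $(n+1)$-dimensional $\mathrm U(\mathfrak{sl}_2)$-module with basis $v_0,\dots,v_n$ where $Ev_i=(n-i+1)v_{i-1}$ ($1\le i\le n$), $Ev_0=0$, $Fv_i=(i+1)v_{i+1}$ ($0\le i\le n-1$), $Fv_n=0$, $Hv_i=(n-2i)v_i$;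 it is regarded as a $\mathfrak K_\omega$-module by pulling back via $\zeta$. -}

module Defs where

open import Level using (Level; _⊔_)
open import Data.Nat using (ℕ; zero; suc; _∸_; _⊓_; _≡ᵇ_) renaming (_+_ to _+ℕ_; _*_ to _*ℕ_)
open import Data.Fin using (Fin; zero; suc; splitAt; remQuot; toℕ)
open import Data.Sum using (inj₁; inj₂)
open import Data.Product using (Σ; _×_; _,_; ∃)
open import Data.List using (List; []; _∷_; _++_; map; foldr; upTo)
open import Relation.Nullary using (¬_)
open import Data.Bool using (if_then_else_)
open import Algebra.Bundles using (CommutativeRing)

-- An algebraically closed field of characteristic zero
-- (stand-in for ℂ; agda-stdlib has no complex numbers).

module RingFns {c ℓ : Level} (R : CommutativeRing c ℓ) where
  open CommutativeRing R

  fromℕ : ℕ → Carrier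
  fromℕ zero    = 0#
  fromℕ (suc n) = 1# + fromℕ n

  evalPoly : List Carrier → Carrier → Carrier
  evalPoly []       x = 0#
  evalPoly (a ∷ as) x = a + x * evalPoly as x

record ACF0 (c ℓ : Level) : Set (Level.suc (c ⊔ ℓ)) where
  field
    commRing : CommutativeRing c ℓ
  open CommutativeRing commRing public
  open RingFns commRing public

  field
    inv        : Carrier → Carrier
    inverse    : ∀ x → ¬ (x ≈ 0#) → x * inv x ≈ 1#
    nontrivial : ¬ (1# ≈ 0#)
    char0      : ∀ n → ¬ (fromℕ (suc n) ≈ 0#)
    algClosed  : ∀ (a : Carrier) (as : List Carrier) →
                 ∃ λ x → evalPoly ((a ∷ as) ++ (1# ∷ [])) x ≈ 0#

module Reps {c ℓ : Level} (𝔽 : ACF0 c ℓ) where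
  open ACF0 𝔽 using (Carrier; _≈_; _+_; _*_; -_; _-_; 0#; 1#; fromℕ; inv)

  Mat : ℕ → ℕ → Set c
  Mat m n = Fin m → Fin n → Carrier

  _≋_ : ∀ {m n} → Mat m n → Mat m n → Set ℓ
  X ≋ Y = ∀ i j → X i j ≈ Y i j

  sumFin : ∀ {n} → (Fin n → Carrier) → Carrier
  sumFin {zero}  f = 0#
  sumFin {suc n} f = f zero + sumFin (λ i → f (suc i))

  _·_ : ∀ {m n k} → Mat m n → Mat n k → Mat m k
  (X · Y) i j = sumFin (λ l → X i l * Y l j)

  infixl 7 _·_
  infix 4 _≋_
  infixl 6 _+ₘ_
  infixr 7 _*ₛ_

  _+ₘ_ : ∀ {m n} → Mat m n → Mat m n → Mat m n
  (X +ₘ Y) i j = X i j + Y i j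

  _*ₛ_ : ∀ {m n} → Carrier → Mat m n → Mat m n
  (a *ₛ X) i j = a * X i j

  Id : ∀ {n} → Mat n n
  Id i j = if toℕ i ≡ᵇ toℕ j then 1# else 0#

  blockDiag : ∀ {m n} → Mat m m → Mat n n → Mat (m +ℕ n) (m +ℕ n)
  blockDiag {m} X Y i j with splitAt m i | splitAt m j
  ... | inj₁ i′ | inj₁ j′ = X i′ j′
  ... | inj₂ i′ | inj₂ j′ = Y i′ j′
  ... | inj₁ _  | inj₂ _  = 0#
  ... | inj₂ _  | inj₁ _  = 0#

  kron : ∀ {m n} → Mat m m → Mat n n → Mat (m *ℕ n) (m *ℕ n)
  kron {m} {n} X Y i j with remQuot {m} n i | remQuot {m} n j
  ... | i₁ , i₂ | j₁ , j₂ = X i₁ j₁ * Y i₂ j₂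

  -- A finite-dimensional 𝔎_ω-module: a space 𝔽^dim with the actions of
  -- the generators A and B (C = [A,B] acts by the commutator).

  record Rep : Set c where
    field
      dim : ℕ
      ρA  : Mat dim dim
      ρB  : Mat dim dim
  open Rep public

  record _≅_ (V W : Rep) : Set (c ⊔ ℓ) where
    field
      to      : Mat (dim W) (dim V)
      from    : Mat (dim V) (dim W)
      from∘to : from · to ≋ Id
      to∘from : to · from ≋ Id
      comm-A  : to · ρA V ≋ ρA W · to
      comm-B  : to · ρB V ≋ ρB W · to

  _⊗_ : Rep → Rep → Rep
  V ⊗ W = record
    { dim = dim V *ℕ dim W
    ; ρA  = kron (ρA V) Id +ₘ kron {dim V} (Id {dim V}) (ρA W)
    ; ρB  = kron (ρB V) Id +ₘ kron {dim V} (Id {dim V}) (ρB W)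
    }

  _⊕_ : Rep → Rep → Rep
  V ⊕ W = record
    { dim = dim V +ℕ dim W
    ; ρA  = blockDiag (ρA V) (ρA W)
    ; ρB  = blockDiag (ρB V) (ρB W)
    }

  zeroRep : Rep
  zeroRep = record { dim = 0 ; ρA = λ () ; ρB = λ () }

  ⨁ : List Rep → Rep
  ⨁ = foldr _⊕_ zeroRep

  -- matrix of E on L_n : E vₛ = (n - s + 1) vₛ₋₁
  Eₙ : ∀ n → Mat (suc n) (suc n)
  Eₙ n r s = if toℕ s ≡ᵇ suc (toℕ r) then fromℕ (n ∸ toℕ r) else 0#

  -- matrix of F on L_n : F vₛ = (s + 1) vₛ₊₁
  Fₙ : ∀ n → Mat (suc n) (suc n)
  Fₙ n r s = if toℕ r ≡ᵇ suc (toℕ s) then fromℕ (toℕ r) else 0#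

  -- matrix of H on L_n : H vₛ = (n - 2s) vₛ
  Hₙ : ∀ n → Mat (suc n) (suc n)
  Hₙ n r s = if toℕ r ≡ᵇ toℕ s then fromℕ n - fromℕ (2 *ℕ toℕ s) else 0#

  ½ : Carrier
  ½ = inv (1# + 1#)

  -- L_n as a 𝔎_ω-module via ζ
  L : Carrier → ℕ → Rep
  L ω n = record
    { dim = suc n
    ; ρA  = ((½ * (1# + ω)) *ₛ Eₙ n) +ₘ ((½ * (1# - ω)) *ₛ Fₙ n)
              +ₘ ((- (½ * ω)) *ₛ Hₙ n)
    ; ρB  = ½ *ₛ Hₙ n
    }

-- On L_n the generators act by fixed linear combinations of E, F, H (A ↦ αE + βF + γH,
-- B ↦ ½H), and on tensor products by X ⊗ 1 + 1 ⊗ X, so any invertible map commuting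
-- with E, F and H is an isomorphism of 𝔎_ω-modules.  The theorem then follows by
-- induction from the Clebsch–Gordan step L_{m+1} ⊗ L_{n+1} ≅ L_{m+n+2} ⊕ (L_m ⊗ L_n),
-- realised by explicit matrices.  L_{m+n+2} embeds by v_k ↦ Σ_{i+j=k} v_i ⊗ v_j (the
-- basis v_i consists of divided powers of F applied to v_0), and L_m ⊗ L_n by
-- v_a ⊗ v_b ↦ (m+1−a)(b+1) v_a ⊗ v_{b+1} − (a+1)(n+1−b) v_{a+1} ⊗ v_b.  The inverse is
-- assembled from the functional v_i ⊗ v_j ↦ C(m+1,i) C(n+1,j): it kills the second image
-- and, by Vandermonde's identity, takes the value C(m+n+2,k) on the image of v_k.
-- Characteristic zero is used only to invert these and similar positive integers.

module Submission where

open import Level using (Level)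
open import Defs
open import Algebra.Bundles using (RawRing)
import Algebra.Solver.Ring as RS
import Algebra.Solver.Ring.AlmostCommutativeRing as ACRm
open import Data.Bool using (if_then_else_; true; false)
open import Data.Empty using (⊥-elim)
open import Data.Fin as Fin using (Fin; zero; suc; toℕ; _↑ˡ_; _↑ʳ_; combine; remQuot; splitAt)
import Data.Fin.Properties as FinP
open import Data.Integer as ℤ using (ℤ; +_; -[1+_]; _⊖_)
import Data.Integer.Properties as ℤP
open import Data.Maybe using (just; nothing)
open import Data.Nat as ℕ using (ℕ; zero; suc; _≤_; _<_; z≤n; s≤s; _≡ᵇ_; _∸_)
import Data.Nat.Properties as ℕP
open import Data.Nat.Solver using (module +-*-Solver)
open import Data.Product using (proj₁; proj₂)
open import Data.Sign as Sign using (Sign)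
open import Data.Sum using (_⊎_; inj₁; inj₂)
open import Function using (_∘_; id)
open import Relation.Binary.Definitions using (WeaklyDecidable)
open import Relation.Binary.PropositionalEquality as ≡ using (_≡_; _≢_)
open import Relation.Nullary using (¬_; Dec; yes; no)

module RingArithmetic {c ℓ : Level} (𝔽 : ACF0 c ℓ) where
  open ACF0 𝔽 public hiding (zero)
  open import Relation.Binary.Reasoning.Setoid setoid public
  open import Algebra.Properties.Ring ring public using (-‿distribˡ-*; -‿distribʳ-*; -‿involutive; -0#≈0#; -‿+-comm)
  open import Algebra.Properties.CommutativeSemigroup +-commutativeSemigroup public
    using () renaming (interchange to +-interchange)

  𝔽-almostCommutativeRing : ACRm.AlmostCommutativeRing c ℓ
  𝔽-almostCommutativeRing = ACRm.fromCommutativeRing commRing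

  fromℕ-+ : ∀ a b → fromℕ (a ℕ.+ b) ≈ fromℕ a + fromℕ b
  fromℕ-+ zero b = sym (+-identityˡ _)
  fromℕ-+ (suc a) b = trans (+-congˡ (fromℕ-+ a b)) (sym (+-assoc _ _ _))

  fromℕ-* : ∀ a b → fromℕ (a ℕ.* b) ≈ fromℕ a * fromℕ b
  fromℕ-* zero b = sym (zeroˡ _)
  fromℕ-* (suc a) b = begin
    fromℕ (b ℕ.+ a ℕ.* b) ≈⟨ fromℕ-+ b (a ℕ.* b) ⟩
    fromℕ b + fromℕ (a ℕ.* b) ≈⟨ +-congˡ (fromℕ-* a b) ⟩
    fromℕ b + fromℕ a * fromℕ b ≈⟨ +-congʳ (sym (*-identityˡ _)) ⟩
    1# * fromℕ b + fromℕ a * fromℕ b ≈⟨ sym (distribʳ _ _ _) ⟩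
    (1# + fromℕ a) * fromℕ b ∎

  *-cancelˡ-inv : ∀ {x X Y} → x * inv x ≈ 1# → x * X ≈ x * Y → X ≈ Y
  *-cancelˡ-inv {x} {X} {Y} xi p = begin
    X ≈⟨ sym (trans (*-congʳ {X} (trans (*-comm _ _) xi)) (*-identityˡ _)) ⟩
    (inv x * x) * X ≈⟨ *-assoc _ _ _ ⟩
    inv x * (x * X) ≈⟨ *-congˡ {inv x} p ⟩
    inv x * (x * Y) ≈⟨ sym (*-assoc _ _ _) ⟩
    (inv x * x) * Y ≈⟨ trans (*-congʳ {Y} (trans (*-comm _ _) xi)) (*-identityˡ _) ⟩
    Y ∎

  ⟦_⟧ℤ : ℤ → Carrier
  ⟦ + n ⟧ℤ = fromℕ n
  ⟦ -[1+ n ] ⟧ℤ = - fromℕ (suc n)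

  ⊖-hom : ∀ a b → ⟦ a ⊖ b ⟧ℤ ≈ fromℕ a - fromℕ b
  ⊖-hom a zero = sym (trans (+-congˡ -0#≈0#) (+-identityʳ _))
  ⊖-hom zero (suc b) = sym (+-identityˡ _)
  ⊖-hom (suc a) (suc b) rewrite ℤP.[1+m]⊖[1+n]≡m⊖n a b = begin
    ⟦ a ⊖ b ⟧ℤ ≈⟨ ⊖-hom a b ⟩
    fromℕ a - fromℕ b ≈⟨ sym (+-congʳ (trans (+-assoc _ _ _) (trans (+-congˡ (-‿inverseʳ 1#)) (+-identityʳ _)))) ⟩
    (fromℕ a + 1# - 1#) - fromℕ b ≈⟨ trans (+-assoc _ _ _) (+-congˡ (-‿+-comm _ _)) ⟩
    (fromℕ a + 1#) - (1# + fromℕ b) ≈⟨ +-congʳ (+-comm _ _) ⟩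
    (1# + fromℕ a) - (1# + fromℕ b) ∎

  ℤ-rawRing : RawRing _ _
  ℤ-rawRing = record { Carrier = ℤ ; _≈_ = _≡_ ; _+_ = ℤ._+_ ; _*_ = ℤ._*_ ; -_ = ℤ.-_ ; 0# = + 0 ; 1# = + 1 }

  neg-hom : ∀ z → ⟦ ℤ.- z ⟧ℤ ≈ - ⟦ z ⟧ℤ
  neg-hom (+ zero) = sym -0#≈0#
  neg-hom (+ suc n) = refl
  neg-hom -[1+ n ] = sym (-‿involutive _)

  add-hom : ∀ x y → ⟦ x ℤ.+ y ⟧ℤ ≈ ⟦ x ⟧ℤ + ⟦ y ⟧ℤ
  add-hom -[1+ m ] -[1+ n ] = begin
    - fromℕ (suc (suc (m ℕ.+ n))) ≈⟨ -‿cong (trans (reflexive (≡.cong fromℕ lem)) (fromℕ-+ (suc m) (suc n))) ⟩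
    - (fromℕ (suc m) + fromℕ (suc n)) ≈⟨ sym (-‿+-comm _ _) ⟩
    - fromℕ (suc m) + - fromℕ (suc n) ∎
    where
    lem : suc (suc (m ℕ.+ n)) ≡ suc m ℕ.+ suc n
    lem = ≡.cong suc (≡.sym (ℕP.+-suc m n))
  add-hom -[1+ m ] (+ n) = trans (⊖-hom n (suc m)) (+-comm _ _)
  add-hom (+ m) -[1+ n ] = ⊖-hom m (suc n)
  add-hom (+ m) (+ n) = fromℕ-+ m n

  sgn : Sign → Carrier
  sgn Sign.+ = 1#
  sgn Sign.- = - 1#

  ◃-hom : ∀ s n → ⟦ s ℤ.◃ n ⟧ℤ ≈ sgn s * fromℕ n
  ◃-hom s zero = sym (zeroʳ _)
  ◃-hom Sign.+ (suc n) = sym (*-identityˡ _)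
  ◃-hom Sign.- (suc n) = trans (-‿cong (sym (*-identityˡ _))) (-‿distribˡ-* _ _)

  sa-hom : ∀ z → ⟦ z ⟧ℤ ≈ sgn (ℤ.sign z) * fromℕ ℤ.∣ z ∣
  sa-hom (+ n) = sym (*-identityˡ _)
  sa-hom -[1+ n ] = trans (-‿cong (sym (*-identityˡ _))) (-‿distribˡ-* _ _)

  sgn-* : ∀ s t → sgn (s Sign.* t) ≈ sgn s * sgn t
  sgn-* Sign.+ t = sym (*-identityˡ _)
  sgn-* Sign.- Sign.+ = sym (*-identityʳ _)
  sgn-* Sign.- Sign.- = sym (trans (sym (-‿distribˡ-* _ _)) (trans (-‿cong (*-identityˡ _)) (-‿involutive _)))

  mul-hom : ∀ x y → ⟦ x ℤ.* y ⟧ℤ ≈ ⟦ x ⟧ℤ * ⟦ y ⟧ℤ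
  mul-hom x y = begin
    ⟦ x ℤ.* y ⟧ℤ ≈⟨ ◃-hom (ℤ.sign x Sign.* ℤ.sign y) (ℤ.∣ x ∣ ℕ.* ℤ.∣ y ∣) ⟩
    sgn (ℤ.sign x Sign.* ℤ.sign y) * fromℕ (ℤ.∣ x ∣ ℕ.* ℤ.∣ y ∣) ≈⟨ *-cong (sgn-* (ℤ.sign x) (ℤ.sign y))
        (fromℕ-* ℤ.∣ x ∣ ℤ.∣ y ∣) ⟩
    (sgn (ℤ.sign x) * sgn (ℤ.sign y)) * (fromℕ ℤ.∣ x ∣ * fromℕ ℤ.∣ y ∣) ≈⟨ lem _ _ _ _ ⟩
    (sgn (ℤ.sign x) * fromℕ ℤ.∣ x ∣) * (sgn (ℤ.sign y) * fromℕ ℤ.∣ y ∣) ≈⟨ sym (*-cong (sa-hom x) (sa-hom y)) ⟩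
    ⟦ x ⟧ℤ * ⟦ y ⟧ℤ ∎
    where
    lem : ∀ a b u v → (a * b) * (u * v) ≈ (a * u) * (b * v)
    lem a b u v = trans (*-assoc _ _ _) (trans
        (*-congˡ (trans (sym (*-assoc _ _ _)) (trans (*-congʳ (*-comm _ _)) (*-assoc _ _ _)))) (sym (*-assoc _ _ _)))

  -- Coefficients of the ring solver: ⟦_⟧ℤ adjusted so that con (+ 1) evaluates
  -- to 1# itself rather than to fromℕ 1 = 1# + 0#.
  ⟦_⟧ᶜ : ℤ → Carrier
  ⟦ + 1 ⟧ᶜ = 1#
  ⟦ z ⟧ᶜ = ⟦ z ⟧ℤ

  ⟦⟧ᶜ≈⟦⟧ℤ : ∀ z → ⟦ z ⟧ᶜ ≈ ⟦ z ⟧ℤ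
  ⟦⟧ᶜ≈⟦⟧ℤ (+ 0) = refl
  ⟦⟧ᶜ≈⟦⟧ℤ (+ 1) = sym (+-identityʳ _)
  ⟦⟧ᶜ≈⟦⟧ℤ (+ suc (suc n)) = refl
  ⟦⟧ᶜ≈⟦⟧ℤ -[1+ n ] = refl

  ℤ⟶𝔽 : ACRm._-Raw-AlmostCommutative⟶_ ℤ-rawRing 𝔽-almostCommutativeRing
  ℤ⟶𝔽 = record
    { ⟦_⟧ = ⟦_⟧ᶜ
    ; +-homo = λ x y → trans (⟦⟧ᶜ≈⟦⟧ℤ (x ℤ.+ y)) (trans (add-hom x y) (sym (+-cong (⟦⟧ᶜ≈⟦⟧ℤ x) (⟦⟧ᶜ≈⟦⟧ℤ y))))
    ; *-homo = λ x y → trans (⟦⟧ᶜ≈⟦⟧ℤ (x ℤ.* y)) (trans (mul-hom x y) (sym (*-cong (⟦⟧ᶜ≈⟦⟧ℤ x) (⟦⟧ᶜ≈⟦⟧ℤ y))))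
    ; -‿homo = λ x → trans (⟦⟧ᶜ≈⟦⟧ℤ (ℤ.- x)) (trans (neg-hom x) (sym (-‿cong (⟦⟧ᶜ≈⟦⟧ℤ x))))
    ; 0-homo = refl
    ; 1-homo = refl
    }

  ℤ-coeff≟ : WeaklyDecidable (ACRm.Induced-equivalence ℤ⟶𝔽)
  ℤ-coeff≟ x y with x ℤ.≟ y
  ... | yes ≡.refl = just refl
  ... | no _ = nothing

  open RS ℤ-rawRing 𝔽-almostCommutativeRing ℤ⟶𝔽 ℤ-coeff≟ public using (solve; _:=_; _:+_; _:*_; _:-_; :-_; con)

module FiniteSums {c ℓ : Level} (𝔽 : ACF0 c ℓ) where
  open RingArithmetic 𝔽 public
  open Reps 𝔽 public

  ΣN : ℕ → (ℕ → Carrier) → Carrier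
  ΣN zero f = 0#
  ΣN (suc n) f = f 0 + ΣN n (λ i → f (suc i))

  ΣN-cong< : ∀ n {f g : ℕ → Carrier} → (∀ i → i < n → f i ≈ g i) → ΣN n f ≈ ΣN n g
  ΣN-cong< zero h = refl
  ΣN-cong< (suc n) h = +-cong (h 0 (s≤s z≤n)) (ΣN-cong< n (λ i i<n → h (suc i) (s≤s i<n)))

  ΣN-cong : ∀ n {f g : ℕ → Carrier} → (∀ i → f i ≈ g i) → ΣN n f ≈ ΣN n g
  ΣN-cong n h = ΣN-cong< n (λ i _ → h i)

  ΣN-+ : ∀ n (f g : ℕ → Carrier) → ΣN n (λ i → f i + g i) ≈ ΣN n f + ΣN n g
  ΣN-+ zero f g = sym (+-identityʳ _)
  ΣN-+ (suc n) f g = trans (+-congˡ (ΣN-+ n _ _)) (+-interchange _ _ _ _)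

  ΣN-*ˡ : ∀ n a (f : ℕ → Carrier) → a * ΣN n f ≈ ΣN n (λ i → a * f i)
  ΣN-*ˡ zero a f = zeroʳ _
  ΣN-*ˡ (suc n) a f = trans (distribˡ _ _ _) (+-congˡ (ΣN-*ˡ n a _))

  ΣN-*ʳ : ∀ n a (f : ℕ → Carrier) → ΣN n f * a ≈ ΣN n (λ i → f i * a)
  ΣN-*ʳ n a f = trans (*-comm _ _) (trans (ΣN-*ˡ n a f) (ΣN-cong n (λ i → *-comm _ _)))

  ΣN-0 : ∀ n → ΣN n (λ _ → 0#) ≈ 0#
  ΣN-0 zero = refl
  ΣN-0 (suc n) = trans (+-identityˡ _) (ΣN-0 n)

  ΣN-neg : ∀ n (f : ℕ → Carrier) → ΣN n (λ i → - f i) ≈ - ΣN n f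
  ΣN-neg zero f = sym -0#≈0#
  ΣN-neg (suc n) f = trans (+-congˡ (ΣN-neg n _)) (-‿+-comm _ _)

  ΣN-swap : ∀ a b (f : ℕ → ℕ → Carrier) → ΣN a (λ i → ΣN b (λ j → f i j)) ≈ ΣN b (λ j → ΣN a (λ i → f i j))
  ΣN-swap zero b f = sym (ΣN-0 b)
  ΣN-swap (suc a) b f = begin
    ΣN b (f 0) + ΣN a (λ i → ΣN b (λ j → f (suc i) j)) ≈⟨ +-congˡ (ΣN-swap a b _) ⟩
    ΣN b (f 0) + ΣN b (λ j → ΣN a (λ i → f (suc i) j)) ≈⟨ sym (ΣN-+ b _ _) ⟩
    ΣN b (λ j → ΣN (suc a) (λ i → f i j)) ∎

  ΣN-split : ∀ a b (f : ℕ → Carrier) → ΣN (a ℕ.+ b) f ≈ ΣN a f + ΣN b (λ i → f (a ℕ.+ i))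
  ΣN-split zero b f = sym (+-identityˡ _)
  ΣN-split (suc a) b f = trans (+-congˡ (ΣN-split a b _)) (sym (+-assoc _ _ _))

  ΣN-last : ∀ n (f : ℕ → Carrier) → ΣN (suc n) f ≈ ΣN n f + f n
  ΣN-last zero f = trans (+-identityʳ _) (sym (+-identityˡ _))
  ΣN-last (suc n) f = trans (+-congˡ (ΣN-last n (f ∘ suc))) (sym (+-assoc _ _ _))

  δ : ℕ → ℕ → Carrier
  δ i j = if i ≡ᵇ j then 1# else 0#

  δ-refl : ∀ i → δ i i ≈ 1#
  δ-refl zero = refl
  δ-refl (suc i) = δ-refl i

  δ-≢ : ∀ i j → i ≢ j → δ i j ≈ 0#
  δ-≢ zero zero ne = ⊥-elim (ne ≡.refl)
  δ-≢ zero (suc j) ne = refl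
  δ-≢ (suc i) zero ne = refl
  δ-≢ (suc i) (suc j) ne = δ-≢ i j (λ e → ne (≡.cong suc e))

  δ-eq : ∀ {i j} → i ≡ j → δ i j ≈ 1#
  δ-eq {i} ≡.refl = δ-refl i

  δ-sym : ∀ i j → δ i j ≈ δ j i
  δ-sym zero zero = refl
  δ-sym zero (suc j) = refl
  δ-sym (suc i) zero = refl
  δ-sym (suc i) (suc j) = δ-sym i j

  ΣN-δ : ∀ n k (f : ℕ → Carrier) → k < n → ΣN n (λ i → δ k i * f i) ≈ f k
  ΣN-δ (suc n) zero f _ = trans (+-cong (*-identityˡ _) (trans (ΣN-cong n (λ i → zeroˡ _)) (ΣN-0 n))) (+-identityʳ _)
  ΣN-δ (suc n) (suc k) f (s≤s k<n) = trans (+-cong (zeroˡ _) (ΣN-δ n k (λ i → f (suc i)) k<n)) (+-identityˡ _)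

  ΣN-δ-beyond : ∀ n k (f : ℕ → Carrier) → n ≤ k → ΣN n (λ i → δ k i * f i) ≈ 0#
  ΣN-δ-beyond zero k f _ = refl
  ΣN-δ-beyond (suc n) (suc k) f (s≤s n≤k) = trans (+-cong (zeroˡ _) (ΣN-δ-beyond n k (λ i → f (suc i)) n≤k)) (+-identityˡ _)

  ΣN-δʳ : ∀ n k (f : ℕ → Carrier) → k < n → ΣN n (λ i → f i * δ i k) ≈ f k
  ΣN-δʳ n k f k<n = trans (ΣN-cong n (λ i → trans (*-comm _ _) (*-congʳ (δ-sym i k)))) (ΣN-δ n k f k<n)

  ΣN-δʳ-beyond : ∀ n k (f : ℕ → Carrier) → n ≤ k → ΣN n (λ i → f i * δ i k) ≈ 0#
  ΣN-δʳ-beyond n k f n≤k = trans (ΣN-cong n (λ i → trans (*-comm _ _) (*-congʳ (δ-sym i k)))) (ΣN-δ-beyond n k f n≤k)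

  sumFin-cong : ∀ n {f g : Fin n → Carrier} → (∀ i → f i ≈ g i) → sumFin f ≈ sumFin g
  sumFin-cong zero h = refl
  sumFin-cong (suc n) h = +-cong (h zero) (sumFin-cong n (λ i → h (suc i)))

  sumFin-toℕ : ∀ n (f : ℕ → Carrier) → sumFin {n} (λ i → f (toℕ i)) ≈ ΣN n f
  sumFin-toℕ zero f = refl
  sumFin-toℕ (suc n) f = +-congˡ (sumFin-toℕ n (λ i → f (suc i)))

  sumFin-+ : ∀ n (f g : Fin n → Carrier) → sumFin (λ i → f i + g i) ≈ sumFin f + sumFin g
  sumFin-+ zero f g = sym (+-identityʳ _)
  sumFin-+ (suc n) f g = trans (+-congˡ (sumFin-+ n _ _)) (+-interchange _ _ _ _)

  sumFin-0 : ∀ n → sumFin {n} (λ _ → 0#) ≈ 0#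
  sumFin-0 zero = refl
  sumFin-0 (suc n) = trans (+-identityˡ _) (sumFin-0 n)

  sumFin-*ˡ : ∀ n a (f : Fin n → Carrier) → a * sumFin f ≈ sumFin (λ i → a * f i)
  sumFin-*ˡ zero a f = zeroʳ _
  sumFin-*ˡ (suc n) a f = trans (distribˡ _ _ _) (+-congˡ (sumFin-*ˡ n a _))

  sumFin-*ʳ : ∀ n a (f : Fin n → Carrier) → sumFin f * a ≈ sumFin (λ i → f i * a)
  sumFin-*ʳ n a f = trans (*-comm _ _) (trans (sumFin-*ˡ n a f) (sumFin-cong n (λ i → *-comm _ _)))

  sumFin-swap : ∀ a b (f : Fin a → Fin b → Carrier) → sumFin {a}
      (λ i → sumFin {b} (λ j → f i j)) ≈ sumFin {b} (λ j → sumFin {a} (λ i → f i j))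
  sumFin-swap zero b f = sym (sumFin-0 b)
  sumFin-swap (suc a) b f = trans (+-congˡ (sumFin-swap a b _)) (sym (sumFin-+ b _ _))

  sumFin-↑ : ∀ a b (f : Fin (a ℕ.+ b) → Carrier) → sumFin f ≈ sumFin {a} (λ i → f (i ↑ˡ b)) + sumFin {b} (λ j → f (a ↑ʳ j))
  sumFin-↑ zero b f = sym (+-identityˡ _)
  sumFin-↑ (suc a) b f = trans (+-congˡ (sumFin-↑ a b _)) (sym (+-assoc _ _ _))

  sumFin-combine : ∀ a b (f : Fin (a ℕ.* b) → Carrier) → sumFin f ≈ sumFin {a} (λ i → sumFin {b} (λ j → f (combine i j)))
  sumFin-combine zero b f = refl
  sumFin-combine (suc a) b f = trans (sumFin-↑ b (a ℕ.* b) f) (+-congˡ (sumFin-combine a b _))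

module Matrices {c ℓ : Level} (𝔽 : ACF0 c ℓ) where
  open FiniteSums 𝔽 public

  ≋-refl : ∀ {m n} {X : Mat m n} → X ≋ X
  ≋-refl i j = refl
  ≋-sym : ∀ {m n} {X Y : Mat m n} → X ≋ Y → Y ≋ X
  ≋-sym p i j = sym (p i j)
  ≋-trans : ∀ {m n} {X Y Z : Mat m n} → X ≋ Y → Y ≋ Z → X ≋ Z
  ≋-trans p q i j = trans (p i j) (q i j)

  ·-cong : ∀ {m n k} {X X' : Mat m n} {Y Y' : Mat n k} → X ≋ X' → Y ≋ Y' → X · Y ≋ X' · Y'
  ·-cong {n = n} p q i j = sumFin-cong n (λ l → *-cong (p i l) (q l j))

  ·-assoc : ∀ {m n k r} (X : Mat m n) (Y : Mat n k) (Z : Mat k r) → (X · Y) · Z ≋ X · (Y · Z)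
  ·-assoc {m} {n} {k} X Y Z i j = begin
    sumFin {k} (λ l → sumFin {n} (λ l' → X i l' * Y l' l) * Z l j) ≈⟨ sumFin-cong k (λ l → sumFin-*ʳ n _ _) ⟩
    sumFin {k} (λ l → sumFin {n} (λ l' → X i l' * Y l' l * Z l j)) ≈⟨ sumFin-swap k n _ ⟩
    sumFin {n} (λ l' → sumFin {k} (λ l → X i l' * Y l' l * Z l j)) ≈⟨ sumFin-cong n
        (λ l' → trans (sumFin-cong k (λ l → *-assoc _ _ _)) (sym (sumFin-*ˡ k _ _))) ⟩
    sumFin {n} (λ l' → X i l' * sumFin {k} (λ l → Y l' l * Z l j)) ∎

  Id-sum : ∀ {n} (i : Fin n) (f : Fin n → Carrier) → sumFin (λ l → Id i l * f l) ≈ f i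
  Id-sum {suc n} zero f = trans (+-cong (*-identityˡ _) (trans (sumFin-cong n (λ l → zeroˡ _)) (sumFin-0 n))) (+-identityʳ _)
  Id-sum {suc n} (suc i) f = trans (+-cong (zeroˡ _) (Id-sum i (λ l → f (suc l)))) (+-identityˡ _)

  Id-sym : ∀ {n} (i j : Fin n) → Id i j ≈ Id j i
  Id-sym i j = δ-sym (toℕ i) (toℕ j)

  Id-sum' : ∀ {n} (j : Fin n) (f : Fin n → Carrier) → sumFin (λ l → f l * Id l j) ≈ f j
  Id-sum' {n} j f = trans (sumFin-cong n (λ l → trans (*-comm _ _) (*-congʳ (Id-sym l j)))) (Id-sum j f)

  Id-· : ∀ {m n} (X : Mat m n) → Id · X ≋ X
  Id-· X i j = Id-sum i (λ l → X l j)

  ·-Id : ∀ {m n} (X : Mat m n) → X · Id ≋ X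
  ·-Id X i j = Id-sum' j (λ l → X i l)

  intertwiner⇒≅ : (V W : Rep) (ι : Mat (dim V) (dim W)) (π : Mat (dim W) (dim V)) →
          π · ι ≋ Id → ι · π ≋ Id →
          ρA V · ι ≋ ι · ρA W → ρB V · ι ≋ ι · ρB W → V ≅ W
  intertwiner⇒≅ V W ι π πι ιπ cA cB = record
    { to = π ; from = ι ; from∘to = ιπ ; to∘from = πι
    ; comm-A = comm (ρA V) (ρA W) cA ; comm-B = comm (ρB V) (ρB W) cB }
    where
    comm : (RV : Mat (dim V) (dim V)) (RW : Mat (dim W) (dim W)) → RV · ι ≋ ι · RW → π · RV ≋ RW · π
    comm RV RW c =
      ≋-trans (≋-sym (·-Id (π · RV))) (
      ≋-trans (·-cong (≋-refl {X = π · RV}) (≋-sym ιπ)) (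
      ≋-trans (≋-sym (·-assoc (π · RV) ι π)) (
      ≋-trans (·-cong (·-assoc π RV ι) (≋-refl {X = π})) (
      ≋-trans (·-cong (·-cong (≋-refl {X = π}) c) (≋-refl {X = π})) (
      ≋-trans (·-cong (≋-sym (·-assoc π ι RW)) (≋-refl {X = π})) (
      ≋-trans (·-cong (·-cong πι (≋-refl {X = RW})) (≋-refl {X = π})) (
      ·-cong (Id-· RW) (≋-refl {X = π}))))))))

  ≅-trans : ∀ {U V W} → U ≅ V → V ≅ W → U ≅ W
  ≅-trans {U} {V} {W} f g = record
    { to = tg · tf ; from = ff · fg
    ; from∘to = ≋-trans (·-assoc ff fg (tg · tf))
        (≋-trans (·-cong (≋-refl {X = ff}) (≋-trans (≋-sym (·-assoc fg tg tf))
        (≋-trans (·-cong G.from∘to (≋-refl {X = tf})) (Id-· tf)))) F.from∘to)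
    ; to∘from = ≋-trans (·-assoc tg tf (ff · fg))
        (≋-trans (·-cong (≋-refl {X = tg}) (≋-trans (≋-sym (·-assoc tf ff fg))
        (≋-trans (·-cong F.to∘from (≋-refl {X = fg})) (Id-· fg)))) G.to∘from)
    ; comm-A = cm (ρA U) (ρA V) (ρA W) F.comm-A G.comm-A
    ; comm-B = cm (ρB U) (ρB V) (ρB W) F.comm-B G.comm-B
    }
    where module F = _≅_ f
          module G = _≅_ g
          tf = F.to
          ff = F.from
          tg = G.to
          fg = G.from
          cm : ∀ RU RV RW → tf · RU ≋ RV · tf → tg · RV ≋ RW · tg → (tg · tf) · RU ≋ RW · (tg · tf)
          cm RU RV RW p q = ≋-trans (·-assoc tg tf RU)
              (≋-trans (·-cong (≋-refl {X = tg}) p) (≋-trans (≋-sym (·-assoc tg RV tf))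
              (≋-trans (·-cong q (≋-refl {X = tf})) (·-assoc RW tg tf))))

  blockEntry : ∀ {a b c d} → Mat a b → Mat c d → Fin a ⊎ Fin c → Fin b ⊎ Fin d → Carrier
  blockEntry X Y (inj₁ i) (inj₁ j) = X i j
  blockEntry X Y (inj₁ i) (inj₂ j) = 0#
  blockEntry X Y (inj₂ i) (inj₁ j) = 0#
  blockEntry X Y (inj₂ i) (inj₂ j) = Y i j

  blockMat : ∀ {a b c d} → Mat a b → Mat c d → Mat (a ℕ.+ c) (b ℕ.+ d)
  blockMat {a} {b} X Y i j = blockEntry X Y (splitAt a i) (splitAt b j)

  blockDiag≋blockMat : ∀ {m n} (X : Mat m m) (Y : Mat n n) → blockDiag X Y ≋ blockMat X Y
  blockDiag≋blockMat {m} X Y i j with splitAt m i | splitAt m j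
  ... | inj₁ _ | inj₁ _ = refl
  ... | inj₁ _ | inj₂ _ = refl
  ... | inj₂ _ | inj₁ _ = refl
  ... | inj₂ _ | inj₂ _ = refl

  blockMat-cong : ∀ {a b c d} {X X' : Mat a b} {Y Y' : Mat c d} → X ≋ X' → Y ≋ Y' → blockMat X Y ≋ blockMat X' Y'
  blockMat-cong {a} {b} p q i j with splitAt a i | splitAt b j
  ... | inj₁ i' | inj₁ j' = p i' j'
  ... | inj₁ _ | inj₂ _ = refl
  ... | inj₂ _ | inj₁ _ = refl
  ... | inj₂ i' | inj₂ j' = q i' j'

  blockMat-· : ∀ {a b c d e f} (X : Mat a b) (Y : Mat c d) (X' : Mat b e) (Y' : Mat d f) →
          blockMat X Y · blockMat X' Y' ≋ blockMat (X · X') (Y · Y')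
  blockMat-· {a} {b} {c} {d} {e} {f} X Y X' Y' i j = begin
    sumFin {b ℕ.+ d} (λ l → blockEntry X Y (splitAt a i) (splitAt b l) * blockEntry X' Y' (splitAt b l) (splitAt e j))
      ≈⟨ sumFin-↑ b d _ ⟩
    sumFin {b} (λ l → blockEntry X Y (splitAt a i) (splitAt b (l ↑ˡ d)) * blockEntry X' Y' (splitAt b (l ↑ˡ d)) (splitAt e j))
      + sumFin {d} (λ l → blockEntry X Y (splitAt a i) (splitAt b (b ↑ʳ l)) * blockEntry X' Y' (splitAt b (b ↑ʳ l)) (splitAt e j))
      ≈⟨ +-cong (sumFin-cong b (λ l → reflexive
          (≡.cong₂ (λ u v → blockEntry X Y (splitAt a i) u * blockEntry X' Y' v (splitAt e j))
          (FinP.splitAt-↑ˡ b l d) (FinP.splitAt-↑ˡ b l d))))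
                (sumFin-cong d (λ l → reflexive (≡.cong₂
                    (λ u v → blockEntry X Y (splitAt a i) u * blockEntry X' Y' v (splitAt e j))
                    (FinP.splitAt-↑ʳ b d l) (FinP.splitAt-↑ʳ b d l)))) ⟩
    sumFin {b} (λ l → blockEntry X Y (splitAt a i) (inj₁ l) * blockEntry X' Y' (inj₁ l) (splitAt e j))
      + sumFin {d} (λ l → blockEntry X Y (splitAt a i) (inj₂ l) * blockEntry X' Y' (inj₂ l) (splitAt e j))
      ≈⟨ lem (splitAt a i) (splitAt e j) ⟩
    blockEntry (X · X') (Y · Y') (splitAt a i) (splitAt e j) ∎
    where
    z1 : ∀ n (g : Fin n → Carrier) → sumFin (λ l → 0# * g l) ≈ 0#
    z1 n g = trans (sumFin-cong n (λ l → zeroˡ _)) (sumFin-0 n)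
    z2 : ∀ n (g : Fin n → Carrier) → sumFin (λ l → g l * 0#) ≈ 0#
    z2 n g = trans (sumFin-cong n (λ l → zeroʳ _)) (sumFin-0 n)
    lem : ∀ u v → sumFin {b} (λ l → blockEntry X Y u (inj₁ l) * blockEntry X' Y' (inj₁ l) v)
                 + sumFin {d} (λ l → blockEntry X Y u (inj₂ l) * blockEntry X' Y' (inj₂ l) v) ≈ blockEntry (X · X') (Y · Y') u v
    lem (inj₁ u) (inj₁ v) = trans (+-congˡ (z1 d _)) (+-identityʳ _)
    lem (inj₁ u) (inj₂ v) = trans (+-cong (z2 b _) (z1 d _)) (+-identityʳ _)
    lem (inj₂ u) (inj₁ v) = trans (+-cong (z1 b _) (z2 d _)) (+-identityʳ _)
    lem (inj₂ u) (inj₂ v) = trans (+-congʳ (z1 b _)) (+-identityˡ _)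

  δ-+ˡ : ∀ a x y → δ (a ℕ.+ x) (a ℕ.+ y) ≈ δ x y
  δ-+ˡ zero x y = refl
  δ-+ˡ (suc a) x y = δ-+ˡ a x y

  blockMat-Id : ∀ {a c} → blockMat {a} {a} {c} {c} Id Id ≋ Id
  blockMat-Id {a} {c} i j with splitAt a i in ei | splitAt a j in ej
  ... | inj₁ i' | inj₁ j' = trans (reflexive
      (≡.cong₂ (λ u v → δ u v) (≡.sym (FinP.toℕ-↑ˡ i' c)) (≡.sym (FinP.toℕ-↑ˡ j' c))))
      (reflexive (≡.cong₂ (λ u v → Id u v) (FinP.splitAt⁻¹-↑ˡ ei) (FinP.splitAt⁻¹-↑ˡ ej)))
  ... | inj₂ i' | inj₂ j' = trans (sym (δ-+ˡ a (toℕ i') (toℕ j')))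
      (trans (reflexive (≡.cong₂ (λ u v → δ u v) (≡.sym (FinP.toℕ-↑ʳ a i')) (≡.sym (FinP.toℕ-↑ʳ a j'))))
                               (reflexive (≡.cong₂ (λ u v → Id u v) (FinP.splitAt⁻¹-↑ʳ ei) (FinP.splitAt⁻¹-↑ʳ ej))))
  ... | inj₁ i' | inj₂ j' = sym (trans (reflexive
      (≡.cong₂ (λ u v → Id u v) (≡.sym (FinP.splitAt⁻¹-↑ˡ ei)) (≡.sym (FinP.splitAt⁻¹-↑ʳ ej)))) (δ-≢ _ _ ne))
    where
    ne : toℕ (i' ↑ˡ c) ≢ toℕ (a ↑ʳ j')
    ne e = ℕP.<⇒≢ (≡.subst₂ ℕ._<_ (≡.sym (FinP.toℕ-↑ˡ i' c)) ≡.refl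
        (ℕP.<-≤-trans (FinP.toℕ<n i') (ℕP.m≤m+n a (toℕ j')))) (≡.trans e (FinP.toℕ-↑ʳ a j'))
  ... | inj₂ i' | inj₁ j' = sym (trans (reflexive
      (≡.cong₂ (λ u v → Id u v) (≡.sym (FinP.splitAt⁻¹-↑ʳ ei)) (≡.sym (FinP.splitAt⁻¹-↑ˡ ej)))) (δ-≢ _ _ ne))
    where
    ne : toℕ (a ↑ʳ i') ≢ toℕ (j' ↑ˡ c)
    ne e = ℕP.<⇒≢ (≡.subst₂ ℕ._<_ (≡.sym (FinP.toℕ-↑ˡ j' c)) (≡.sym (FinP.toℕ-↑ʳ a i'))
        (ℕP.<-≤-trans (FinP.toℕ<n j') (ℕP.m≤m+n a (toℕ i')))) (≡.sym e)

  ⊕-congʳ : ∀ (L : Rep) {X Y : Rep} → X ≅ Y → (L ⊕ X) ≅ (L ⊕ Y)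
  ⊕-congʳ L {X} {Y} g = record
    { to = blockMat I t ; from = blockMat I f
    ; from∘to = ≋-trans (blockMat-· I f I t) (≋-trans (blockMat-cong (Id-· I) G.from∘to) (blockMat-Id {dim L} {dim X}))
    ; to∘from = ≋-trans (blockMat-· I t I f) (≋-trans (blockMat-cong (Id-· I) G.to∘from) (blockMat-Id {dim L} {dim Y}))
    ; comm-A = cm (ρA L) (ρA X) (ρA Y) G.comm-A
    ; comm-B = cm (ρB L) (ρB X) (ρB Y) G.comm-B
    }
    where
    module G = _≅_ g
    t = G.to
    f = G.from
    I : Mat (dim L) (dim L)
    I = Id
    cm : ∀ RL RX RY → t · RX ≋ RY · t → blockMat I t · blockDiag RL RX ≋ blockDiag RL RY · blockMat I t
    cm RL RX RY p =
      ≋-trans (·-cong (≋-refl {X = blockMat I t}) (blockDiag≋blockMat RL RX)) (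
      ≋-trans (blockMat-· I t RL RX) (
      ≋-trans (blockMat-cong (≋-trans (Id-· RL) (≋-sym (·-Id RL))) p) (
      ≋-trans (≋-sym (blockMat-· RL RY I t)) (
      ·-cong (≋-sym (blockDiag≋blockMat RL RY)) (≋-refl {X = blockMat I t})))))

module TensorIndices {c ℓ : Level} (𝔽 : ACF0 c ℓ) where
  open Matrices 𝔽 public

  fstIndex : ∀ {a} b → Fin (a ℕ.* b) → ℕ
  fstIndex {a} b x = toℕ (proj₁ (remQuot {a} b x))
  sndIndex : ∀ {a} b → Fin (a ℕ.* b) → ℕ
  sndIndex {a} b x = toℕ (proj₂ (remQuot {a} b x))

  sumFin-tensor : ∀ a b (h : ℕ → ℕ → Carrier) → sumFin {a ℕ.* b}
      (λ x → h (fstIndex {a} b x) (sndIndex {a} b x)) ≈ ΣN a (λ i → ΣN b (λ j → h i j))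
  sumFin-tensor a b h = begin
    sumFin {a ℕ.* b} (λ x → h (fstIndex {a} b x) (sndIndex {a} b x)) ≈⟨ sumFin-combine a b _ ⟩
    sumFin {a} (λ i → sumFin {b} (λ j → h (fstIndex {a} b (combine i j)) (sndIndex {a} b (combine i j))))
      ≈⟨ sumFin-cong a (λ i → sumFin-cong b (λ j → reflexive
          (≡.cong (λ p → h (toℕ (proj₁ p)) (toℕ (proj₂ p))) (FinP.remQuot-combine i j)))) ⟩
    sumFin {a} (λ i → sumFin {b} (λ j → h (toℕ i) (toℕ j))) ≈⟨ sumFin-cong a (λ i → sumFin-toℕ b _) ⟩
    sumFin {a} (λ i → ΣN b (λ j → h (toℕ i) j)) ≈⟨ sumFin-toℕ a (λ i → ΣN b (λ j → h i j)) ⟩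
    ΣN a (λ i → ΣN b (λ j → h i j)) ∎

  Id-tensor : ∀ a b (x y : Fin (a ℕ.* b)) → Id x y ≈ δ (fstIndex {a} b x) (fstIndex {a} b y) * δ
      (sndIndex {a} b x) (sndIndex {a} b y)
  Id-tensor a b x y with x Fin.≟ y
  ... | yes ≡.refl = trans (δ-refl (toℕ x))
      (sym (trans (*-cong (δ-refl (fstIndex {a} b x)) (δ-refl (sndIndex {a} b x))) (*-identityˡ _)))
  ... | no x≢y = trans (δ-≢ _ _ (λ e → x≢y (FinP.toℕ-injective e))) (sym lem)
    where
    lem : δ (fstIndex {a} b x) (fstIndex {a} b y) * δ (sndIndex {a} b x) (sndIndex {a} b y) ≈ 0#
    lem with fstIndex {a} b x ℕ.≟ fstIndex {a} b y | sndIndex {a} b x ℕ.≟ sndIndex {a} b y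
    ... | yes e1 | yes e2 = ⊥-elim (x≢y (≡.trans (≡.sym (FinP.combine-remQuot {a} b x))
        (≡.trans (≡.cong₂ combine (FinP.toℕ-injective e1) (FinP.toℕ-injective e2)) (FinP.combine-remQuot {a} b y))))
    ... | no ne | _ = trans (*-congʳ (δ-≢ (fstIndex {a} b x) (fstIndex {a} b y) ne)) (zeroˡ _)
    ... | yes _ | no ne = trans (*-congˡ (δ-≢ (sndIndex {a} b x) (sndIndex {a} b y) ne)) (zeroʳ _)

  sumFin-splitAt : ∀ c d (h : Fin c ⊎ Fin d → Carrier) → sumFin {c ℕ.+ d}
      (λ w → h (splitAt c w)) ≈ sumFin {c} (λ k → h (inj₁ k)) + sumFin {d} (λ v → h (inj₂ v))
  sumFin-splitAt c d h = trans (sumFin-↑ c d _)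
      (+-cong (sumFin-cong c (λ k → reflexive (≡.cong h (FinP.splitAt-↑ˡ c k d))))
      (sumFin-cong d (λ v → reflexive (≡.cong h (FinP.splitAt-↑ʳ c d v)))))

  fstIndex< : ∀ {a} b (x : Fin (a ℕ.* b)) → fstIndex {a} b x < a
  fstIndex< b x = FinP.toℕ<n _
  sndIndex< : ∀ {a} b (x : Fin (a ℕ.* b)) → sndIndex {a} b x < b
  sndIndex< b x = FinP.toℕ<n _

module Sl2Matrices {c ℓ : Level} (𝔽 : ACF0 c ℓ) where
  open TensorIndices 𝔽 public

  -- Eₙ, Fₙ, Hₙ with entries indexed by ℕ: Eₙ n r s is definitionally Eᴺ n (toℕ r) (toℕ s).
  Eᴺ Fᴺ Hᴺ : ℕ → ℕ → ℕ → Carrier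
  Eᴺ n r s = if s ≡ᵇ suc r then fromℕ (n ∸ r) else 0#
  Fᴺ n r s = if r ≡ᵇ suc s then fromℕ r else 0#
  Hᴺ n r s = if r ≡ᵇ s then fromℕ n - fromℕ (2 ℕ.* s) else 0#

  if≡ᵇ-δ : ∀ s t x → (if s ≡ᵇ t then x else 0#) ≈ x * δ s t
  if≡ᵇ-δ s t x with s ≡ᵇ t
  ... | true = sym (*-identityʳ _)
  ... | false = sym (zeroʳ _)

  Eᴺ-row : ∀ n r (g : ℕ → Carrier) → r ≤ n → ΣN (suc n) (λ s → Eᴺ n r s * g s) ≈ fromℕ (n ∸ r) * g (suc r)
  Eᴺ-row n r g r≤n = begin
    ΣN (suc n) (λ s → Eᴺ n r s * g s) ≈⟨ ΣN-cong (suc n)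
        (λ s → trans (*-congʳ (trans (if≡ᵇ-δ s (suc r) _) (*-congˡ (δ-sym s (suc r)))))
        (*-assoc (fromℕ (n ∸ r)) (δ (suc r) s) (g s))) ⟩
    ΣN (suc n) (λ s → fromℕ (n ∸ r) * (δ (suc r) s * g s)) ≈⟨ sym (ΣN-*ˡ (suc n) (fromℕ (n ∸ r)) (λ s → δ (suc r) s * g s)) ⟩
    fromℕ (n ∸ r) * ΣN (suc n) (λ s → δ (suc r) s * g s) ≈⟨ lem (ℕP.m≤n⇒m<n∨m≡n r≤n) ⟩
    fromℕ (n ∸ r) * g (suc r) ∎
    where
    lem : r < n ⊎ r ≡ n → fromℕ (n ∸ r) * ΣN (suc n) (λ s → δ (suc r) s * g s) ≈ fromℕ (n ∸ r) * g (suc r)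
    lem (inj₁ r<n) = *-congˡ (ΣN-δ (suc n) (suc r) g (s≤s r<n))
    lem (inj₂ ≡.refl) = trans (*-congʳ (reflexive (≡.cong fromℕ (ℕP.n∸n≡0 r))))
        (trans (zeroˡ _) (sym (trans (*-congʳ (reflexive (≡.cong fromℕ (ℕP.n∸n≡0 r)))) (zeroˡ _))))

  Ecol : ℕ → ℕ → (ℕ → Carrier) → Carrier
  Ecol n zero g = 0#
  Ecol n (suc s) g = g s * fromℕ (n ∸ s)

  ΣN-≈0 : ∀ n (F : ℕ → Carrier) → (∀ s → F s ≈ 0#) → ΣN n F ≈ 0#
  ΣN-≈0 n F h = trans (ΣN-cong n h) (ΣN-0 n)

  Eᴺ-col : ∀ n s (g : ℕ → Carrier) → s ≤ n → ΣN (suc n) (λ r → g r * Eᴺ n r s) ≈ Ecol n s g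
  Eᴺ-col n zero g _ = ΣN-≈0 (suc n) _ (λ r → zeroʳ (g r))
  Eᴺ-col n (suc s) g ss≤n = begin
    ΣN (suc n) (λ r → g r * Eᴺ n r (suc s)) ≈⟨ ΣN-cong (suc n)
        (λ r → trans (*-congˡ (if≡ᵇ-δ (suc s) (suc r) (fromℕ (n ∸ r))))
        (trans (sym (*-assoc (g r) (fromℕ (n ∸ r)) (δ s r))) (*-congˡ (δ-sym s r)))) ⟩
    ΣN (suc n) (λ r → (g r * fromℕ (n ∸ r)) * δ r s) ≈⟨ ΣN-δʳ (suc n) s (λ r → g r * fromℕ (n ∸ r)) (ℕP.m≤n⇒m≤1+n ss≤n) ⟩
    g s * fromℕ (n ∸ s) ∎

  Frow : ℕ → (ℕ → Carrier) → Carrier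
  Frow zero g = 0#
  Frow (suc r) g = fromℕ (suc r) * g r

  Fᴺ-row : ∀ n r (g : ℕ → Carrier) → r ≤ n → ΣN (suc n) (λ s → Fᴺ n r s * g s) ≈ Frow r g
  Fᴺ-row n zero g _ = ΣN-≈0 (suc n) _ (λ s → zeroˡ (g s))
  Fᴺ-row n (suc r) g r≤n = begin
    ΣN (suc n) (λ s → Fᴺ n (suc r) s * g s) ≈⟨ ΣN-cong (suc n)
        (λ s → trans (*-congʳ {g s} (if≡ᵇ-δ r s (fromℕ (suc r))))
        (trans (*-assoc (fromℕ (suc r)) (δ r s) (g s)) (*-congˡ (*-comm (δ r s) (g s))))) ⟩
    ΣN (suc n) (λ s → fromℕ (suc r) * (g s * δ r s)) ≈⟨ sym (ΣN-*ˡ (suc n) (fromℕ (suc r)) (λ s → g s * δ r s)) ⟩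
    fromℕ (suc r) * ΣN (suc n) (λ s → g s * δ r s) ≈⟨ *-congˡ
        (trans (ΣN-cong (suc n) (λ s → *-congˡ {g s} (δ-sym r s)))
        (ΣN-δʳ (suc n) r g (ℕP.<-≤-trans ℕP.≤-refl (ℕP.m≤n⇒m≤1+n r≤n)))) ⟩
    fromℕ (suc r) * g r ∎

  Fᴺ-col : ∀ n s (g : ℕ → Carrier) → s ≤ n → g (suc n) ≈ 0# → ΣN (suc n) (λ r → g r * Fᴺ n r s) ≈ g (suc s) * fromℕ (suc s)
  Fᴺ-col n s g s≤n gz = begin
    ΣN (suc n) (λ r → g r * Fᴺ n r s) ≈⟨ ΣN-cong (suc n)
        (λ r → trans (*-congˡ (if≡ᵇ-δ r (suc s) (fromℕ r))) (sym (*-assoc (g r) (fromℕ r) (δ r (suc s))))) ⟩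
    ΣN (suc n) (λ r → (g r * fromℕ r) * δ r (suc s)) ≈⟨ lem (ℕP.m≤n⇒m<n∨m≡n s≤n) ⟩
    g (suc s) * fromℕ (suc s) ∎
    where
    lem : s < n ⊎ s ≡ n → ΣN (suc n) (λ r → (g r * fromℕ r) * δ r (suc s)) ≈ g (suc s) * fromℕ (suc s)
    lem (inj₁ s<n) = ΣN-δʳ (suc n) (suc s) (λ r → g r * fromℕ r) (s≤s s<n)
    lem (inj₂ ≡.refl) = trans (ΣN-δʳ-beyond (suc n) (suc s) (λ r → g r * fromℕ r) ℕP.≤-refl) (sym (trans (*-congʳ gz) (zeroˡ _)))

  Hdiag : ℕ → ℕ → Carrier
  Hdiag n s = fromℕ n - fromℕ (2 ℕ.* s)

  Hᴺ-row : ∀ n r (g : ℕ → Carrier) → r ≤ n → ΣN (suc n) (λ s → Hᴺ n r s * g s) ≈ Hdiag n r * g r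
  Hᴺ-row n r g r≤n = begin
    ΣN (suc n) (λ s → Hᴺ n r s * g s) ≈⟨ ΣN-cong (suc n)
        (λ s → trans (*-congʳ {g s} (if≡ᵇ-δ r s (Hdiag n s)))
        (trans (*-assoc (Hdiag n s) (δ r s) (g s))
        (trans (*-congˡ (*-comm (δ r s) (g s))) (trans (sym (*-assoc (Hdiag n s) (g s) (δ r s))) (*-congˡ (δ-sym r s)))))) ⟩
    ΣN (suc n) (λ s → (Hdiag n s * g s) * δ s r) ≈⟨ ΣN-δʳ (suc n) r (λ s → Hdiag n s * g s) (s≤s r≤n) ⟩
    Hdiag n r * g r ∎

  Hᴺ-col : ∀ n s (g : ℕ → Carrier) → s ≤ n → ΣN (suc n) (λ r → g r * Hᴺ n r s) ≈ g s * Hdiag n s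
  Hᴺ-col n s g s≤n = begin
    ΣN (suc n) (λ r → g r * Hᴺ n r s) ≈⟨ ΣN-cong (suc n)
        (λ r → trans (*-congˡ (trans (if≡ᵇ-δ r s (Hdiag n s)) (*-comm (Hdiag n s) (δ r s))))
        (trans (sym (*-assoc (g r) (δ r s) (Hdiag n s)))
        (trans (*-congʳ (*-comm (g r) (δ r s))) (trans (*-assoc (δ r s) (g r) (Hdiag n s))
        (*-comm (δ r s) (g r * Hdiag n s)))))) ⟩
    ΣN (suc n) (λ r → (g r * Hdiag n s) * δ r s) ≈⟨ ΣN-δʳ (suc n) s (λ r → g r * Hdiag n s) (s≤s s≤n) ⟩
    g s * Hdiag n s ∎

  -- The entry of X ⊗ 1 + 1 ⊗ Y at (i ⊗ j , i′ ⊗ j′); under fstIndex and sndIndex it is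
  -- definitionally the corresponding entry of ρA or ρB of a tensor product.
  kronSum : (ℕ → ℕ → Carrier) → (ℕ → ℕ → Carrier) → ℕ → ℕ → ℕ → ℕ → Carrier
  kronSum X Y i j i' j' = X i i' * δ j j' + δ i i' * Y j j'

  kronSum-row : ∀ a b (X Y : ℕ → ℕ → Carrier) (g : ℕ → ℕ → Carrier) i j → i < a → j < b →
         ΣN a (λ i' → ΣN b (λ j' → kronSum X Y i j i' j' * g i' j')) ≈ ΣN a (λ i' → X i i' * g i' j) + ΣN b
             (λ j' → Y j j' * g i j')
  kronSum-row a b X Y g i j i<a j<b = begin
    ΣN a (λ i' → ΣN b (λ j' → kronSum X Y i j i' j' * g i' j'))
      ≈⟨ ΣN-cong a (λ i' → trans (ΣN-cong b {g = λ j' → X i i' * (δ j j' * g i' j') + δ i i' *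
          (Y j j' * g i' j')} (λ j' → trans (distribʳ _ _ _) (+-cong (*-assoc _ _ _) (*-assoc _ _ _))))
          (ΣN-+ b (λ j' → X i i' * (δ j j' * g i' j')) (λ j' → δ i i' * (Y j j' * g i' j')))) ⟩
    ΣN a (λ i' → ΣN b (λ j' → X i i' * (δ j j' * g i' j')) + ΣN b (λ j' → δ i i' * (Y j j' * g i' j')))
      ≈⟨ ΣN-+ a _ _ ⟩
    ΣN a (λ i' → ΣN b (λ j' → X i i' * (δ j j' * g i' j'))) + ΣN a (λ i' → ΣN b (λ j' → δ i i' * (Y j j' * g i' j')))
      ≈⟨ +-cong (ΣN-cong a (λ i' → trans (sym (ΣN-*ˡ b (X i i') (λ j' → δ j j' * g i' j')))
          (*-congˡ {X i i'} (ΣN-δ b j (g i') j<b))))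
                (trans (ΣN-cong a {g = λ i' → δ i i' * ΣN b (λ j' → Y j j' * g i' j')}
                    (λ i' → sym (ΣN-*ˡ b (δ i i') (λ j' → Y j j' * g i' j'))))
                    (ΣN-δ a i (λ i' → ΣN b (λ j' → Y j j' * g i' j')) i<a)) ⟩
    ΣN a (λ i' → X i i' * g i' j) + ΣN b (λ j' → Y j j' * g i j') ∎

  kronSum-col : ∀ a b (X Y : ℕ → ℕ → Carrier) (g : ℕ → ℕ → Carrier) i j → i < a → j < b →
         ΣN a (λ i' → ΣN b (λ j' → g i' j' * kronSum X Y i' j' i j)) ≈ ΣN a (λ i' → g i' j * X i' i) + ΣN b
             (λ j' → g i j' * Y j' j)
  kronSum-col a b X Y g i j i<a j<b = begin
    ΣN a (λ i' → ΣN b (λ j' → g i' j' * kronSum X Y i' j' i j))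
      ≈⟨ ΣN-cong a (λ i' → ΣN-cong b (λ j' → trans (*-comm _ _)
          (*-congʳ {g i' j'} (+-cong (*-congˡ (δ-sym j' j)) (*-congʳ (δ-sym i' i)))))) ⟩
    ΣN a (λ i' → ΣN b (λ j' → kronSum (λ u v → X v u) (λ u v → Y v u) i j i' j' * g i' j'))
      ≈⟨ kronSum-row a b (λ u v → X v u) (λ u v → Y v u) g i j i<a j<b ⟩
    ΣN a (λ i' → X i' i * g i' j) + ΣN b (λ j' → Y j' j * g i j')
      ≈⟨ +-cong (ΣN-cong a (λ i' → *-comm _ _)) (ΣN-cong b (λ j' → *-comm _ _)) ⟩
    ΣN a (λ i' → g i' j * X i' i) + ΣN b (λ j' → g i j' * Y j' j) ∎

  δ-sub : ∀ i a (F : ℕ → Carrier) → δ i a * F i ≈ δ i a * F a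
  δ-sub i a F with i ℕ.≟ a
  ... | yes ≡.refl = refl
  ... | no ne = trans (*-congʳ {F i} (δ-≢ i a ne)) (trans (zeroˡ _) (sym (trans (*-congʳ {F a} (δ-≢ i a ne)) (zeroˡ _))))

  δ-when : ∀ u v {F F' : Carrier} → (u ≡ v → F ≈ F') → δ u v * F ≈ δ u v * F'
  δ-when u v {F} {F'} h with u ℕ.≟ v
  ... | yes e = *-congˡ {δ u v} (h e)
  ... | no ne = trans (*-congʳ {F} (δ-≢ u v ne)) (trans (zeroˡ _) (sym (trans (*-congʳ {F'} (δ-≢ u v ne)) (zeroˡ _))))

  δδ-when : ∀ u v u' v' {F F' : Carrier} → (u ≡ v → u' ≡ v' → F ≈ F') → (δ u v * δ u' v') * F ≈ (δ u v * δ u' v') * F'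
  δδ-when u v u' v' {F} {F'} h = begin
    (δ u v * δ u' v') * F ≈⟨ *-assoc _ _ _ ⟩
    δ u v * (δ u' v' * F) ≈⟨ δ-when u v (λ e → δ-when u' v' (λ e' → h e e')) ⟩
    δ u v * (δ u' v' * F') ≈⟨ sym (*-assoc _ _ _) ⟩
    (δ u v * δ u' v') * F' ∎

  -- ζ(A) = αA E + βA F + γA H and ζ(B) = ½ H, entrywise on L_n.
  Aᴺ : Carrier → Carrier → Carrier → ℕ → ℕ → ℕ → Carrier
  Aᴺ α β γ n r s = (α * Eᴺ n r s + β * Fᴺ n r s) + γ * Hᴺ n r s

  αA βA γA : Carrier → Carrier
  αA ω = ½ * (1# + ω)
  βA ω = ½ * (1# - ω)
  γA ω = - (½ * ω)

  ρB≈Aᴺ : ∀ n r s → ½ * Hᴺ n r s ≈ Aᴺ 0# 0# ½ n r s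
  ρB≈Aᴺ n r s = solve 4 (λ h e f x → h :* x := (con (+ 0) :* e :+ con (+ 0) :* f) :+ h :* x) refl ½
      (Eᴺ n r s) (Fᴺ n r s) (Hᴺ n r s)

  ρB⊗≈kronSum : ∀ n1 n2 i j i' j' → (½ * Hᴺ n1 i i') * δ j j' + δ i i' * (½ * Hᴺ n2 j j') ≈ kronSum
      (Aᴺ 0# 0# ½ n1) (Aᴺ 0# 0# ½ n2) i j i' j'
  ρB⊗≈kronSum n1 n2 i j i' j' = solve 9 (λ h e1 f1 h1 e2 f2 h2 d1 d2 →
      (h :* h1) :* d2 :+ d1 :* (h :* h2) := ((con (+ 0) :* e1 :+ con (+ 0) :* f1) :+ h :* h1) :* d2 :+ d1 :*
          ((con (+ 0) :* e2 :+ con (+ 0) :* f2) :+ h :* h2)) refl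
      ½ (Eᴺ n1 i i') (Fᴺ n1 i i') (Hᴺ n1 i i') (Eᴺ n2 j j') (Fᴺ n2 j j') (Hᴺ n2 j j') (δ i i') (δ j j')

  module LinearCombination (α β γ : Carrier) where
    lin3 : ∀ k (f g h : ℕ → Carrier) → ΣN k (λ t → α * f t + β * g t + γ * h t) ≈ α * ΣN k f + β * ΣN k g + γ * ΣN k h
    lin3 k f g h = begin
      ΣN k (λ t → α * f t + β * g t + γ * h t) ≈⟨ ΣN-+ k (λ t → α * f t + β * g t) (λ t → γ * h t) ⟩
      ΣN k (λ t → α * f t + β * g t) + ΣN k (λ t → γ * h t) ≈⟨ +-congʳ (ΣN-+ k (λ t → α * f t) (λ t → β * g t)) ⟩
      ΣN k (λ t → α * f t) + ΣN k (λ t → β * g t) + ΣN k (λ t → γ * h t)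
        ≈⟨ sym (+-cong (+-cong (ΣN-*ˡ k α f) (ΣN-*ˡ k β g)) (ΣN-*ˡ k γ h)) ⟩
      α * ΣN k f + β * ΣN k g + γ * ΣN k h ∎

    lin3² : ∀ a b (f g h : ℕ → ℕ → Carrier) → ΣN a (λ i → ΣN b (λ j → α * f i j + β * g i j + γ * h i j)) ≈
            α * ΣN a (λ i → ΣN b (f i)) + β * ΣN a (λ i → ΣN b (g i)) + γ * ΣN a (λ i → ΣN b (h i))
    lin3² a b f g h = trans (ΣN-cong a {g = λ i → α * ΣN b (f i) + β * ΣN b (g i) + γ * ΣN b (h i)}
        (λ i → lin3 b (f i) (g i) (h i))) (lin3 a (λ i → ΣN b (f i)) (λ i → ΣN b (g i)) (λ i → ΣN b (h i)))

    A' : ℕ → ℕ → ℕ → Carrier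
    A' = Aᴺ α β γ

    linTl : ∀ n1 n2 i j i' j' G → kronSum (A' n1) (A' n2) i j i' j' * G ≈
            α * (kronSum (Eᴺ n1) (Eᴺ n2) i j i' j' * G) + β * (kronSum (Fᴺ n1) (Fᴺ n2) i j i' j' * G) + γ *
                (kronSum (Hᴺ n1) (Hᴺ n2) i j i' j' * G)
    linTl n1 n2 i j i' j' G = solve 12 (λ α β γ e1 f1 h1 e2 f2 h2 d1 d2 G →
        (((α :* e1 :+ β :* f1) :+ γ :* h1) :* d2 :+ d1 :* ((α :* e2 :+ β :* f2) :+ γ :* h2)) :* G
        := α :* ((e1 :* d2 :+ d1 :* e2) :* G) :+ β :* ((f1 :* d2 :+ d1 :* f2) :* G) :+ γ :* ((h1 :* d2 :+ d1 :* h2) :* G)) refl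
        α β γ (Eᴺ n1 i i') (Fᴺ n1 i i') (Hᴺ n1 i i') (Eᴺ n2 j j') (Fᴺ n2 j j') (Hᴺ n2 j j') (δ i i') (δ j j') G

    linTr : ∀ n1 n2 i j i' j' G → G * kronSum (A' n1) (A' n2) i j i' j' ≈
            α * (G * kronSum (Eᴺ n1) (Eᴺ n2) i j i' j') + β * (G * kronSum (Fᴺ n1) (Fᴺ n2) i j i' j') + γ *
                (G * kronSum (Hᴺ n1) (Hᴺ n2) i j i' j')
    linTr n1 n2 i j i' j' G = solve 12 (λ α β γ e1 f1 h1 e2 f2 h2 d1 d2 G →
        G :* (((α :* e1 :+ β :* f1) :+ γ :* h1) :* d2 :+ d1 :* ((α :* e2 :+ β :* f2) :+ γ :* h2))
        := α :* (G :* (e1 :* d2 :+ d1 :* e2)) :+ β :* (G :* (f1 :* d2 :+ d1 :* f2)) :+ γ :* (G :* (h1 :* d2 :+ d1 :* h2))) refl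
        α β γ (Eᴺ n1 i i') (Fᴺ n1 i i') (Hᴺ n1 i i') (Eᴺ n2 j j') (Fᴺ n2 j j') (Hᴺ n2 j j') (δ i i') (δ j j') G

    linA : ∀ n' k k0 G → G * A' n' k k0 ≈ α * (G * Eᴺ n' k k0) + β * (G * Fᴺ n' k k0) + γ * (G * Hᴺ n' k k0)
    linA n' k k0 G = solve 7 (λ α β γ e f h G → G :* ((α :* e :+ β :* f) :+ γ :* h) := α :* (G :* e) :+ β :*
        (G :* f) :+ γ :* (G :* h)) refl
        α β γ (Eᴺ n' k k0) (Fᴺ n' k k0) (Hᴺ n' k k0) G

binom : ℕ → ℕ → ℕ
binom n zero = 1
binom zero (suc k) = 0
binom (suc n) (suc k) = binom n k ℕ.+ binom n (suc k)

binom-1 : ∀ n → binom n 1 ≡ n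
binom-1 zero = ≡.refl
binom-1 (suc n) = ≡.cong suc (binom-1 n)

binom-beyond : ∀ n k → n < k → binom n k ≡ 0
binom-beyond zero (suc k) _ = ≡.refl
binom-beyond (suc n) (suc k) (s≤s n<k) = ≡.cong₂ ℕ._+_ (binom-beyond n k n<k) (binom-beyond n (suc k) (ℕP.m≤n⇒m≤1+n n<k))

binom-pos : ∀ n k → k ≤ n → 0 < binom n k
binom-pos n zero _ = s≤s z≤n
binom-pos (suc n) (suc k) (s≤s k≤n) = ℕP.<-≤-trans (binom-pos n k k≤n) (ℕP.m≤m+n _ _)

∸-suc : ∀ n k → k < n → n ∸ k ≡ suc (n ∸ suc k)
∸-suc (suc n) zero _ = ≡.refl
∸-suc (suc n) (suc k) (s≤s k<n) = ∸-suc n k k<n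

∸-+-distrib : ∀ M N i j → i ≤ M → j ≤ N → (M ∸ i) ℕ.+ (N ∸ j) ≡ (M ℕ.+ N) ∸ (i ℕ.+ j)
∸-+-distrib M N i j i≤M j≤N = ≡.sym (≡.trans (≡.sym (ℕP.∸-+-assoc (M ℕ.+ N) i j))
    (≡.trans (≡.cong (_∸ j) (ℕP.+-∸-comm N i≤M)) (ℕP.+-∸-assoc (M ∸ i) j≤N)))

binom-absorb : ∀ n k → binom n (suc k) ℕ.* suc k ≡ binom n k ℕ.* (n ∸ k)
binom-absorb zero k = ≡.sym (≡.trans (≡.cong (binom zero k ℕ.*_) (ℕP.0∸n≡0 k)) (ℕP.*-zeroʳ (binom zero k)))
binom-absorb (suc n) zero = ≡.trans (ℕP.*-identityʳ _) (≡.cong suc (≡.trans (binom-1 n) (≡.sym (ℕP.+-identityʳ n))))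
binom-absorb (suc n) (suc k) with k ℕ.<? n
... | yes k<n = begin
    (x ℕ.+ y) ℕ.* suc (suc k) ≡⟨ ℕP.*-distribʳ-+ (suc (suc k)) x y ⟩
    x ℕ.* suc (suc k) ℕ.+ y ℕ.* suc (suc k) ≡⟨ ≡.cong (x ℕ.* suc (suc k) ℕ.+_) ih2 ⟩
    x ℕ.* suc (suc k) ℕ.+ x ℕ.* d ≡⟨ lem x z d k ih1' ⟩
    (z ℕ.+ x) ℕ.* suc d ≡⟨ ≡.cong ((z ℕ.+ x) ℕ.*_) (≡.sym (∸-suc n k k<n)) ⟩
    (z ℕ.+ x) ℕ.* (n ∸ k) ∎
  where
  open ≡.≡-Reasoning
  x = binom n (suc k)
  y = binom n (suc (suc k))
  z = binom n k
  d = n ∸ suc k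
  ih1 : x ℕ.* suc k ≡ z ℕ.* (n ∸ k)
  ih1 = binom-absorb n k
  ih1' : x ℕ.* suc k ≡ z ℕ.* suc d
  ih1' = ≡.trans ih1 (≡.cong (z ℕ.*_) (∸-suc n k k<n))
  ih2 : y ℕ.* suc (suc k) ≡ x ℕ.* d
  ih2 = binom-absorb n (suc k)
  lem : ∀ x z d k → x ℕ.* suc k ≡ z ℕ.* suc d → x ℕ.* suc (suc k) ℕ.+ x ℕ.* d ≡ (z ℕ.+ x) ℕ.* suc d
  lem x z d k e = begin
    x ℕ.* suc (suc k) ℕ.+ x ℕ.* d ≡⟨ +-*-Solver.solve 3
        (λ x d k → x :* (con 2 :+ k) :+ x :* d := x :* (con 1 :+ k) :+ x :* (con 1 :+ d)) ≡.refl x d k ⟩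
    x ℕ.* suc k ℕ.+ x ℕ.* suc d ≡⟨ ≡.cong (ℕ._+ x ℕ.* suc d) e ⟩
    z ℕ.* suc d ℕ.+ x ℕ.* suc d ≡⟨ ≡.sym (ℕP.*-distribʳ-+ (suc d) z x) ⟩
    (z ℕ.+ x) ℕ.* suc d ∎
    where open +-*-Solver
... | no k≮n = begin
    (binom n (suc k) ℕ.+ binom n (suc (suc k))) ℕ.* suc (suc k) ≡⟨ ≡.cong (λ u → u ℕ.* suc (suc k))
        (≡.cong₂ ℕ._+_ (binom-beyond n (suc k) (s≤s (ℕP.≮⇒≥ k≮n)))
        (binom-beyond n (suc (suc k)) (s≤s (ℕP.m≤n⇒m≤1+n (ℕP.≮⇒≥ k≮n))))) ⟩
    0 ≡⟨ ≡.sym (ℕP.*-zeroʳ (binom n k ℕ.+ binom n (suc k))) ⟩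
    (binom n k ℕ.+ binom n (suc k)) ℕ.* 0 ≡⟨ ≡.cong ((binom n k ℕ.+ binom n (suc k)) ℕ.*_) (≡.sym (ℕP.m≤n⇒m∸n≡0 (ℕP.≮⇒≥ k≮n))) ⟩
    (binom n k ℕ.+ binom n (suc k)) ℕ.* (n ∸ k) ∎
  where open ≡.≡-Reasoning

module BinomialSums {c ℓ : Level} (𝔽 : ACF0 c ℓ) where
  open Sl2Matrices 𝔽 public

  fromℕ-1 : fromℕ 1 ≈ 1#
  fromℕ-1 = +-identityʳ 1#

  vandermondeSum : ℕ → ℕ → ℕ → Carrier
  vandermondeSum M N k = ΣN (suc k) (λ r → fromℕ (binom M r) * fromℕ (binom N (k ∸ r)))

  vandermonde : ∀ M N k → vandermondeSum M N k ≈ fromℕ (binom (M ℕ.+ N) k)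
  vandermonde zero N k = trans (+-cong (trans (*-congʳ {fromℕ (binom N (k ∸ 0))} fromℕ-1) (*-identityˡ _))
      (ΣN-≈0 k _ (λ r → zeroˡ _))) (+-identityʳ _)
  vandermonde (suc M) N zero = trans (+-identityʳ _) (trans (*-congʳ {fromℕ 1} fromℕ-1) (*-identityˡ _))
  vandermonde (suc M) N (suc k) = begin
    fromℕ 1 * fromℕ (binom N (suc k)) + ΣN (suc k) (λ r → fromℕ (binom M r ℕ.+ binom M (suc r)) * fromℕ (binom N (k ∸ r)))
      ≈⟨ +-congˡ (trans (ΣN-cong (suc k) (λ r → trans (*-congʳ {fromℕ (binom N (k ∸ r))} (fromℕ-+ (binom M r) (binom M (suc r)))) (distribʳ _ _ _)))
                        (ΣN-+ (suc k) t₁ t₂)) ⟩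
    fromℕ 1 * fromℕ (binom N (suc k)) + (ΣN (suc k) t₁ + ΣN (suc k) t₂)
      ≈⟨ solve 3 (λ a b c → a :+ (b :+ c) := b :+ (a :+ c)) refl _ _ _ ⟩
    ΣN (suc k) t₁ + (fromℕ 1 * fromℕ (binom N (suc k)) + ΣN (suc k) t₂)
      ≈⟨ +-cong (vandermonde M N k) (vandermonde M N (suc k)) ⟩
    fromℕ (binom (M ℕ.+ N) k) + fromℕ (binom (M ℕ.+ N) (suc k))
      ≈⟨ sym (fromℕ-+ (binom (M ℕ.+ N) k) (binom (M ℕ.+ N) (suc k))) ⟩
    fromℕ (binom (suc M ℕ.+ N) (suc k)) ∎
    where
    t₁ t₂ : ℕ → Carrier
    t₁ r = fromℕ (binom M r) * fromℕ (binom N (k ∸ r))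
    t₂ r = fromℕ (binom M (suc r)) * fromℕ (binom N (k ∸ r))

  step : ℕ → ℕ → Carrier
  step zero a = 1#
  step (suc i) zero = 0#
  step (suc i) (suc a) = step i a

  step-≤ : ∀ i a → i ≤ a → step i a ≈ 1#
  step-≤ zero a _ = refl
  step-≤ (suc i) (suc a) (s≤s i≤a) = step-≤ i a i≤a

  step-> : ∀ i a → a < i → step i a ≈ 0#
  step-> (suc i) zero _ = refl
  step-> (suc i) (suc a) (s≤s a<i) = step-> i a a<i

  step-0 : ∀ x → step x 0 ≈ δ x 0
  step-0 zero = refl
  step-0 (suc x) = refl

  step-diffˡ : ∀ x y → step x y - step (suc x) y ≈ δ x y
  step-diffˡ zero zero = trans (+-congˡ -0#≈0#) (+-identityʳ _)
  step-diffˡ zero (suc y) = trans (+-congˡ (-‿cong (step-≤ 0 y z≤n))) (-‿inverseʳ 1#)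
  step-diffˡ (suc x) zero = trans (+-congˡ -0#≈0#) (+-identityʳ _)
  step-diffˡ (suc x) (suc y) = step-diffˡ x y

  step-diffʳ : ∀ x y → step x (suc y) - step x y ≈ δ x (suc y)
  step-diffʳ zero y = trans (+-congˡ (-‿cong (step-≤ 0 y z≤n))) (-‿inverseʳ 1#)
  step-diffʳ (suc x) y = step-diffˡ x y

  ΣN-step : ∀ n a (F : ℕ → Carrier) → a < n → ΣN n (λ i → step i a * F i) ≈ ΣN (suc a) F
  ΣN-step (suc n) zero F _ = +-cong (*-identityˡ _) (ΣN-≈0 n _ (λ i → zeroˡ _))
  ΣN-step (suc n) (suc a) F (s≤s a<n) = +-cong (*-identityˡ _) (ΣN-step n a (λ i → F (suc i)) a<n)

  ΣN-step-all : ∀ n a (F : ℕ → Carrier) → n ≤ suc a → ΣN n (λ i → step i a * F i) ≈ ΣN n F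
  ΣN-step-all zero a F _ = refl
  ΣN-step-all (suc n) zero F (s≤s z≤n) = +-cong (*-identityˡ _) refl
  ΣN-step-all (suc n) (suc a) F (s≤s n≤sa) = +-cong (*-identityˡ _) (ΣN-step-all n a (λ i → F (suc i)) n≤sa)

  ΣN-pad : ∀ a d (F : ℕ → Carrier) → (∀ r → a ≤ r → F r ≈ 0#) → ΣN (a ℕ.+ d) F ≈ ΣN a F
  ΣN-pad a d F h = trans (ΣN-split a d F) (trans (+-congˡ (ΣN-≈0 d _ (λ i → h (a ℕ.+ i) (ℕP.m≤m+n a i)))) (+-identityʳ _))

  ΣN-δ-shift : ∀ n i k (F : ℕ → Carrier) → (n < k ∸ i → F (k ∸ i) ≈ 0#) → ΣN (suc n)
      (λ j → δ (i ℕ.+ j) k * F j) ≈ step i k * F (k ∸ i)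
  ΣN-δ-shift n i k F Fz with i ℕ.≤? k
  ... | no i≰k = trans (ΣN-≈0 (suc n) _ (λ j → trans
      (*-congʳ {F j} (δ-≢ (i ℕ.+ j) k (λ e → i≰k (≡.subst (i ≤_) e (ℕP.m≤m+n i j))))) (zeroˡ _)))
      (sym (trans (*-congʳ {F (k ∸ i)} (step-> i k (ℕP.≰⇒> i≰k))) (zeroˡ _)))
  ... | yes i≤k = begin
    ΣN (suc n) (λ j → δ (i ℕ.+ j) k * F j) ≈⟨ ΣN-cong (suc n) {g = λ j → δ (k ∸ i) j * F j} (λ j → *-congʳ {F j} (dd j)) ⟩
    ΣN (suc n) (λ j → δ (k ∸ i) j * F j) ≈⟨ lem (k ∸ i ℕ.<? suc n) ⟩
    F (k ∸ i) ≈⟨ sym (trans (*-congʳ {F (k ∸ i)} (step-≤ i k i≤k)) (*-identityˡ _)) ⟩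
    step i k * F (k ∸ i) ∎
    where
    dd : ∀ j → δ (i ℕ.+ j) k ≈ δ (k ∸ i) j
    dd j with (i ℕ.+ j) ℕ.≟ k
    ... | yes e = trans (δ-eq e) (sym (δ-eq (≡.trans (≡.cong (ℕ._∸ i) (≡.sym e)) (ℕP.m+n∸m≡n i j))))
    ... | no ne = trans (δ-≢ _ _ ne) (sym (δ-≢ _ _ (λ e → ne (≡.trans (≡.cong (i ℕ.+_) (≡.sym e)) (ℕP.m+[n∸m]≡n i≤k)))))
    lem : Dec (k ∸ i < suc n) → ΣN (suc n) (λ j → δ (k ∸ i) j * F j) ≈ F (k ∸ i)
    lem (yes p) = ΣN-δ (suc n) (k ∸ i) F p
    lem (no p) = trans (ΣN-δ-beyond (suc n) (k ∸ i) F (ℕP.≮⇒≥ p)) (sym (Fz (ℕP.≤-trans (s≤s ℕP.≤-refl) (ℕP.≮⇒≥ p))))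

  fromℕ-pos≉0 : ∀ x → 0 < x → ¬ (fromℕ x ≈ 0#)
  fromℕ-pos≉0 (suc x) _ = char0 x

  fromℕ-pos-inverse : ∀ x → 0 < x → fromℕ x * inv (fromℕ x) ≈ 1#
  fromℕ-pos-inverse x p = inverse (fromℕ x) (fromℕ-pos≉0 x p)

module Embedding {c ℓ : Level} (𝔽 : ACF0 c ℓ) (m n : ℕ) where
  open BinomialSums 𝔽 public

  M N K : ℕ
  M = suc m
  N = suc n
  K = M ℕ.+ N

  c₁ c₂ : ℕ → ℕ → Carrier
  c₁ a b = fromℕ (M ∸ a) * fromℕ (suc b)
  c₂ a b = fromℕ (suc a) * fromℕ (N ∸ b)

  Ω : ℕ → ℕ → ℕ → ℕ → Carrier
  Ω i j a b = (δ i a * δ j (suc b)) * c₁ a b - (δ i (suc a) * δ j b) * c₂ a b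

  ιtop : ℕ → ℕ → ℕ → Carrier
  ιtop i j k = δ (i ℕ.+ j) k

  ρ⊗·ιtop ιtop·ρ : (ℕ → ℕ → ℕ → Carrier) → ℕ → ℕ → ℕ → Carrier
  ρ⊗·ιtop X i j k0 = ΣN (suc M) (λ i' → ΣN (suc N) (λ j' → kronSum (X M) (X N) i j i' j' * ιtop i' j' k0))
  ιtop·ρ X i j k0 = ΣN (suc K) (λ k → ιtop i j k * X K k k0)

  ρ⊗·Ω Ω·ρ⊗ : (ℕ → ℕ → ℕ → Carrier) → ℕ → ℕ → ℕ → ℕ → Carrier
  ρ⊗·Ω X i j a0 b0 = ΣN (suc M) (λ i' → ΣN (suc N) (λ j' → kronSum (X M) (X N) i j i' j' * Ω i' j' a0 b0))
  Ω·ρ⊗ X i j a0 b0 = ΣN (suc m) (λ a → ΣN (suc n) (λ b → Ω i j a b * kronSum (X m) (X n) a b a0 b0))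

  ιtop-E : ∀ i j k0 → i ≤ M → j ≤ N → k0 ≤ K → ρ⊗·ιtop Eᴺ i j k0 ≈ ιtop·ρ Eᴺ i j k0
  ιtop-E i j k0 i≤M j≤N k0≤K = begin
    ρ⊗·ιtop Eᴺ i j k0 ≈⟨ kronSum-row (suc M) (suc N) (Eᴺ M) (Eᴺ N) ιtop′ i j (s≤s i≤M) (s≤s j≤N) ⟩
    ΣN (suc M) (λ i' → Eᴺ M i i' * ιtop′ i' j) + ΣN (suc N) (λ j' → Eᴺ N j j' * ιtop′ i j')
      ≈⟨ +-cong (Eᴺ-row M i (λ i' → ιtop′ i' j) i≤M) (Eᴺ-row N j (λ j' → ιtop′ i j') j≤N) ⟩
    fromℕ (M ∸ i) * δ (suc i ℕ.+ j) k0 + fromℕ (N ∸ j) * δ (i ℕ.+ suc j) k0 ≈⟨ mid k0 k0≤K ⟩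
    Ecol K k0 (λ k → δ (i ℕ.+ j) k) ≈⟨ sym (Eᴺ-col K k0 (λ k → δ (i ℕ.+ j) k) k0≤K) ⟩
    ιtop·ρ Eᴺ i j k0 ∎
    where
    ιtop′ : ℕ → ℕ → Carrier
    ιtop′ i' j' = ιtop i' j' k0
    e+ : i ℕ.+ suc j ≡ suc (i ℕ.+ j)
    e+ = ℕP.+-suc i j
    mid : ∀ k0 → k0 ≤ K → fromℕ (M ∸ i) * δ (suc i ℕ.+ j) k0 + fromℕ (N ∸ j) * δ (i ℕ.+ suc j) k0 ≈ Ecol K k0
        (λ k → δ (i ℕ.+ j) k)
    mid zero _ = trans (+-cong (zeroʳ _) (trans
        (*-congˡ {fromℕ (N ∸ j)} (reflexive (≡.cong (λ u → δ u 0) e+))) (zeroʳ _))) (+-identityʳ _)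
    mid (suc k') _ = begin
      fromℕ (M ∸ i) * δ (i ℕ.+ j) k' + fromℕ (N ∸ j) * δ (i ℕ.+ suc j) (suc k')
        ≈⟨ +-congˡ (*-congˡ {fromℕ (N ∸ j)} (reflexive (≡.cong (λ u → δ u (suc k')) e+))) ⟩
      fromℕ (M ∸ i) * δ (i ℕ.+ j) k' + fromℕ (N ∸ j) * δ (i ℕ.+ j) k' ≈⟨ sym (distribʳ _ _ _) ⟩
      (fromℕ (M ∸ i) + fromℕ (N ∸ j)) * δ (i ℕ.+ j) k' ≈⟨ *-congʳ {δ (i ℕ.+ j) k'}
          (trans (sym (fromℕ-+ (M ∸ i) (N ∸ j))) (reflexive (≡.cong fromℕ (∸-+-distrib M N i j i≤M j≤N)))) ⟩
      fromℕ (K ∸ (i ℕ.+ j)) * δ (i ℕ.+ j) k' ≈⟨ *-comm _ _ ⟩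
      δ (i ℕ.+ j) k' * fromℕ (K ∸ (i ℕ.+ j)) ≈⟨ δ-sub (i ℕ.+ j) k' (λ u → fromℕ (K ∸ u)) ⟩
      δ (i ℕ.+ j) k' * fromℕ (K ∸ k') ∎



  Ω-E : ∀ i j a0 b0 → i ≤ M → j ≤ N → a0 ≤ m → b0 ≤ n → ρ⊗·Ω Eᴺ i j a0 b0 ≈ Ω·ρ⊗ Eᴺ i j a0 b0
  Ω-E i j a0 b0 i≤M j≤N a0≤m b0≤n = begin
    ρ⊗·Ω Eᴺ i j a0 b0 ≈⟨ kronSum-row (suc M) (suc N) (Eᴺ M) (Eᴺ N) (λ i' j' → Ω i' j' a0 b0) i j (s≤s i≤M) (s≤s j≤N) ⟩
    ΣN (suc M) (λ i' → Eᴺ M i i' * Ω i' j a0 b0) + ΣN (suc N) (λ j' → Eᴺ N j j' * Ω i j' a0 b0)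
      ≈⟨ +-cong (Eᴺ-row M i (λ i' → Ω i' j a0 b0) i≤M) (Eᴺ-row N j (λ j' → Ω i j' a0 b0) j≤N) ⟩
    X * Ω (suc i) j a0 b0 + Y * Ω i (suc j) a0 b0 ≈⟨ mid a0 b0 ⟩
    Ecol m a0 (λ a → Ω i j a b0) + Ecol n b0 (λ b → Ω i j a0 b)
      ≈⟨ sym (+-cong (Eᴺ-col m a0 (λ a → Ω i j a b0) a0≤m) (Eᴺ-col n b0 (λ b → Ω i j a0 b) b0≤n)) ⟩
    ΣN (suc m) (λ a → Ω i j a b0 * Eᴺ m a a0) + ΣN (suc n) (λ b → Ω i j a0 b * Eᴺ n b b0)
      ≈⟨ sym (kronSum-col (suc m) (suc n) (Eᴺ m) (Eᴺ n) (λ a b → Ω i j a b) a0 b0 (s≤s a0≤m) (s≤s b0≤n)) ⟩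
    Ω·ρ⊗ Eᴺ i j a0 b0 ∎
    where
    X = fromℕ (M ∸ i)
    Y = fromℕ (N ∸ j)
    -- fromℕ (suc k) unfolds to 1# + fromℕ k and M ∸ suc a to m ∸ a, so once the δδ-supports
    -- are matched each case is a ring identity in a few atoms.
    mid : ∀ a0 b0 → X * Ω (suc i) j a0 b0 + Y * Ω i (suc j) a0 b0 ≈ Ecol m a0 (λ a → Ω i j a b0) + Ecol n b0 (λ b → Ω i j a0 b)
    mid (suc a) (suc b) = begin
      X * ((d1 * d2) * c1' - (d3 * d4) * c2') + Y * ((d3 * d4) * c1' - (d5 * d6) * c2')
        ≈⟨ solve 10 (λ d1 d2 d3 d4 d5 d6 X Y c1' c2' →
              X :* ((d1 :* d2) :* c1' :- (d3 :* d4) :* c2') :+ Y :* ((d3 :* d4) :* c1' :- (d5 :* d6) :* c2')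
              := (d1 :* d2) :* (X :* c1') :+ (d3 :* d4) :* (Y :* c1' :- X :* c2') :+ (d5 :* d6) :* (:- (Y :* c2'))) refl
              d1 d2 d3 d4 d5 d6 X Y c1' c2' ⟩
      (d1 * d2) * (X * c1') + (d3 * d4) * (Y * c1' - X * c2') + (d5 * d6) * (- (Y * c2'))
        ≈⟨ +-cong (+-cong (δδ-when i a j (suc (suc b)) (λ { ≡.refl _ → refl }))
            (δδ-when i (suc a) j (suc b) (λ { ≡.refl ≡.refl → refl }))) (δδ-when i (suc (suc a)) j b (λ { _ ≡.refl → refl })) ⟩
      (d1 * d2) * (fromℕ (M ∸ a) * c1') + (d3 * d4) * (fromℕ (N ∸ suc b) * c1' - fromℕ (M ∸ suc a) * c2') +
          (d5 * d6) * (- (fromℕ (N ∸ b) * c2'))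
        ≈⟨ solve 12 (λ d1 d2 d3 d4 d5 d6 x y Ma Nb A1 B1 →
              (d1 :* d2) :* (Ma :* (x :* (con (+ 1) :+ B1))) :+ (d3 :* d4) :*
                  (y :* (x :* (con (+ 1) :+ B1)) :- x :* ((con (+ 1) :+ A1) :* y)) :+ (d5 :* d6) :*
                  (:- (Nb :* ((con (+ 1) :+ A1) :* y)))
              := ((d1 :* d2) :* (Ma :* (con (+ 1) :+ B1)) :- (d3 :* d4) :* (A1 :* y)) :* x :+
                  ((d3 :* d4) :* (x :* B1) :- (d5 :* d6) :* ((con (+ 1) :+ A1) :* Nb)) :* y) refl
              d1 d2 d3 d4 d5 d6 (fromℕ (m ∸ a)) (fromℕ (n ∸ b)) (fromℕ (M ∸ a)) (fromℕ (N ∸ b)) (fromℕ (suc a)) (fromℕ (suc b)) ⟩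
      ((d1 * d2) * c₁ a (suc b) - (d3 * d4) * c₂ a (suc b)) * fromℕ (m ∸ a) +
          ((d3 * d4) * c₁ (suc a) b - (d5 * d6) * c₂ (suc a) b) * fromℕ (n ∸ b) ∎
      where
      d1 = δ i a
      d2 = δ j (suc (suc b))
      d3 = δ i (suc a)
      d4 = δ j (suc b)
      d5 = δ i (suc (suc a))
      d6 = δ j b
      c1' = c₁ (suc a) (suc b)
      c2' = c₂ (suc a) (suc b)
    mid zero (suc b) = begin
      X * ((0# * z) * c₁ 0 (suc b) - (e1 * e2) * c₂ 0 (suc b)) + Y * ((e1 * e2) * c₁ 0 (suc b) - (e3 * e4) * c₂ 0 (suc b))
        ≈⟨ solve 9 (λ z e1 e2 e3 e4 X Y p q →
              X :* ((con (+ 0) :* z) :* p :- (e1 :* e2) :* q) :+ Y :* ((e1 :* e2) :* p :- (e3 :* e4) :* q)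
              := (e1 :* e2) :* (Y :* p :- X :* q) :+ (e3 :* e4) :* (:- (Y :* q))) refl
              z e1 e2 e3 e4 X Y (c₁ 0 (suc b)) (c₂ 0 (suc b)) ⟩
      (e1 * e2) * (Y * c₁ 0 (suc b) - X * c₂ 0 (suc b)) + (e3 * e4) * (- (Y * c₂ 0 (suc b)))
        ≈⟨ +-cong (δδ-when i 0 j (suc b) (λ { ≡.refl ≡.refl → refl })) (δδ-when i 1 j b (λ { _ ≡.refl → refl })) ⟩
      (e1 * e2) * (fromℕ (N ∸ suc b) * c₁ 0 (suc b) - fromℕ M * c₂ 0 (suc b)) + (e3 * e4) * (- (fromℕ (N ∸ b) * c₂ 0 (suc b)))
        ≈⟨ solve 8 (λ e1 e2 e3 e4 y Mf Nb B1 →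
              (e1 :* e2) :* (y :* (Mf :* (con (+ 1) :+ B1)) :- Mf :* ((con (+ 1) :+ con (+ 0)) :* y)) :+
                  (e3 :* e4) :* (:- (Nb :* ((con (+ 1) :+ con (+ 0)) :* y)))
              := con (+ 0) :+ ((e1 :* e2) :* (Mf :* B1) :- (e3 :* e4) :* ((con (+ 1) :+ con (+ 0)) :* Nb)) :* y) refl
              e1 e2 e3 e4 (fromℕ (n ∸ b)) (fromℕ M) (fromℕ (N ∸ b)) (fromℕ (suc b)) ⟩
      0# + Ω i j 0 b * fromℕ (n ∸ b) ∎
      where
      z = δ j (suc (suc b))
      e1 = δ i 0
      e2 = δ j (suc b)
      e3 = δ i 1
      e4 = δ j b
    mid (suc a) zero = begin
      X * ((e1 * e2) * c₁ (suc a) 0 - (e3 * e4) * c₂ (suc a) 0) + Y * ((e3 * e4) * c₁ (suc a) 0 - (z * 0#) * c₂ (suc a) 0)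
        ≈⟨ solve 9 (λ z e1 e2 e3 e4 X Y p q →
              X :* ((e1 :* e2) :* p :- (e3 :* e4) :* q) :+ Y :* ((e3 :* e4) :* p :- (z :* con (+ 0)) :* q)
              := (e1 :* e2) :* (X :* p) :+ (e3 :* e4) :* (Y :* p :- X :* q)) refl
              z e1 e2 e3 e4 X Y (c₁ (suc a) 0) (c₂ (suc a) 0) ⟩
      (e1 * e2) * (X * c₁ (suc a) 0) + (e3 * e4) * (Y * c₁ (suc a) 0 - X * c₂ (suc a) 0)
        ≈⟨ +-cong (δδ-when i a j 1 (λ { ≡.refl _ → refl })) (δδ-when i (suc a) j 0 (λ { ≡.refl ≡.refl → refl })) ⟩
      (e1 * e2) * (fromℕ (M ∸ a) * c₁ (suc a) 0) + (e3 * e4) * (fromℕ N * c₁ (suc a) 0 - fromℕ (M ∸ suc a) * c₂ (suc a) 0)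
        ≈⟨ solve 8 (λ e1 e2 e3 e4 x Ma Nf A1 →
              (e1 :* e2) :* (Ma :* (x :* (con (+ 1) :+ con (+ 0)))) :+ (e3 :* e4) :*
                  (Nf :* (x :* (con (+ 1) :+ con (+ 0))) :- x :* ((con (+ 1) :+ A1) :* Nf))
              := ((e1 :* e2) :* (Ma :* (con (+ 1) :+ con (+ 0))) :- (e3 :* e4) :* (A1 :* Nf)) :* x :+ con (+ 0)) refl
              e1 e2 e3 e4 (fromℕ (m ∸ a)) (fromℕ (M ∸ a)) (fromℕ N) (fromℕ (suc a)) ⟩
      Ω i j a 0 * fromℕ (m ∸ a) + 0# ∎
      where
      z = δ i (suc (suc a))
      e1 = δ i a
      e2 = δ j 1
      e3 = δ i (suc a)
      e4 = δ j 0
    mid zero zero = begin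
      X * ((0# * z1) * c₁ 0 0 - (e1 * e2) * c₂ 0 0) + Y * ((e1 * e2) * c₁ 0 0 - (z2 * 0#) * c₂ 0 0)
        ≈⟨ solve 8 (λ z1 z2 e1 e2 X Y p q →
              X :* ((con (+ 0) :* z1) :* p :- (e1 :* e2) :* q) :+ Y :* ((e1 :* e2) :* p :- (z2 :* con (+ 0)) :* q)
              := (e1 :* e2) :* (Y :* p :- X :* q)) refl
              z1 z2 e1 e2 X Y (c₁ 0 0) (c₂ 0 0) ⟩
      (e1 * e2) * (Y * c₁ 0 0 - X * c₂ 0 0)
        ≈⟨ δδ-when i 0 j 0 (λ { ≡.refl ≡.refl → refl }) ⟩
      (e1 * e2) * (fromℕ N * c₁ 0 0 - fromℕ M * c₂ 0 0)
        ≈⟨ solve 4 (λ e1 e2 Mf Nf →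
              (e1 :* e2) :* (Nf :* (Mf :* (con (+ 1) :+ con (+ 0))) :- Mf :* ((con (+ 1) :+ con (+ 0)) :* Nf))
              := con (+ 0) :+ con (+ 0)) refl
              e1 e2 (fromℕ M) (fromℕ N) ⟩
      0# + 0# ∎
      where
      z1 = δ j 1
      z2 = δ i 1
      e1 = δ i 0
      e2 = δ j 0

  Hdiag-eq : ∀ n s → Hdiag n s ≈ fromℕ n - (1# + 1#) * fromℕ s
  Hdiag-eq n s = +-congˡ (-‿cong (trans (fromℕ-* 2 s) (*-congʳ {fromℕ s} (+-congˡ (+-identityʳ 1#)))))

  ιtop-H : ∀ i j k0 → i ≤ M → j ≤ N → k0 ≤ K → ρ⊗·ιtop Hᴺ i j k0 ≈ ιtop·ρ Hᴺ i j k0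
  ιtop-H i j k0 i≤M j≤N k0≤K = begin
    ρ⊗·ιtop Hᴺ i j k0 ≈⟨ kronSum-row (suc M) (suc N) (Hᴺ M) (Hᴺ N) ιtop′ i j (s≤s i≤M) (s≤s j≤N) ⟩
    ΣN (suc M) (λ i' → Hᴺ M i i' * ιtop′ i' j) + ΣN (suc N) (λ j' → Hᴺ N j j' * ιtop′ i j')
      ≈⟨ +-cong (Hᴺ-row M i (λ i' → ιtop′ i' j) i≤M) (Hᴺ-row N j (λ j' → ιtop′ i j') j≤N) ⟩
    Hdiag M i * D + Hdiag N j * D ≈⟨ sym (distribʳ _ _ _) ⟩
    (Hdiag M i + Hdiag N j) * D ≈⟨ *-comm _ _ ⟩
    D * (Hdiag M i + Hdiag N j) ≈⟨ δ-when (i ℕ.+ j) k0 (λ { ≡.refl → lem }) ⟩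
    D * Hdiag K k0 ≈⟨ sym (Hᴺ-col K k0 (λ k → δ (i ℕ.+ j) k) k0≤K) ⟩
    ιtop·ρ Hᴺ i j k0 ∎
    where
    ιtop′ : ℕ → ℕ → Carrier
    ιtop′ i' j' = ιtop i' j' k0
    D = δ (i ℕ.+ j) k0
    lem : Hdiag M i + Hdiag N j ≈ Hdiag K (i ℕ.+ j)
    lem = begin
      Hdiag M i + Hdiag N j ≈⟨ +-cong (Hdiag-eq M i) (Hdiag-eq N j) ⟩
      (fromℕ M - (1# + 1#) * fromℕ i) + (fromℕ N - (1# + 1#) * fromℕ j)
        ≈⟨ solve 4 (λ a b x y → (a :- (con (+ 1) :+ con (+ 1)) :* x) :+
            (b :- (con (+ 1) :+ con (+ 1)) :* y) := (a :+ b) :- (con (+ 1) :+ con (+ 1)) :* (x :+ y)) refl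
            (fromℕ M) (fromℕ N) (fromℕ i) (fromℕ j) ⟩
      (fromℕ M + fromℕ N) - (1# + 1#) * (fromℕ i + fromℕ j) ≈⟨ sym
          (+-cong (fromℕ-+ M N) (-‿cong (*-congˡ {1# + 1#} (fromℕ-+ i j)))) ⟩
      fromℕ K - (1# + 1#) * fromℕ (i ℕ.+ j) ≈⟨ sym (Hdiag-eq K (i ℕ.+ j)) ⟩
      Hdiag K (i ℕ.+ j) ∎

  Ω-H : ∀ i j a0 b0 → i ≤ M → j ≤ N → a0 ≤ m → b0 ≤ n → ρ⊗·Ω Hᴺ i j a0 b0 ≈ Ω·ρ⊗ Hᴺ i j a0 b0
  Ω-H i j a0 b0 i≤M j≤N a0≤m b0≤n = begin
    ρ⊗·Ω Hᴺ i j a0 b0 ≈⟨ kronSum-row (suc M) (suc N) (Hᴺ M) (Hᴺ N) (λ i' j' → Ω i' j' a0 b0) i j (s≤s i≤M) (s≤s j≤N) ⟩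
    ΣN (suc M) (λ i' → Hᴺ M i i' * Ω i' j a0 b0) + ΣN (suc N) (λ j' → Hᴺ N j j' * Ω i j' a0 b0)
      ≈⟨ +-cong (Hᴺ-row M i (λ i' → Ω i' j a0 b0) i≤M) (Hᴺ-row N j (λ j' → Ω i j' a0 b0) j≤N) ⟩
    Hdiag M i * ((r1 * r2) * c₁ a0 b0 - (r3 * r4) * c₂ a0 b0) + Hdiag N j * ((r1 * r2) * c₁ a0 b0 - (r3 * r4) * c₂ a0 b0)
      ≈⟨ solve 8 (λ hm hn r1 r2 r3 r4 p q → hm :* ((r1 :* r2) :* p :- (r3 :* r4) :* q) :+ hn :*
          ((r1 :* r2) :* p :- (r3 :* r4) :* q)
            := (r1 :* r2) :* ((hm :+ hn) :* p) :+ (r3 :* r4) :* (:- ((hm :+ hn) :* q))) refl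
            (Hdiag M i) (Hdiag N j) r1 r2 r3 r4 (c₁ a0 b0) (c₂ a0 b0) ⟩
    (r1 * r2) * ((Hdiag M i + Hdiag N j) * c₁ a0 b0) + (r3 * r4) * (- ((Hdiag M i + Hdiag N j) * c₂ a0 b0))
      ≈⟨ +-cong (δδ-when i a0 j (suc b0) (λ { ≡.refl ≡.refl → *-congʳ {c₁ a0 b0} l1 }))
          (δδ-when i (suc a0) j b0 (λ { ≡.refl ≡.refl → -‿cong (*-congʳ {c₂ a0 b0} l2) })) ⟩
    (r1 * r2) * ((Hdiag m a0 + Hdiag n b0) * c₁ a0 b0) + (r3 * r4) * (- ((Hdiag m a0 + Hdiag n b0) * c₂ a0 b0))
      ≈⟨ solve 7 (λ h r1 r2 r3 r4 p q → (r1 :* r2) :* (h :* p) :+ (r3 :* r4) :* (:- (h :* q)) :=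
          ((r1 :* r2) :* p :- (r3 :* r4) :* q) :* h) refl
            (Hdiag m a0 + Hdiag n b0) r1 r2 r3 r4 (c₁ a0 b0) (c₂ a0 b0) ⟩
    Ω i j a0 b0 * (Hdiag m a0 + Hdiag n b0) ≈⟨ distribˡ _ _ _ ⟩
    Ω i j a0 b0 * Hdiag m a0 + Ω i j a0 b0 * Hdiag n b0
      ≈⟨ sym (+-cong (Hᴺ-col m a0 (λ a → Ω i j a b0) a0≤m) (Hᴺ-col n b0 (λ b → Ω i j a0 b) b0≤n)) ⟩
    ΣN (suc m) (λ a → Ω i j a b0 * Hᴺ m a a0) + ΣN (suc n) (λ b → Ω i j a0 b * Hᴺ n b b0)
      ≈⟨ sym (kronSum-col (suc m) (suc n) (Hᴺ m) (Hᴺ n) (λ a b → Ω i j a b) a0 b0 (s≤s a0≤m) (s≤s b0≤n)) ⟩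
    Ω·ρ⊗ Hᴺ i j a0 b0 ∎
    where
    r1 = δ i a0
    r2 = δ j (suc b0)
    r3 = δ i (suc a0)
    r4 = δ j b0
    two = 1# + 1#
    l1 : Hdiag M a0 + Hdiag N (suc b0) ≈ Hdiag m a0 + Hdiag n b0
    l1 = trans (+-cong (Hdiag-eq M a0) (Hdiag-eq N (suc b0))) (trans
          (solve 4 (λ mm nn a b → ((con (+ 1) :+ mm) :- (con (+ 1) :+ con (+ 1)) :* a) :+
              ((con (+ 1) :+ nn) :- (con (+ 1) :+ con (+ 1)) :* (con (+ 1) :+ b))
                 := (mm :- (con (+ 1) :+ con (+ 1)) :* a) :+ (nn :- (con (+ 1) :+ con (+ 1)) :* b)) refl
                     (fromℕ m) (fromℕ n) (fromℕ a0) (fromℕ b0))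
          (sym (+-cong (Hdiag-eq m a0) (Hdiag-eq n b0))))
    l2 : Hdiag M (suc a0) + Hdiag N b0 ≈ Hdiag m a0 + Hdiag n b0
    l2 = trans (+-cong (Hdiag-eq M (suc a0)) (Hdiag-eq N b0)) (trans
          (solve 4 (λ mm nn a b → ((con (+ 1) :+ mm) :- (con (+ 1) :+ con (+ 1)) :* (con (+ 1) :+ a)) :+
              ((con (+ 1) :+ nn) :- (con (+ 1) :+ con (+ 1)) :* b)
                 := (mm :- (con (+ 1) :+ con (+ 1)) :* a) :+ (nn :- (con (+ 1) :+ con (+ 1)) :* b)) refl
                     (fromℕ m) (fromℕ n) (fromℕ a0) (fromℕ b0))
          (sym (+-cong (Hdiag-eq m a0) (Hdiag-eq n b0))))

  ιtop-F : ∀ i j k0 → i ≤ M → j ≤ N → k0 ≤ K → ρ⊗·ιtop Fᴺ i j k0 ≈ ιtop·ρ Fᴺ i j k0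
  ιtop-F i j k0 i≤M j≤N k0≤K = begin
    ρ⊗·ιtop Fᴺ i j k0 ≈⟨ kronSum-row (suc M) (suc N) (Fᴺ M) (Fᴺ N) ιtop′ i j (s≤s i≤M) (s≤s j≤N) ⟩
    ΣN (suc M) (λ i' → Fᴺ M i i' * ιtop′ i' j) + ΣN (suc N) (λ j' → Fᴺ N j j' * ιtop′ i j')
      ≈⟨ +-cong (Fᴺ-row M i (λ i' → ιtop′ i' j) i≤M) (Fᴺ-row N j (λ j' → ιtop′ i j') j≤N) ⟩
    Frow i (λ i' → ιtop′ i' j) + Frow j (λ j' → ιtop′ i j') ≈⟨ mid i j ⟩
    δ (i ℕ.+ j) (suc k0) * fromℕ (suc k0) ≈⟨ sym
        (Fᴺ-col K k0 (λ k → δ (i ℕ.+ j) k) k0≤K (δ-≢ (i ℕ.+ j) (suc K) (λ e → ℕP.<⇒≢ (s≤s (ℕP.+-mono-≤ i≤M j≤N)) e))) ⟩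
    ιtop·ρ Fᴺ i j k0 ∎
    where
    ιtop′ : ℕ → ℕ → Carrier
    ιtop′ i' j' = ιtop i' j' k0
    mid : ∀ i j → Frow i (λ i' → δ (i' ℕ.+ j) k0) + Frow j (λ j' → δ (i ℕ.+ j') k0) ≈ δ (i ℕ.+ j) (suc k0) * fromℕ (suc k0)
    mid zero zero = trans (+-identityʳ _) (sym (zeroˡ _))
    mid (suc i) zero = begin
      fromℕ (suc i) * δ (i ℕ.+ 0) k0 + 0# ≈⟨ trans (+-identityʳ _) (*-comm _ _) ⟩
      δ (i ℕ.+ 0) k0 * fromℕ (suc i) ≈⟨ δ-when (i ℕ.+ 0) k0
          (λ e → reflexive (≡.cong (λ u → fromℕ (suc u)) (≡.trans (≡.sym (ℕP.+-identityʳ i)) e))) ⟩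
      δ (i ℕ.+ 0) k0 * fromℕ (suc k0) ∎
    mid zero (suc j) = trans (+-identityˡ _) (trans (*-comm _ _) (δ-when j k0 (λ e → reflexive (≡.cong (λ u → fromℕ (suc u)) e))))
    mid (suc i) (suc j) = begin
      fromℕ (suc i) * δ (i ℕ.+ suc j) k0 + fromℕ (suc j) * δ (suc (i ℕ.+ j)) k0
        ≈⟨ +-congʳ (*-congˡ {fromℕ (suc i)} (reflexive (≡.cong (λ u → δ u k0) (ℕP.+-suc i j)))) ⟩
      fromℕ (suc i) * D + fromℕ (suc j) * D ≈⟨ trans (sym (distribʳ _ _ _)) (*-comm _ _) ⟩
      D * (fromℕ (suc i) + fromℕ (suc j)) ≈⟨ δ-when (suc (i ℕ.+ j)) k0
          (λ e → trans (sym (fromℕ-+ (suc i) (suc j)))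
          (reflexive (≡.cong fromℕ (≡.trans (≡.cong suc (ℕP.+-suc i j)) (≡.cong suc e))))) ⟩
      D * fromℕ (suc k0) ≈⟨ *-congʳ {fromℕ (suc k0)} (reflexive (≡.cong (λ u → δ u k0) (≡.sym (ℕP.+-suc i j)))) ⟩
      δ (i ℕ.+ suc j) k0 * fromℕ (suc k0) ∎
      where D = δ (suc (i ℕ.+ j)) k0

  fromℕ-M∸ : ∀ a → a ≤ m → fromℕ (M ∸ a) ≈ 1# + fromℕ (m ∸ a)
  fromℕ-M∸ a a≤m = reflexive (≡.cong fromℕ (ℕP.+-∸-assoc 1 a≤m))
  fromℕ-N∸ : ∀ b → b ≤ n → fromℕ (N ∸ b) ≈ 1# + fromℕ (n ∸ b)
  fromℕ-N∸ b b≤n = reflexive (≡.cong fromℕ (ℕP.+-∸-assoc 1 b≤n))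

  Ω-F : ∀ i j a0 b0 → i ≤ M → j ≤ N → a0 ≤ m → b0 ≤ n → ρ⊗·Ω Fᴺ i j a0 b0 ≈ Ω·ρ⊗ Fᴺ i j a0 b0
  Ω-F i j a0 b0 i≤M j≤N a0≤m b0≤n = begin
    ρ⊗·Ω Fᴺ i j a0 b0 ≈⟨ kronSum-row (suc M) (suc N) (Fᴺ M) (Fᴺ N) (λ i' j' → Ω i' j' a0 b0) i j (s≤s i≤M) (s≤s j≤N) ⟩
    ΣN (suc M) (λ i' → Fᴺ M i i' * Ω i' j a0 b0) + ΣN (suc N) (λ j' → Fᴺ N j j' * Ω i j' a0 b0)
      ≈⟨ +-cong (Fᴺ-row M i (λ i' → Ω i' j a0 b0) i≤M) (Fᴺ-row N j (λ j' → Ω i j' a0 b0) j≤N) ⟩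
    Frow i (λ i' → Ω i' j a0 b0) + Frow j (λ j' → Ω i j' a0 b0) ≈⟨ mid i j a0 b0 a0≤m b0≤n ⟩
    Ω i j (suc a0) b0 * fromℕ (suc a0) + Ω i j a0 (suc b0) * fromℕ (suc b0)
      ≈⟨ sym (+-cong (Fᴺ-col m a0 (λ a → Ω i j a b0) a0≤m hypA) (Fᴺ-col n b0 (λ b → Ω i j a0 b) b0≤n hypB)) ⟩
    ΣN (suc m) (λ a → Ω i j a b0 * Fᴺ m a a0) + ΣN (suc n) (λ b → Ω i j a0 b * Fᴺ n b b0)
      ≈⟨ sym (kronSum-col (suc m) (suc n) (Fᴺ m) (Fᴺ n) (λ a b → Ω i j a b) a0 b0 (s≤s a0≤m) (s≤s b0≤n)) ⟩
    Ω·ρ⊗ Fᴺ i j a0 b0 ∎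
    where
    hypA : Ω i j (suc m) b0 ≈ 0#
    hypA = begin
      (δ i M * δ j (suc b0)) * (fromℕ (M ∸ M) * fromℕ (suc b0)) - (δ i (suc M) * δ j b0) * c₂ M b0
        ≈⟨ +-cong (*-congˡ {δ i M * δ j (suc b0)}
            (*-congʳ {fromℕ (suc b0)} (reflexive (≡.cong fromℕ (ℕP.n∸n≡0 M)))))
            (-‿cong (*-congʳ {c₂ M b0} (*-congʳ {δ j b0} (δ-≢ i (suc M) (λ e → ℕP.<⇒≢ (s≤s i≤M) e))))) ⟩
      (δ i M * δ j (suc b0)) * (0# * fromℕ (suc b0)) - (0# * δ j b0) * c₂ M b0
        ≈⟨ solve 4 (λ x y z w → x :* (con (+ 0) :* y) :- (con (+ 0) :* z) :* w := con (+ 0)) refl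
            (δ i M * δ j (suc b0)) (fromℕ (suc b0)) (δ j b0) (c₂ M b0) ⟩
      0# ∎
    hypB : Ω i j a0 (suc n) ≈ 0#
    hypB = begin
      (δ i a0 * δ j (suc N)) * c₁ a0 N - (δ i (suc a0) * δ j N) * (fromℕ (suc a0) * fromℕ (N ∸ N))
        ≈⟨ +-cong (*-congʳ {c₁ a0 N} (*-congˡ {δ i a0} (δ-≢ j (suc N) (λ e → ℕP.<⇒≢ (s≤s j≤N) e))))
            (-‿cong (*-congˡ {δ i (suc a0) * δ j N} (*-congˡ {fromℕ (suc a0)} (reflexive (≡.cong fromℕ (ℕP.n∸n≡0 N)))))) ⟩
      (δ i a0 * 0#) * c₁ a0 N - (δ i (suc a0) * δ j N) * (fromℕ (suc a0) * 0#)
        ≈⟨ solve 4 (λ x y z w → (x :* con (+ 0)) :* y :- z :* (w :* con (+ 0)) := con (+ 0)) refl (δ i a0)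
            (c₁ a0 N) (δ i (suc a0) * δ j N) (fromℕ (suc a0)) ⟩
      0# ∎
    mid : ∀ i j a0 b0 → a0 ≤ m → b0 ≤ n → Frow i (λ i' → Ω i' j a0 b0) + Frow j (λ j' → Ω i j' a0 b0) ≈ Ω i j
        (suc a0) b0 * fromℕ (suc a0) + Ω i j a0 (suc b0) * fromℕ (suc b0)
    mid zero zero a0 b0 _ _ = solve 8 (λ z p' q' p'' q'' A1 B1 u →
                    con (+ 0) :+ con (+ 0) := ((con (+ 0) :* con (+ 0)) :* p' :-
                        (con (+ 0) :* z) :* q') :* A1 :+ ((u :* con (+ 0)) :* p'' :- (con (+ 0) :* con (+ 0)) :* q'') :* B1) refl
                    (δ 0 b0) (c₁ (suc a0) b0) (c₂ (suc a0) b0) (c₁ a0 (suc b0)) (c₂ a0 (suc b0))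
                        (fromℕ (suc a0)) (fromℕ (suc b0)) (δ 0 a0)
    mid zero (suc j) a0 b0 _ _ = begin
      0# + J * ((Q * p) - (0# * δ j b0) * q)
        ≈⟨ solve 5 (λ J Q p z q → con (+ 0) :+ J :* ((Q :* p) :- (con (+ 0) :* z) :* q) := Q :* (J :* p)) refl J Q p (δ j b0) q ⟩
      Q * (J * p) ≈⟨ δδ-when 0 a0 j (suc b0) (λ { ≡.refl ≡.refl → solve 3
          (λ J Mf B1 → J :* (Mf :* B1) := Mf :* J :* B1) refl J (fromℕ M) (fromℕ (suc b0)) }) ⟩
      Q * (p'' * B1) ≈⟨ solve 9 (λ Q p'' B1 z1 z2 z3 p' q' q'' →
                 Q :* (p'' :* B1) := ((con (+ 0) :* z1) :* p' :- (con (+ 0) :* z2) :* q') :* z3 :+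
                     (Q :* p'' :- (con (+ 0) :* z1) :* q'') :* B1) refl
                 Q p'' B1 (δ j b0) (δ (suc j) b0) A1 p' q' q'' ⟩
      ((0# * δ j b0) * p' - (0# * δ (suc j) b0) * q') * A1 + (Q * p'' - (0# * δ j b0) * q'') * B1 ∎
      where
      J = fromℕ (suc j)
      Q = δ 0 a0 * δ j (suc b0)
      p = c₁ a0 b0
      q = c₂ a0 b0
      p' = c₁ (suc a0) b0
      q' = c₂ (suc a0) b0
      p'' = c₁ a0 (suc b0)
      q'' = c₂ a0 (suc b0)
      A1 = fromℕ (suc a0)
      B1 = fromℕ (suc b0)
    mid (suc i) zero a0 b0 _ _ = begin
      I * ((δ i a0 * 0#) * p - Q * q) + 0#
        ≈⟨ solve 5 (λ I z p Q q → I :* ((z :* con (+ 0)) :* p :- Q :* q) :+ con (+ 0) := Q :*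
            (:- (I :* q))) refl I (δ i a0) p Q q ⟩
      Q * (- (I * q)) ≈⟨ δδ-when i (suc a0) 0 b0
          (λ { ≡.refl ≡.refl → solve 3 (λ I A1 Nf → :- (I :* (A1 :* Nf)) := :- ((I :* Nf) :* A1)) refl I A1 (fromℕ N) }) ⟩
      Q * (- (q' * A1)) ≈⟨ solve 10 (λ Q q' A1 B1 z1 z2 p' p'' q'' w →
                 Q :* (:- (q' :* A1)) := ((z1 :* con (+ 0)) :* p' :- Q :* q') :* A1 :+
                     ((z2 :* con (+ 0)) :* p'' :- (z1 :* con (+ 0)) :* q'') :* B1) refl
                 Q q' A1 B1 (δ i a0) (δ (suc i) a0) p' p'' q'' I ⟩
      ((δ i a0 * 0#) * p' - Q * q') * A1 + ((δ (suc i) a0 * 0#) * p'' - (δ i a0 * 0#) * q'') * B1 ∎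
      where
      I = fromℕ (suc i)
      Q = δ i (suc a0) * δ 0 b0
      p = c₁ a0 b0
      q = c₂ a0 b0
      p' = c₁ (suc a0) b0
      q' = c₂ (suc a0) b0
      p'' = c₁ a0 (suc b0)
      q'' = c₂ a0 (suc b0)
      A1 = fromℕ (suc a0)
      B1 = fromℕ (suc b0)
    mid (suc i) (suc j) a0 b0 a0≤m b0≤n = begin
      I * (Q1 * p - Q2 * q) + J * (Q3 * p - Q1 * q)
        ≈⟨ solve 8 (λ I J Q1 Q2 Q3 p q z → I :* (Q1 :* p :- Q2 :* q) :+ J :* (Q3 :* p :- Q1 :* q)
                := Q1 :* (I :* p :- J :* q) :+ Q2 :* (:- (I :* q)) :+ Q3 :* (J :* p)) refl I J Q1 Q2 Q3 p q A1 ⟩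
      Q1 * (I * p - J * q) + Q2 * (- (I * q)) + Q3 * (J * p)
        ≈⟨ +-cong (+-cong (δδ-when i a0 j b0 (λ { ≡.refl ≡.refl → l1 }))
            (δδ-when i (suc a0) (suc j) b0 (λ { ≡.refl ≡.refl → solve 3
            (λ I A1 Z → :- (I :* (A1 :* Z)) := :- ((I :* Z) :* A1)) refl I A1 (fromℕ (N ∸ suc j)) })))
            (δδ-when (suc i) a0 j (suc b0) (λ { ≡.refl ≡.refl → solve 3
            (λ J X B1 → J :* (X :* B1) := (X :* J) :* B1) refl J (fromℕ (M ∸ suc i)) B1 })) ⟩
      Q1 * (p' * A1 - q'' * B1) + Q2 * (- (q' * A1)) + Q3 * (p'' * B1)
        ≈⟨ solve 10 (λ Q1 Q2 Q3 p' q' p'' q'' A1 B1 z → Q1 :* (p' :* A1 :- q'' :* B1) :+ Q2 :*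
            (:- (q' :* A1)) :+ Q3 :* (p'' :* B1)
                := (Q1 :* p' :- Q2 :* q') :* A1 :+ (Q3 :* p'' :- Q1 :* q'') :* B1) refl Q1 Q2 Q3 p' q' p'' q'' A1 B1 I ⟩
      (Q1 * p' - Q2 * q') * A1 + (Q3 * p'' - Q1 * q'') * B1 ∎
      where
      I = fromℕ (suc i)
      J = fromℕ (suc j)
      Q1 = δ i a0 * δ j b0
      Q2 = δ i (suc a0) * δ (suc j) b0
      Q3 = δ (suc i) a0 * δ j (suc b0)
      p = c₁ a0 b0
      q = c₂ a0 b0
      p' = c₁ (suc a0) b0
      q' = c₂ (suc a0) b0
      p'' = c₁ a0 (suc b0)
      q'' = c₂ a0 (suc b0)
      A1 = fromℕ (suc a0)
      B1 = fromℕ (suc b0)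
      l1 : fromℕ (suc a0) * c₁ a0 b0 - fromℕ (suc b0) * c₂ a0 b0 ≈ c₁ (suc a0) b0 * A1 - c₂ a0 (suc b0) * B1
      l1 = begin
        A1 * (fromℕ (M ∸ a0) * B1) - B1 * (A1 * fromℕ (N ∸ b0)) ≈⟨ +-cong
            (*-congˡ {A1} (*-congʳ {B1} (fromℕ-M∸ a0 a0≤m))) (-‿cong (*-congˡ {B1} (*-congˡ {A1} (fromℕ-N∸ b0 b0≤n)))) ⟩
        A1 * ((1# + fromℕ (m ∸ a0)) * B1) - B1 * (A1 * (1# + fromℕ (n ∸ b0)))
          ≈⟨ solve 4 (λ A1 B1 x y → A1 :* ((con (+ 1) :+ x) :* B1) :- B1 :* (A1 :* (con (+ 1) :+ y)) :=
              (x :* B1) :* A1 :- (A1 :* y) :* B1) refl A1 B1 (fromℕ (m ∸ a0)) (fromℕ (n ∸ b0)) ⟩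
        (fromℕ (m ∸ a0) * B1) * A1 - (A1 * fromℕ (n ∸ b0)) * B1 ∎

module Projection {c ℓ : Level} (𝔽 : ACF0 c ℓ) (m n : ℕ) where
  open Embedding 𝔽 m n public

  -- πtop k is the functional v_i ⊗ v_j ↦ wt k i (i + j = k), normalised by C(K,k).  For
  -- πΩ a b the telescoping functional [i ≤ a] wt k i, which sends Ω(v_a′ ⊗ v_b′) to
  -- δ a a′ times norm, is corrected by a multiple of wt k so as to vanish on ιtop.
  wt : ℕ → ℕ → Carrier
  wt k r = fromℕ (binom M r) * fromℕ (binom N (k ∸ r))

  binomK binomK⁻¹ : ℕ → Carrier
  binomK k = fromℕ (binom K k)
  binomK⁻¹ k = inv (binomK k)

  partialWt : ℕ → ℕ → Carrier
  partialWt a k = ΣN (suc a) (wt k)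

  πΩcoef : ℕ → ℕ → ℕ → Carrier
  πΩcoef a i k = step i a * wt k i - (wt k i * binomK⁻¹ k) * partialWt a k

  normℕ : ℕ → ℕ → ℕ
  normℕ a k = (binom M a ℕ.* binom N (k ∸ a)) ℕ.* ((M ∸ a) ℕ.* (k ∸ a))

  norm norm⁻¹ : ℕ → ℕ → Carrier
  norm a k = fromℕ (normℕ a k)
  norm⁻¹ a k = inv (norm a k)

  πtop : ℕ → ℕ → ℕ → Carrier
  πtop k i j = δ (i ℕ.+ j) k * (wt k i * binomK⁻¹ k)

  πΩ : ℕ → ℕ → ℕ → ℕ → Carrier
  πΩ a b i j = δ (suc (a ℕ.+ b)) (i ℕ.+ j) * (πΩcoef a i (i ℕ.+ j) * norm⁻¹ a (i ℕ.+ j))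

  binomK-inverseʳ : ∀ k → k ≤ K → binomK k * binomK⁻¹ k ≈ 1#
  binomK-inverseʳ k k≤K = fromℕ-pos-inverse (binom K k) (binom-pos K k k≤K)

  binomK-inverseˡ : ∀ k → k ≤ K → binomK⁻¹ k * binomK k ≈ 1#
  binomK-inverseˡ k k≤K = trans (*-comm _ _) (binomK-inverseʳ k k≤K)


  norm-inverseʳ : ∀ a b → a ≤ m → b ≤ n → norm a (suc (a ℕ.+ b)) * norm⁻¹ a (suc (a ℕ.+ b)) ≈ 1#
  norm-inverseʳ a b a≤m b≤n = fromℕ-pos-inverse (normℕ a (suc (a ℕ.+ b)))
      (ℕP.*-mono-< (ℕP.*-mono-< (binom-pos M a (ℕP.m≤n⇒m≤1+n a≤m)) (binom-pos N _ kb))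
      (ℕP.*-mono-< (ℕP.m<n⇒0<n∸m (s≤s a≤m)) (ℕP.m<n⇒0<n∸m (s≤s (ℕP.m≤m+n a b)))))
    where
    kb : suc (a ℕ.+ b) ∸ a ≤ N
    kb = ≡.subst (_≤ N) (≡.sym (≡.trans (ℕP.+-∸-assoc 1 (ℕP.m≤m+n a b)) (≡.cong suc (ℕP.m+n∸m≡n a b)))) (s≤s b≤n)

  wt-inverseʳ : ∀ k i → i ≤ M → k ∸ i ≤ N → wt k i * inv (wt k i) ≈ 1#
  wt-inverseʳ k i i≤M ki≤N = inverse (wt k i)
      (λ e → fromℕ-pos≉0 (binom M i ℕ.* binom N (k ∸ i))
      (ℕP.*-mono-< (binom-pos M i i≤M) (binom-pos N (k ∸ i) ki≤N)) (trans (fromℕ-* (binom M i) (binom N (k ∸ i))) e))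

  wt-beyondN : ∀ k r → N < k ∸ r → wt k r ≈ 0#
  wt-beyondN k r p = trans (*-congˡ {fromℕ (binom M r)} (reflexive (≡.cong fromℕ (binom-beyond N (k ∸ r) p)))) (zeroʳ _)

  wt-beyondM : ∀ k r → M < r → wt k r ≈ 0#
  wt-beyondM k r p = trans (*-congʳ {fromℕ (binom N (k ∸ r))} (reflexive (≡.cong fromℕ (binom-beyond M r p)))) (zeroˡ _)

  wt-absorb : ∀ a b → wt (suc (a ℕ.+ b)) a * c₁ a b ≈ wt (suc (a ℕ.+ b)) (suc a) * c₂ a b
  wt-absorb a b = begin
    (fromℕ (binom M a) * fromℕ (binom N (Lv ∸ a))) * (fromℕ (M ∸ a) * fromℕ (suc b))
      ≈⟨ solve 4 (λ x y z w → (x :* y) :* (z :* w) := (x :* z) :* (y :* w)) refl (fromℕ (binom M a))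
          (fromℕ (binom N (Lv ∸ a))) (fromℕ (M ∸ a)) (fromℕ (suc b)) ⟩
    (fromℕ (binom M a) * fromℕ (M ∸ a)) * (fromℕ (binom N (Lv ∸ a)) * fromℕ (suc b))
      ≈⟨ *-cong (sym (fromℕ-* (binom M a) (M ∸ a)))
          (trans (*-congʳ {fromℕ (suc b)} (reflexive (≡.cong (λ u → fromℕ (binom N u)) e1)))
          (sym (fromℕ-* (binom N (suc b)) (suc b)))) ⟩
    fromℕ (binom M a ℕ.* (M ∸ a)) * fromℕ (binom N (suc b) ℕ.* suc b)
      ≈⟨ *-cong (reflexive (≡.cong fromℕ (≡.sym (binom-absorb M a)))) (reflexive (≡.cong fromℕ (binom-absorb N b))) ⟩
    fromℕ (binom M (suc a) ℕ.* suc a) * fromℕ (binom N b ℕ.* (N ∸ b))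
      ≈⟨ *-cong (fromℕ-* (binom M (suc a)) (suc a))
          (trans (fromℕ-* (binom N b) (N ∸ b)) (*-congʳ {fromℕ (N ∸ b)}
          (reflexive (≡.cong (λ u → fromℕ (binom N u)) (≡.sym e2))))) ⟩
    (fromℕ (binom M (suc a)) * fromℕ (suc a)) * (fromℕ (binom N (Lv ∸ suc a)) * fromℕ (N ∸ b))
      ≈⟨ solve 4 (λ x y z w → (x :* y) :* (z :* w) := (x :* z) :* (y :* w)) refl (fromℕ (binom M (suc a)))
          (fromℕ (suc a)) (fromℕ (binom N (Lv ∸ suc a))) (fromℕ (N ∸ b)) ⟩
    (fromℕ (binom M (suc a)) * fromℕ (binom N (Lv ∸ suc a))) * (fromℕ (suc a) * fromℕ (N ∸ b)) ∎
    where
    Lv = suc (a ℕ.+ b)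
    e1 : Lv ∸ a ≡ suc b
    e1 = ≡.trans (ℕP.+-∸-assoc 1 (ℕP.m≤m+n a b)) (≡.cong suc (ℕP.m+n∸m≡n a b))
    e2 : Lv ∸ suc a ≡ b
    e2 = ℕP.m+n∸m≡n a b

  norm≈wt*c₁ : ∀ a b → norm a (suc (a ℕ.+ b)) ≈ wt (suc (a ℕ.+ b)) a * c₁ a b
  norm≈wt*c₁ a b = trans (fromℕ-* (binom M a ℕ.* binom N (Lv ∸ a)) ((M ∸ a) ℕ.* (Lv ∸ a)))
      (*-cong (fromℕ-* (binom M a) (binom N (Lv ∸ a)))
      (trans (fromℕ-* (M ∸ a) (Lv ∸ a)) (*-congˡ {fromℕ (M ∸ a)} (reflexive (≡.cong fromℕ e1)))))
    where
    Lv = suc (a ℕ.+ b)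
    e1 : suc (a ℕ.+ b) ∸ a ≡ suc b
    e1 = ≡.trans (ℕP.+-∸-assoc 1 (ℕP.m≤m+n a b)) (≡.cong suc (ℕP.m+n∸m≡n a b))

  partialWt-full : ∀ k → partialWt k k ≈ binomK k
  partialWt-full k = vandermonde M N k

  partialWt-beyondM : ∀ k → M ≤ k → partialWt M k ≈ binomK k
  partialWt-beyondM k M≤k = begin
    partialWt M k ≈⟨ sym (ΣN-pad (suc M) (k ∸ M) (wt k) (λ r p → wt-beyondM k r p)) ⟩
    ΣN (suc M ℕ.+ (k ∸ M)) (wt k) ≈⟨ reflexive (≡.cong (λ u → ΣN u (wt k)) (≡.cong suc (ℕP.m+[n∸m]≡n M≤k))) ⟩
    partialWt k k ≈⟨ partialWt-full k ⟩
    binomK k ∎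

  ΣN-step-wt : ∀ k → ΣN (suc M) (λ i → step i k * wt k i) ≈ binomK k
  ΣN-step-wt k with k ℕ.<? suc M
  ... | yes k<sM = trans (ΣN-step (suc M) k (wt k) k<sM) (partialWt-full k)
  ... | no k≮sM = trans (ΣN-step-all (suc M) k (wt k) (ℕP.m≤n⇒m≤1+n (ℕP.≮⇒≥ k≮sM)))
      (partialWt-beyondM k (ℕP.≤-trans (ℕP.n≤1+n M) (ℕP.≮⇒≥ k≮sM)))

  ΣΣ-δδ : ∀ A Bn (h : ℕ → ℕ → Carrier) i j → i < A → j < Bn → ΣN A (λ a → ΣN Bn (λ b → (δ i a * δ j b) * h a b)) ≈ h i j
  ΣΣ-δδ A Bn h i j i<A j<Bn = begin
    ΣN A (λ a → ΣN Bn (λ b → (δ i a * δ j b) * h a b))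
        ≈⟨ ΣN-cong A {g = λ a → δ i a * ΣN Bn (λ b → δ j b * h a b)}
        (λ a → trans (ΣN-cong Bn (λ b → *-assoc _ _ _)) (sym (ΣN-*ˡ Bn (δ i a) (λ b → δ j b * h a b)))) ⟩
    ΣN A (λ a → δ i a * ΣN Bn (λ b → δ j b * h a b)) ≈⟨ ΣN-δ A i (λ a → ΣN Bn (λ b → δ j b * h a b)) i<A ⟩
    ΣN Bn (λ b → δ j b * h i b) ≈⟨ ΣN-δ Bn j (h i) j<Bn ⟩
    h i j ∎

  ΣΣ-δδ-beyond₁ : ∀ A Bn (h : ℕ → ℕ → Carrier) i j → A ≤ i → ΣN A (λ a → ΣN Bn (λ b → (δ i a * δ j b) * h a b)) ≈ 0#
  ΣΣ-δδ-beyond₁ A Bn h i j A≤i = begin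
    ΣN A (λ a → ΣN Bn (λ b → (δ i a * δ j b) * h a b))
        ≈⟨ ΣN-cong A {g = λ a → δ i a * ΣN Bn (λ b → δ j b * h a b)}
        (λ a → trans (ΣN-cong Bn (λ b → *-assoc _ _ _)) (sym (ΣN-*ˡ Bn (δ i a) (λ b → δ j b * h a b)))) ⟩
    ΣN A (λ a → δ i a * ΣN Bn (λ b → δ j b * h a b)) ≈⟨ ΣN-δ-beyond A i (λ a → ΣN Bn (λ b → δ j b * h a b)) A≤i ⟩
    0# ∎

  ΣΣ-δδ-beyond₂ : ∀ A Bn (h : ℕ → ℕ → Carrier) i j → Bn ≤ j → ΣN A (λ a → ΣN Bn (λ b → (δ i a * δ j b) * h a b)) ≈ 0#
  ΣΣ-δδ-beyond₂ A Bn h i j Bn≤j = ΣN-≈0 A _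
      (λ a → trans (ΣN-cong Bn (λ b → *-assoc _ _ _))
      (trans (sym (ΣN-*ˡ Bn (δ i a) (λ b → δ j b * h a b))) (trans (*-congˡ {δ i a} (ΣN-δ-beyond Bn j (h a) Bn≤j)) (zeroʳ _))))

  ΣΣ-Ω : ∀ (g : ℕ → ℕ → Carrier) a' b' → a' ≤ m → b' ≤ n →
       ΣN (suc M) (λ i → ΣN (suc N) (λ j → g i j * Ω i j a' b')) ≈ g a' (suc b') * c₁ a' b' - g (suc a') b' * c₂ a' b'
  ΣΣ-Ω g a' b' a'≤m b'≤n = begin
    ΣN (suc M) (λ i → ΣN (suc N) (λ j → g i j * Ω i j a' b'))
      ≈⟨ ΣN-cong (suc M) (λ i → ΣN-cong (suc N) {g = λ j → T1 i j + - T2 i j} (λ j → lem i j)) ⟩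
    ΣN (suc M) (λ i → ΣN (suc N) (λ j → T1 i j + - T2 i j))
      ≈⟨ ΣN-cong (suc M) (λ i → trans (ΣN-+ (suc N) (T1 i) (λ j → - T2 i j)) (+-congˡ (ΣN-neg (suc N) (T2 i)))) ⟩
    ΣN (suc M) (λ i → ΣN (suc N) (T1 i) + - ΣN (suc N) (T2 i))
      ≈⟨ trans (ΣN-+ (suc M) (λ i → ΣN (suc N) (T1 i)) (λ i → - ΣN (suc N) (T2 i)))
          (+-congˡ (ΣN-neg (suc M) (λ i → ΣN (suc N) (T2 i)))) ⟩
    ΣN (suc M) (λ i → ΣN (suc N) (T1 i)) - ΣN (suc M) (λ i → ΣN (suc N) (T2 i))
      ≈⟨ +-cong (ΣΣ-δδ (suc M) (suc N) (λ i j → g i j * c₁ a' b') a' (suc b') (s≤s (ℕP.m≤n⇒m≤1+n a'≤m)) (s≤s (s≤s b'≤n)))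
                (-‿cong (ΣΣ-δδ (suc M) (suc N) (λ i j → g i j * c₂ a' b') (suc a') b' (s≤s (s≤s a'≤m))
                    (s≤s (ℕP.m≤n⇒m≤1+n b'≤n)))) ⟩
    g a' (suc b') * c₁ a' b' - g (suc a') b' * c₂ a' b' ∎
    where
    T1 T2 : ℕ → ℕ → Carrier
    T1 i j = (δ a' i * δ (suc b') j) * (g i j * c₁ a' b')
    T2 i j = (δ (suc a') i * δ b' j) * (g i j * c₂ a' b')
    lem : ∀ i j → g i j * Ω i j a' b' ≈ T1 i j + - T2 i j
    lem i j = trans (solve 7 (λ G d1 d2 d3 d4 p q → G :* ((d1 :* d2) :* p :- (d3 :* d4) :* q) :=
        (d1 :* d2) :* (G :* p) :+ :- ((d3 :* d4) :* (G :* q))) refl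
                      (g i j) (δ i a') (δ j (suc b')) (δ i (suc a')) (δ j b') (c₁ a' b') (c₂ a' b'))
                    (+-cong (*-congʳ {g i j * c₁ a' b'} (*-cong (δ-sym i a') (δ-sym j (suc b'))))
                        (-‿cong (*-congʳ {g i j * c₂ a' b'} (*-cong (δ-sym i (suc a')) (δ-sym j b')))))

  πtop·ιtop : ∀ k k' → k ≤ K → ΣN (suc M) (λ i → ΣN (suc N) (λ j → πtop k i j * ιtop i j k')) ≈ δ k k'
  πtop·ιtop k k' k≤K = begin
    ΣN (suc M) (λ i → ΣN (suc N) (λ j → πtop k i j * ιtop i j k'))
      ≈⟨ ΣN-cong (suc M) (λ i → ΣN-cong (suc N) {g = λ j → δ (i ℕ.+ j) k' * F i} (λ j → term i j)) ⟩
    ΣN (suc M) (λ i → ΣN (suc N) (λ j → δ (i ℕ.+ j) k' * F i))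
      ≈⟨ ΣN-cong (suc M) {g = λ i → step i k' * F i} (λ i → ΣN-δ-shift N i k' (λ _ → F i) (hyp i)) ⟩
    ΣN (suc M) (λ i → step i k' * F i)
      ≈⟨ ΣN-cong (suc M) {g = λ i → (δ k' k * binomK⁻¹ k) * (step i k * wt k i)} (λ i → outer i) ⟩
    ΣN (suc M) (λ i → (δ k' k * binomK⁻¹ k) * (step i k * wt k i)) ≈⟨ sym
        (ΣN-*ˡ (suc M) (δ k' k * binomK⁻¹ k) (λ i → step i k * wt k i)) ⟩
    (δ k' k * binomK⁻¹ k) * ΣN (suc M) (λ i → step i k * wt k i) ≈⟨ *-congˡ {δ k' k * binomK⁻¹ k} (ΣN-step-wt k) ⟩
    (δ k' k * binomK⁻¹ k) * binomK k ≈⟨ trans (*-assoc _ _ _) (trans (*-congˡ {δ k' k} (binomK-inverseˡ k k≤K)) (*-identityʳ _)) ⟩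
    δ k' k ≈⟨ δ-sym k' k ⟩
    δ k k' ∎
    where
    F : ℕ → Carrier
    F i = δ k' k * (wt k i * binomK⁻¹ k)
    term : ∀ i j → πtop k i j * ιtop i j k' ≈ δ (i ℕ.+ j) k' * F i
    term i j = trans (*-comm _ _) (δ-when (i ℕ.+ j) k' (λ e → *-congʳ {wt k i * binomK⁻¹ k} (reflexive (≡.cong (λ u → δ u k) e))))
    hyp : ∀ i → N < k' ∸ i → F i ≈ 0#
    hyp i p = trans (δ-when k' k (λ e → trans
        (*-congʳ {binomK⁻¹ k} (wt-beyondN k i (≡.subst (λ u → N < u ∸ i) e p))) (zeroˡ _))) (zeroʳ _)
    outer : ∀ i → step i k' * F i ≈ (δ k' k * binomK⁻¹ k) * (step i k * wt k i)
    outer i = begin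
      step i k' * (δ k' k * (wt k i * binomK⁻¹ k)) ≈⟨ solve 4
          (λ s d l c → s :* (d :* (l :* c)) := d :* (s :* (c :* l))) refl (step i k') (δ k' k) (wt k i) (binomK⁻¹ k) ⟩
      δ k' k * (step i k' * (binomK⁻¹ k * wt k i)) ≈⟨ δ-when k' k
          (λ e → *-congʳ {binomK⁻¹ k * wt k i} (reflexive (≡.cong (step i) e))) ⟩
      δ k' k * (step i k * (binomK⁻¹ k * wt k i)) ≈⟨ solve 4
          (λ s d l c → d :* (s :* (c :* l)) := (d :* c) :* (s :* l)) refl (step i k) (δ k' k) (wt k i) (binomK⁻¹ k) ⟩
      (δ k' k * binomK⁻¹ k) * (step i k * wt k i) ∎

  πtop·Ω : ∀ k a' b' → a' ≤ m → b' ≤ n → ΣN (suc M) (λ i → ΣN (suc N) (λ j → πtop k i j * Ω i j a' b')) ≈ 0#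
  πtop·Ω k a' b' a'≤m b'≤n = begin
    ΣN (suc M) (λ i → ΣN (suc N) (λ j → πtop k i j * Ω i j a' b')) ≈⟨ ΣΣ-Ω (πtop k) a' b' a'≤m b'≤n ⟩
    (δ (a' ℕ.+ suc b') k * (wt k a' * binomK⁻¹ k)) * c₁ a' b' - (δ L' k * (wt k (suc a') * binomK⁻¹ k)) * c₂ a' b'
      ≈⟨ +-congʳ (*-congʳ {c₁ a' b'} (*-congʳ {wt k a' * binomK⁻¹ k} (reflexive (≡.cong (λ u → δ u k) (ℕP.+-suc a' b'))))) ⟩
    (δ L' k * (wt k a' * binomK⁻¹ k)) * c₁ a' b' - (δ L' k * (wt k (suc a') * binomK⁻¹ k)) * c₂ a' b'
      ≈⟨ solve 6 (λ d l1 l2 c p q → (d :* (l1 :* c)) :* p :- (d :* (l2 :* c)) :* q := d :*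
          (c :* (l1 :* p :- l2 :* q))) refl (δ L' k) (wt k a') (wt k (suc a')) (binomK⁻¹ k) (c₁ a' b') (c₂ a' b') ⟩
    δ L' k * (binomK⁻¹ k * (wt k a' * c₁ a' b' - wt k (suc a') * c₂ a' b'))
      ≈⟨ δ-when L' k (λ { ≡.refl → *-congˡ {binomK⁻¹ L'} (trans (+-congʳ (wt-absorb a' b')) (-‿inverseʳ _)) }) ⟩
    δ L' k * (binomK⁻¹ k * 0#) ≈⟨ trans (*-congˡ {δ L' k} (zeroʳ _)) (zeroʳ _) ⟩
    0# ∎
    where L' = suc (a' ℕ.+ b')

  step-* : ∀ i a L → a ≤ L → step i L * step i a ≈ step i a
  step-* i a L a≤L with i ℕ.≤? a
  ... | yes i≤a = trans (*-congʳ {step i a} (step-≤ i L (ℕP.≤-trans i≤a a≤L))) (*-identityˡ _)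
  ... | no i≰a = trans (*-congˡ {step i L} (step-> i a (ℕP.≰⇒> i≰a))) (trans (zeroʳ _) (sym (step-> i a (ℕP.≰⇒> i≰a))))

  πΩ·ιtop : ∀ a b k' → a ≤ m → b ≤ n → ΣN (suc M) (λ i → ΣN (suc N) (λ j → πΩ a b i j * ιtop i j k')) ≈ 0#
  πΩ·ιtop a b k' a≤m b≤n = begin
    ΣN (suc M) (λ i → ΣN (suc N) (λ j → πΩ a b i j * ιtop i j k'))
      ≈⟨ ΣN-cong (suc M) (λ i → ΣN-cong (suc N) {g = λ j → δ (i ℕ.+ j) k' * F i} (λ j → term i j)) ⟩
    ΣN (suc M) (λ i → ΣN (suc N) (λ j → δ (i ℕ.+ j) k' * F i))
      ≈⟨ ΣN-cong (suc M) {g = λ i → step i k' * F i} (λ i → ΣN-δ-shift N i k' (λ _ → F i) (hyp i)) ⟩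
    ΣN (suc M) (λ i → step i k' * F i)
      ≈⟨ ΣN-cong (suc M) {g = λ i → (δ Lv k' * norm⁻¹ a Lv) * (step i Lv * πΩcoef a i Lv)} (λ i → outer i) ⟩
    ΣN (suc M) (λ i → (δ Lv k' * norm⁻¹ a Lv) * (step i Lv * πΩcoef a i Lv)) ≈⟨ sym
        (ΣN-*ˡ (suc M) (δ Lv k' * norm⁻¹ a Lv) (λ i → step i Lv * πΩcoef a i Lv)) ⟩
    (δ Lv k' * norm⁻¹ a Lv) * ΣN (suc M) (λ i → step i Lv * πΩcoef a i Lv) ≈⟨ *-congˡ {δ Lv k' * norm⁻¹ a Lv} sumP ⟩
    (δ Lv k' * norm⁻¹ a Lv) * 0# ≈⟨ zeroʳ _ ⟩
    0# ∎
    where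
    Lv = suc (a ℕ.+ b)
    Lv≤K : Lv ≤ K
    Lv≤K = s≤s (ℕP.+-mono-≤ a≤m (ℕP.m≤n⇒m≤1+n b≤n))
    Y : ℕ → ℕ → Carrier
    Y i u = πΩcoef a i u * norm⁻¹ a u
    F : ℕ → Carrier
    F i = δ Lv k' * Y i Lv
    term : ∀ i j → πΩ a b i j * ιtop i j k' ≈ δ (i ℕ.+ j) k' * F i
    term i j = trans (*-comm _ _) (δ-when (i ℕ.+ j) k'
        (λ e → trans (reflexive (≡.cong (λ u → δ Lv u * Y i u) e)) (δ-when Lv k' (λ e' → reflexive (≡.cong (Y i) (≡.sym e'))))))
    hyp : ∀ i → N < k' ∸ i → F i ≈ 0#
    hyp i p = trans (δ-when Lv k' (λ e → lem (wt-beyondN Lv i (≡.subst (λ u → N < u ∸ i) (≡.sym e) p)))) (zeroʳ _)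
      where
      lem : wt Lv i ≈ 0# → Y i Lv ≈ 0#
      lem z = trans (*-congʳ {norm⁻¹ a Lv} (+-cong (trans (*-congˡ {step i a} z) (zeroʳ _))
          (-‿cong (trans (*-congʳ {partialWt a Lv} (trans (*-congʳ {binomK⁻¹ Lv} z) (zeroˡ _))) (zeroˡ _)))))
          (trans (*-congʳ {norm⁻¹ a Lv} (trans (+-identityˡ _) -0#≈0#)) (zeroˡ _))
    outer : ∀ i → step i k' * F i ≈ (δ Lv k' * norm⁻¹ a Lv) * (step i Lv * πΩcoef a i Lv)
    outer i = begin
      step i k' * (δ Lv k' * (πΩcoef a i Lv * norm⁻¹ a Lv)) ≈⟨ solve 4
          (λ s d p q → s :* (d :* (p :* q)) := d :* (s :* (q :* p))) refl (step i k') (δ Lv k') (πΩcoef a i Lv) (norm⁻¹ a Lv) ⟩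
      δ Lv k' * (step i k' * (norm⁻¹ a Lv * πΩcoef a i Lv)) ≈⟨ δ-when Lv k'
          (λ e → *-congʳ {norm⁻¹ a Lv * πΩcoef a i Lv} (reflexive (≡.cong (step i) (≡.sym e)))) ⟩
      δ Lv k' * (step i Lv * (norm⁻¹ a Lv * πΩcoef a i Lv)) ≈⟨ solve 4
          (λ s d p q → d :* (s :* (q :* p)) := (d :* q) :* (s :* p)) refl (step i Lv) (δ Lv k') (πΩcoef a i Lv) (norm⁻¹ a Lv) ⟩
      (δ Lv k' * norm⁻¹ a Lv) * (step i Lv * πΩcoef a i Lv) ∎
    sumP : ΣN (suc M) (λ i → step i Lv * πΩcoef a i Lv) ≈ 0#
    sumP = begin
      ΣN (suc M) (λ i → step i Lv * πΩcoef a i Lv)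
        ≈⟨ ΣN-cong (suc M) {g = λ i → step i a * wt Lv i + -
            ((step i Lv * wt Lv i) * (binomK⁻¹ Lv * partialWt a Lv))}
            (λ i → trans (solve 6 (λ s t l c x y → s :* (t :* l :- (l :* c) :* x) := (s :* t) :* l :+ :-
            ((s :* l) :* (c :* x))) refl (step i Lv) (step i a) (wt Lv i) (binomK⁻¹ Lv) (partialWt a Lv)
            (partialWt a Lv)) (+-congʳ (*-congʳ {wt Lv i} (step-* i a Lv (ℕP.≤-trans (ℕP.m≤m+n a b) (ℕP.n≤1+n _)))))) ⟩
      ΣN (suc M) (λ i → step i a * wt Lv i + - ((step i Lv * wt Lv i) * (binomK⁻¹ Lv * partialWt a Lv)))
        ≈⟨ trans (ΣN-+ (suc M) (λ i → step i a * wt Lv i)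
            (λ i → - ((step i Lv * wt Lv i) * (binomK⁻¹ Lv * partialWt a Lv))))
            (+-congˡ (trans (ΣN-neg (suc M) (λ i → (step i Lv * wt Lv i) * (binomK⁻¹ Lv * partialWt a Lv)))
            (-‿cong (sym (ΣN-*ʳ (suc M) (binomK⁻¹ Lv * partialWt a Lv) (λ i → step i Lv * wt Lv i)))))) ⟩
      ΣN (suc M) (λ i → step i a * wt Lv i) - ΣN (suc M) (λ i → step i Lv * wt Lv i) * (binomK⁻¹ Lv * partialWt a Lv)
        ≈⟨ +-cong (ΣN-step (suc M) a (wt Lv) (s≤s (ℕP.m≤n⇒m≤1+n a≤m)))
            (-‿cong (*-congʳ {binomK⁻¹ Lv * partialWt a Lv} (ΣN-step-wt Lv))) ⟩
      partialWt a Lv - binomK Lv * (binomK⁻¹ Lv * partialWt a Lv) ≈⟨ +-congˡ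
          (-‿cong (trans (sym (*-assoc _ _ _)) (trans (*-congʳ {partialWt a Lv} (binomK-inverseʳ Lv Lv≤K)) (*-identityˡ _)))) ⟩
      partialWt a Lv - partialWt a Lv ≈⟨ -‿inverseʳ _ ⟩
      0# ∎

  πΩ·Ω : ∀ a b a' b' → a ≤ m → b ≤ n → a' ≤ m → b' ≤ n → ΣN (suc M)
      (λ i → ΣN (suc N) (λ j → πΩ a b i j * Ω i j a' b')) ≈ δ a a' * δ b b'
  πΩ·Ω a b a' b' a≤m b≤n a'≤m b'≤n = begin
    ΣN (suc M) (λ i → ΣN (suc N) (λ j → πΩ a b i j * Ω i j a' b')) ≈⟨ ΣΣ-Ω (πΩ a b) a' b' a'≤m b'≤n ⟩
    πΩ a b a' (suc b') * c₁ a' b' - πΩ a b (suc a') b' * c₂ a' b'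
      ≈⟨ +-congʳ (*-congʳ {c₁ a' b'} (reflexive (≡.cong (λ u → δ Lv u * (πΩcoef a a' u * norm⁻¹ a u)) (ℕP.+-suc a' b')))) ⟩
    (δ Lv Lv' * (πΩcoef a a' Lv' * norm⁻¹ a Lv')) * c₁ a' b' - (δ Lv Lv' * (πΩcoef a (suc a') Lv' * norm⁻¹ a Lv')) * c₂ a' b'
      ≈⟨ solve 6 (λ d p1 p2 q x y → (d :* (p1 :* q)) :* x :- (d :* (p2 :* q)) :* y := d :*
          (q :* (p1 :* x :- p2 :* y))) refl (δ Lv Lv') (πΩcoef a a' Lv') (πΩcoef a (suc a') Lv')
          (norm⁻¹ a Lv') (c₁ a' b') (c₂ a' b') ⟩
    δ Lv Lv' * (norm⁻¹ a Lv' * (πΩcoef a a' Lv' * c₁ a' b' - πΩcoef a (suc a') Lv' * c₂ a' b'))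
        ≈⟨ *-congˡ {δ Lv Lv'} (*-congˡ {norm⁻¹ a Lv'} combo) ⟩
    δ Lv Lv' * (norm⁻¹ a Lv' * (δ a' a * norm a' Lv')) ≈⟨ fin (a ℕ.≟ a') (b ℕ.≟ b') ⟩
    δ a a' * δ b b' ∎
    where
    Lv = suc (a ℕ.+ b)
    Lv' = suc (a' ℕ.+ b')
    ℓ1 = wt Lv' a'
    ℓ2 = wt Lv' (suc a')
    s1 = step a' a
    s2 = step (suc a') a
    X = binomK⁻¹ Lv' * partialWt a Lv'
    combo : πΩcoef a a' Lv' * c₁ a' b' - πΩcoef a (suc a') Lv' * c₂ a' b' ≈ δ a' a * norm a' Lv'
    combo = begin
      (s1 * ℓ1 - (ℓ1 * binomK⁻¹ Lv') * partialWt a Lv') * c₁ a' b' - (s2 * ℓ2 - (ℓ2 * binomK⁻¹ Lv') * partialWt a Lv') * c₂ a' b'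
        ≈⟨ solve 8 (λ s1 s2 l1 l2 c partialWt p q → (s1 :* l1 :- (l1 :* c) :* partialWt) :* p :-
            (s2 :* l2 :- (l2 :* c) :* partialWt) :* q := (s1 :- c :* partialWt) :* (l1 :* p) :-
            (s2 :- c :* partialWt) :* (l2 :* q)) refl s1 s2 ℓ1 ℓ2 (binomK⁻¹ Lv') (partialWt a Lv') (c₁ a' b') (c₂ a' b') ⟩
      (s1 - X) * (ℓ1 * c₁ a' b') - (s2 - X) * (ℓ2 * c₂ a' b') ≈⟨ +-congˡ (-‿cong (*-congˡ {s2 - X} (sym (wt-absorb a' b')))) ⟩
      (s1 - X) * (ℓ1 * c₁ a' b') - (s2 - X) * (ℓ1 * c₁ a' b')
        ≈⟨ solve 4 (λ s1 s2 X Z → (s1 :- X) :* Z :- (s2 :- X) :* Z := (s1 :- s2) :* Z) refl s1 s2 X (ℓ1 * c₁ a' b') ⟩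
      (s1 - s2) * (ℓ1 * c₁ a' b') ≈⟨ *-cong (step-diffˡ a' a) (sym (norm≈wt*c₁ a' b')) ⟩
      δ a' a * norm a' Lv' ∎
    fin : Dec (a ≡ a') → Dec (b ≡ b') → δ Lv Lv' *
        (norm⁻¹ a Lv' * (δ a' a * norm a' Lv')) ≈ δ a a' * δ b b'
    fin (no ne) _ = trans (*-congˡ {δ Lv Lv'}
        (trans (*-congˡ {norm⁻¹ a Lv'} (trans (*-congʳ {norm a' Lv'} (δ-≢ a' a (λ e → ne (≡.sym e))))
        (zeroˡ _))) (zeroʳ _))) (trans (zeroʳ _) (sym (trans (*-congʳ {δ b b'} (δ-≢ a a' ne)) (zeroˡ _))))
    fin (yes ≡.refl) (no ne) = trans (*-congʳ
        (δ-≢ Lv Lv' (λ e → ne (ℕP.+-cancelˡ-≡ a b b' (ℕP.suc-injective e)))))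
        (trans (zeroˡ _) (sym (trans (*-congˡ {δ a a} (δ-≢ b b' ne)) (zeroʳ _))))
    fin (yes ≡.refl) (yes ≡.refl) = begin
      δ Lv Lv * (norm⁻¹ a Lv * (δ a a * norm a Lv)) ≈⟨ *-cong (δ-refl Lv)
          (*-congˡ {norm⁻¹ a Lv} (trans (*-congʳ {norm a Lv} (δ-refl a)) (*-identityˡ _))) ⟩
      1# * (norm⁻¹ a Lv * norm a Lv) ≈⟨ trans (*-identityˡ _) (trans (*-comm _ _) (norm-inverseʳ a b a≤m b≤n)) ⟩
      1# ≈⟨ sym (trans (*-cong (δ-refl a) (δ-refl b)) (*-identityˡ _)) ⟩
      δ a a * δ b b ∎

  πΩcoef≈0 : ∀ a i0 k → i0 ≤ a → partialWt a k ≈ binomK k → k ≤ K → πΩcoef a i0 k ≈ 0#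
  πΩcoef≈0 a i0 k i0≤a SC k≤K = begin
    step i0 a * wt k i0 - (wt k i0 * binomK⁻¹ k) * partialWt a k ≈⟨ +-cong
        (trans (*-congʳ {wt k i0} (step-≤ i0 a i0≤a)) (*-identityˡ _)) (-‿cong (*-congˡ {wt k i0 * binomK⁻¹ k} SC)) ⟩
    wt k i0 - (wt k i0 * binomK⁻¹ k) * binomK k ≈⟨ +-congˡ
        (-‿cong (trans (*-assoc _ _ _) (trans (*-congˡ {wt k i0} (binomK-inverseˡ k k≤K)) (*-identityʳ _)))) ⟩
    wt k i0 - wt k i0 ≈⟨ -‿inverseʳ _ ⟩
    0# ∎

  πΩcoef-top≈0 : ∀ i' i0 → πΩcoef i' i0 (suc i' ℕ.+ N) ≈ 0#
  πΩcoef-top≈0 i' i0 = begin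
    step i0 i' * wt k i0 - (wt k i0 * binomK⁻¹ k) * partialWt i' k ≈⟨ +-cong t1
        (-‿cong (trans (*-congˡ {wt k i0 * binomK⁻¹ k}
        (trans (ΣN-cong< (suc i') {wt k} {λ _ → 0#} (λ r r<si' → wt-beyondN k r (big r (ℕP.≤-pred r<si'))))
        (ΣN-0 (suc i')))) (zeroʳ _))) ⟩
    0# - 0# ≈⟨ -‿inverseʳ _ ⟩
    0# ∎
    where
    k = suc i' ℕ.+ N
    big : ∀ r → r ≤ i' → N < k ∸ r
    big r r≤i' = ≡.subst (N <_) (≡.sym (ℕP.+-∸-comm N (ℕP.m≤n⇒m≤1+n r≤i')))
        (ℕP.≤-trans (s≤s (ℕP.m≤n+m N _)) (ℕP.≤-reflexive (≡.cong (ℕ._+ N) (≡.sym (ℕP.+-∸-assoc 1 r≤i')))))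
    t1 : step i0 i' * wt k i0 ≈ 0#
    t1 with i0 ℕ.≤? i'
    ... | yes p = trans (*-congˡ {step i0 i'} (wt-beyondN k i0 (big i0 p))) (zeroʳ _)
    ... | no p = trans (*-congʳ {wt k i0} (step-> i0 i' (ℕP.≰⇒> p))) (zeroˡ _)

  module ProjectionColumn (i0 j0 : ℕ) (i0≤M : i0 ≤ M) (j0≤N : j0 ≤ N) where
    k0 = i0 ℕ.+ j0
    πcol : ℕ → ℕ → Carrier
    πcol a b = πΩ a b i0 j0
    h1 h2 : ℕ → ℕ → Carrier
    h1 a b = c₁ a b * πcol a b
    h2 a b = c₂ a b * πcol a b
    Ω₁-part Ω₂-part : ℕ → ℕ → Carrier
    Ω₁-part i j = ΣN (suc m) (λ a → ΣN (suc n) (λ b → (δ i a * δ j (suc b)) * h1 a b))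
    Ω₂-part i j = ΣN (suc m) (λ a → ΣN (suc n) (λ b → (δ i (suc a) * δ j b) * h2 a b))

    πΩcoef-prev : ℕ → ℕ → Carrier
    πΩcoef-prev zero k = 0#
    πΩcoef-prev (suc i') k = πΩcoef i' i0 k

    norm-cancel : ∀ a b → a ≤ m → b ≤ n → ∀ x → x ≈ norm a (suc (a ℕ.+ b)) →
          x * (δ (suc (a ℕ.+ b)) k0 * (πΩcoef a i0 k0 * norm⁻¹ a k0)) ≈ δ k0 (suc (a ℕ.+ b)) * πΩcoef a i0 (suc (a ℕ.+ b))
    norm-cancel a b a≤m b≤n x xQ = begin
      x * (δ Lv k0 * (πΩcoef a i0 k0 * norm⁻¹ a k0)) ≈⟨ solve 4
          (λ x d p q → x :* (d :* (p :* q)) := d :* (x :* (p :* q))) refl x (δ Lv k0) (πΩcoef a i0 k0) (norm⁻¹ a k0) ⟩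
      δ Lv k0 * (x * (πΩcoef a i0 k0 * norm⁻¹ a k0)) ≈⟨ δ-when Lv k0
          (λ e → *-congˡ {x} (reflexive (≡.cong (λ u → πΩcoef a i0 u * norm⁻¹ a u) (≡.sym e)))) ⟩
      δ Lv k0 * (x * (πΩcoef a i0 Lv * norm⁻¹ a Lv)) ≈⟨ *-congˡ {δ Lv k0}
          (trans (*-congʳ xQ) (solve 3 (λ x p q → x :* (p :* q) := p :* (x :* q)) refl (norm a Lv)
          (πΩcoef a i0 Lv) (norm⁻¹ a Lv))) ⟩
      δ Lv k0 * (πΩcoef a i0 Lv * (norm a Lv * norm⁻¹ a Lv)) ≈⟨ *-congˡ {δ Lv k0}
          (trans (*-congˡ {πΩcoef a i0 Lv} (norm-inverseʳ a b a≤m b≤n)) (*-identityʳ _)) ⟩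
      δ Lv k0 * πΩcoef a i0 Lv ≈⟨ *-congʳ (δ-sym Lv k0) ⟩
      δ k0 Lv * πΩcoef a i0 Lv ∎
      where Lv = suc (a ℕ.+ b)

    wt*Ω₁-part : ∀ i j → i ≤ M → j ≤ N → wt (i ℕ.+ j) i * Ω₁-part i j ≈ δ k0 (i ℕ.+ j) * πΩcoef i i0 (i ℕ.+ j)
    wt*Ω₁-part i zero i≤M _ = trans (*-congˡ
        (ΣN-≈0 (suc m) _ (λ a → ΣN-≈0 (suc n) _ (λ b → trans (*-congʳ {h1 a b} (zeroʳ (δ i a))) (zeroˡ _)))))
        (trans (zeroʳ _) (sym (trans (δ-when k0 (i ℕ.+ 0)
        (λ e → πΩcoef≈0 i i0 (i ℕ.+ 0) (i0≤ e) (trans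
        (reflexive (≡.cong (λ u → partialWt u (i ℕ.+ 0)) (≡.sym (ℕP.+-identityʳ i))))
        (partialWt-full (i ℕ.+ 0))) (≡.subst (_≤ K) (≡.sym (ℕP.+-identityʳ i)) (ℕP.≤-trans i≤M (ℕP.m≤m+n M N))))) (zeroʳ _))))
      where
      i0≤ : k0 ≡ i ℕ.+ 0 → i0 ≤ i
      i0≤ e = ≡.subst (i0 ≤_) (≡.trans e (ℕP.+-identityʳ i)) (ℕP.m≤m+n i0 j0)
    wt*Ω₁-part i (suc j') i≤M sj≤N with i ℕ.≤? m
    ... | no i≰m = trans (*-congˡ (ΣΣ-δδ-beyond₁ (suc m) (suc n) h1 i j' (ℕP.≰⇒> i≰m)))
        (trans (zeroʳ _) (sym (trans (*-congˡ {δ k0 (i ℕ.+ suc j')}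
        (πΩcoef≈0 i i0 (i ℕ.+ suc j') (≡.subst (i0 ≤_) (≡.sym iM) i0≤M)
        (≡.subst (λ u → partialWt u (i ℕ.+ suc j') ≈ binomK (i ℕ.+ suc j')) (≡.sym iM)
        (partialWt-beyondM (i ℕ.+ suc j') (≡.subst (_≤ i ℕ.+ suc j') iM (ℕP.m≤m+n i (suc j'))))) k≤K)) (zeroʳ _))))
      where
      iM : i ≡ M
      iM = ℕP.≤-antisym i≤M (ℕP.≰⇒> i≰m)
      k≤K : i ℕ.+ suc j' ≤ K
      k≤K = ℕP.+-mono-≤ i≤M sj≤N
    ... | yes i≤m = begin
      wt (i ℕ.+ suc j') i * Ω₁-part i (suc j') ≈⟨ *-congˡ (ΣΣ-δδ (suc m) (suc n) h1 i j' (s≤s i≤m) sj≤N) ⟩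
      wt (i ℕ.+ suc j') i * (c₁ i j' * πcol i j') ≈⟨ reflexive (≡.cong (λ u → wt u i * (c₁ i j' * πcol i j')) e) ⟩
      wt Lv i * (c₁ i j' * πcol i j') ≈⟨ sym (*-assoc _ _ _) ⟩
      (wt Lv i * c₁ i j') * πcol i j' ≈⟨ norm-cancel i j' i≤m (ℕP.≤-pred sj≤N) (wt Lv i * c₁ i j') (sym (norm≈wt*c₁ i j')) ⟩
      δ k0 Lv * πΩcoef i i0 Lv ≈⟨ reflexive (≡.cong (λ u → δ k0 u * πΩcoef i i0 u) (≡.sym e)) ⟩
      δ k0 (i ℕ.+ suc j') * πΩcoef i i0 (i ℕ.+ suc j') ∎
      where
      Lv = suc (i ℕ.+ j')
      e : i ℕ.+ suc j' ≡ Lv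
      e = ℕP.+-suc i j'

    wt*Ω₂-part : ∀ i j → i ≤ M → j ≤ N → wt (i ℕ.+ j) i * Ω₂-part i j ≈ δ k0 (i ℕ.+ j) * πΩcoef-prev i (i ℕ.+ j)
    wt*Ω₂-part zero j _ _ = trans (*-congˡ (ΣN-≈0 (suc m) _
        (λ a → ΣN-≈0 (suc n) _ (λ b → trans (*-congʳ {h2 a b} (zeroˡ (δ j b))) (zeroˡ _))))) (trans (zeroʳ _) (sym (zeroʳ _)))
    wt*Ω₂-part (suc i') j si≤M j≤N with j ℕ.≤? n
    ... | no j≰n = trans (*-congˡ (ΣΣ-δδ-beyond₂ (suc m) (suc n) h2 i' j (ℕP.≰⇒> j≰n)))
        (trans (zeroʳ _) (sym (trans (*-congˡ (≡.subst (λ u → πΩcoef i' i0 (suc i' ℕ.+ u) ≈ 0#) (≡.sym jN)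
        (πΩcoef-top≈0 i' i0))) (zeroʳ _))))
      where
      jN : j ≡ N
      jN = ℕP.≤-antisym j≤N (ℕP.≰⇒> j≰n)
    ... | yes j≤n = begin
      wt Lv (suc i') * Ω₂-part (suc i') j ≈⟨ *-congˡ (ΣΣ-δδ (suc m) (suc n) h2 i' j si≤M (s≤s j≤n)) ⟩
      wt Lv (suc i') * (c₂ i' j * πcol i' j) ≈⟨ sym (*-assoc _ _ _) ⟩
      (wt Lv (suc i') * c₂ i' j) * πcol i' j ≈⟨ norm-cancel i' j (ℕP.≤-pred si≤M) j≤n
          (wt Lv (suc i') * c₂ i' j) (trans (sym (wt-absorb i' j)) (sym (norm≈wt*c₁ i' j))) ⟩
      δ k0 Lv * πΩcoef i' i0 Lv ∎
      where
      Lv = suc (i' ℕ.+ j)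

    πΩcoef-telescope : ∀ i k → πΩcoef i i0 k - πΩcoef-prev i k ≈ δ i0 i * wt k i0 - (wt k i0 * binomK⁻¹ k) * wt k i
    πΩcoef-telescope zero k = begin
      (step i0 0 * wt k i0 - (wt k i0 * binomK⁻¹ k) * (wt k 0 + 0#)) - 0# ≈⟨ solve 4
          (λ s l c l0 → (s :* l :- (l :* c) :* (l0 :+ con (+ 0))) :- con (+ 0) := s :* l :-
          (l :* c) :* l0) refl (step i0 0) (wt k i0) (binomK⁻¹ k) (wt k 0) ⟩
      step i0 0 * wt k i0 - (wt k i0 * binomK⁻¹ k) * wt k 0 ≈⟨ +-congʳ (*-congʳ (step-0 i0)) ⟩
      δ i0 0 * wt k i0 - (wt k i0 * binomK⁻¹ k) * wt k 0 ∎
    πΩcoef-telescope (suc i') k = begin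
      (step i0 (suc i') * wt k i0 - (wt k i0 * binomK⁻¹ k) * partialWt (suc i') k) -
          (step i0 i' * wt k i0 - (wt k i0 * binomK⁻¹ k) * partialWt i' k)
        ≈⟨ +-congʳ (+-congˡ (-‿cong (*-congˡ (ΣN-last (suc i') (wt k))))) ⟩
      (step i0 (suc i') * wt k i0 - (wt k i0 * binomK⁻¹ k) * (partialWt i' k + wt k (suc i'))) -
          (step i0 i' * wt k i0 - (wt k i0 * binomK⁻¹ k) * partialWt i' k)
        ≈⟨ solve 6 (λ s1 s0 l c partialWt l1 → (s1 :* l :- (l :* c) :* (partialWt :+ l1)) :-
            (s0 :* l :- (l :* c) :* partialWt) := (s1 :- s0) :* l :- (l :* c) :* l1) refl (step i0 (suc i'))
            (step i0 i') (wt k i0) (binomK⁻¹ k) (partialWt i' k) (wt k (suc i')) ⟩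
      (step i0 (suc i') - step i0 i') * wt k i0 - (wt k i0 * binomK⁻¹ k) * wt k (suc i') ≈⟨ +-congʳ (*-congʳ (step-diffʳ i0 i')) ⟩
      δ i0 (suc i') * wt k i0 - (wt k i0 * binomK⁻¹ k) * wt k (suc i') ∎

    δ-wt-diagonal : ∀ i j → δ k0 (i ℕ.+ j) * (δ i0 i * wt (i ℕ.+ j) i0) ≈ wt (i ℕ.+ j) i * (δ i i0 * δ j j0)
    δ-wt-diagonal i j with i0 ℕ.≟ i | j0 ℕ.≟ j
    ... | yes ≡.refl | yes ≡.refl = trans (*-cong (δ-refl k0) (trans (*-congʳ (δ-refl i0)) (*-identityˡ _)))
        (trans (*-identityˡ _) (sym (trans (*-congˡ (trans (*-cong (δ-refl i0) (δ-refl j0)) (*-identityˡ _))) (*-identityʳ _))))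
    ... | no ne | _ = trans (*-congˡ (trans (*-congʳ (δ-≢ i0 i ne)) (zeroˡ _)))
        (trans (zeroʳ _) (sym (trans (*-congˡ (trans (*-congʳ (δ-≢ i i0 (λ e → ne (≡.sym e)))) (zeroˡ _))) (zeroʳ _))))
    ... | yes ≡.refl | no ne = trans (*-congʳ (δ-≢ k0 (i0 ℕ.+ j) (λ e → ne (ℕP.+-cancelˡ-≡ i0 j0 j e))))
        (trans (zeroˡ _) (sym (trans (*-congˡ (trans (*-congˡ (δ-≢ j j0 (λ e → ne (≡.sym e)))) (zeroʳ _))) (zeroʳ _))))

    ιπ-entry : ∀ i j → i ≤ M → j ≤ N →
           ΣN (suc K) (λ k → ιtop i j k * πtop k i0 j0) + ΣN (suc m)
               (λ a → ΣN (suc n) (λ b → Ω i j a b * πcol a b)) ≈ δ i i0 * δ j j0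
    ιπ-entry i j i≤M j≤N = begin
      ΣN (suc K) (λ k' → ιtop i j k' * πtop k' i0 j0) + ΣN (suc m) (λ a → ΣN (suc n) (λ b → Ω i j a b * πcol a b))
        ≈⟨ +-cong (ΣN-δ (suc K) k (λ k' → πtop k' i0 j0) (s≤s (ℕP.+-mono-≤ i≤M j≤N))) second ⟩
      X ≈⟨ *-cancelˡ-inv (wt-inverseʳ k i i≤M (ℕP.≤-trans (ℕP.≤-reflexive (ℕP.m+n∸m≡n i j)) j≤N)) main ⟩
      δ i i0 * δ j j0 ∎
      where
      k = i ℕ.+ j
      ℓi = wt k i
      X = πtop k i0 j0 + (Ω₁-part i j - Ω₂-part i j)
      T1 T2 : ℕ → ℕ → Carrier
      T1 a b = (δ i a * δ j (suc b)) * h1 a b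
      T2 a b = (δ i (suc a) * δ j b) * h2 a b
      second : ΣN (suc m) (λ a → ΣN (suc n) (λ b → Ω i j a b * πcol a b)) ≈ Ω₁-part i j - Ω₂-part i j
      second = begin
        ΣN (suc m) (λ a → ΣN (suc n) (λ b → Ω i j a b * πcol a b))
          ≈⟨ ΣN-cong (suc m) {g = λ a → ΣN (suc n) (λ b → T1 a b + - T2 a b)}
              (λ a → ΣN-cong (suc n) {g = λ b → T1 a b + - T2 a b} (λ b →
               solve 7 (λ d1 d2 d3 d4 p q G → ((d1 :* d2) :* p :- (d3 :* d4) :* q) :* G := (d1 :* d2) :*
                   (p :* G) :+ :- ((d3 :* d4) :* (q :* G))) refl
                 (δ i a) (δ j (suc b)) (δ i (suc a)) (δ j b) (c₁ a b) (c₂ a b) (πcol a b))) ⟩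
        ΣN (suc m) (λ a → ΣN (suc n) (λ b → T1 a b + - T2 a b))
          ≈⟨ ΣN-cong (suc m) {g = λ a → ΣN (suc n) (T1 a) + - ΣN (suc n) (T2 a)}
              (λ a → trans (ΣN-+ (suc n) (T1 a) (λ b → - T2 a b)) (+-congˡ (ΣN-neg (suc n) (T2 a)))) ⟩
        ΣN (suc m) (λ a → ΣN (suc n) (T1 a) + - ΣN (suc n) (T2 a))
          ≈⟨ trans (ΣN-+ (suc m) (λ a → ΣN (suc n) (T1 a)) (λ a → - ΣN (suc n) (T2 a)))
              (+-congˡ (ΣN-neg (suc m) (λ a → ΣN (suc n) (T2 a)))) ⟩
        Ω₁-part i j - Ω₂-part i j ∎
      main : ℓi * X ≈ ℓi * (δ i i0 * δ j j0)
      main = begin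
        ℓi * (δ k0 k * (wt k i0 * binomK⁻¹ k) + (Ω₁-part i j - Ω₂-part i j))
          ≈⟨ solve 6 (λ l d lc r1 r2 z → l :* (d :* lc :+ (r1 :- r2)) := l :* (d :* lc) :+
              (l :* r1 :- l :* r2)) refl ℓi (δ k0 k) (wt k i0 * binomK⁻¹ k) (Ω₁-part i j) (Ω₂-part i j) ℓi ⟩
        ℓi * (δ k0 k * (wt k i0 * binomK⁻¹ k)) + (ℓi * Ω₁-part i j - ℓi * Ω₂-part i j)
          ≈⟨ +-congˡ (+-cong (wt*Ω₁-part i j i≤M j≤N) (-‿cong (wt*Ω₂-part i j i≤M j≤N))) ⟩
        ℓi * (δ k0 k * (wt k i0 * binomK⁻¹ k)) + (δ k0 k * πΩcoef i i0 k - δ k0 k * πΩcoef-prev i k)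
          ≈⟨ solve 5 (λ l d lc p q → l :* (d :* lc) :+ (d :* p :- d :* q) := d :*
              (lc :* l :+ (p :- q))) refl ℓi (δ k0 k) (wt k i0 * binomK⁻¹ k) (πΩcoef i i0 k) (πΩcoef-prev i k) ⟩
        δ k0 k * ((wt k i0 * binomK⁻¹ k) * ℓi + (πΩcoef i i0 k - πΩcoef-prev i k)) ≈⟨ *-congˡ {δ k0 k}
            (+-congˡ (πΩcoef-telescope i k)) ⟩
        δ k0 k * ((wt k i0 * binomK⁻¹ k) * ℓi + (δ i0 i * wt k i0 - (wt k i0 * binomK⁻¹ k) * ℓi))
          ≈⟨ *-congˡ {δ k0 k} (solve 3 (λ a b c → a :* c :+ (b :- a :* c) := b) refl (wt k i0 * binomK⁻¹ k)
              (δ i0 i * wt k i0) ℓi) ⟩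
        δ k0 k * (δ i0 i * wt k i0) ≈⟨ δ-wt-diagonal i j ⟩
        ℓi * (δ i i0 * δ j j0) ∎

module ClebschGordanStep {c ℓ : Level} (𝔽 : ACF0 c ℓ) (ω : ACF0.Carrier 𝔽) (m n : ℕ) where
  open Projection 𝔽 m n public

  Vr Wr : Rep
  Vr = L ω M ⊗ L ω N
  Wr = L ω K ⊕ (L ω m ⊗ L ω n)

  qx rx : Fin (suc M ℕ.* suc N) → ℕ
  qx = fstIndex {suc M} (suc N)
  rx = sndIndex {suc M} (suc N)
  qv rv : Fin (suc m ℕ.* suc n) → ℕ
  qv = fstIndex {suc m} (suc n)
  rv = sndIndex {suc m} (suc n)

  sp : Fin (suc K ℕ.+ suc m ℕ.* suc n) → Fin (suc K) ⊎ Fin (suc m ℕ.* suc n)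
  sp = splitAt (suc K)

  ιS : ℕ → ℕ → Fin (suc K) ⊎ Fin (suc m ℕ.* suc n) → Carrier
  ιS i j (inj₁ k) = ιtop i j (toℕ k)
  ιS i j (inj₂ v) = Ω i j (qv v) (rv v)

  πS : Fin (suc K) ⊎ Fin (suc m ℕ.* suc n) → ℕ → ℕ → Carrier
  πS (inj₁ k) i j = πtop (toℕ k) i j
  πS (inj₂ v) i j = πΩ (qv v) (rv v) i j

  ιM : Mat (dim Vr) (dim Wr)
  ιM x w = ιS (qx x) (rx x) (sp w)

  πM : Mat (dim Wr) (dim Vr)
  πM w x = πS (sp w) (qx x) (rx x)

  qx≤ : ∀ x → qx x ≤ M
  qx≤ x = ℕP.≤-pred (fstIndex< {suc M} (suc N) x)
  rx≤ : ∀ x → rx x ≤ N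
  rx≤ x = ℕP.≤-pred (sndIndex< {suc M} (suc N) x)
  qv≤ : ∀ v → qv v ≤ m
  qv≤ v = ℕP.≤-pred (fstIndex< {suc m} (suc n) v)
  rv≤ : ∀ v → rv v ≤ n
  rv≤ v = ℕP.≤-pred (sndIndex< {suc m} (suc n) v)
  tk≤ : ∀ (k : Fin (suc K)) → toℕ k ≤ K
  tk≤ k = ℕP.≤-pred (FinP.toℕ<n k)

  πι : πM · ιM ≋ Id
  πι w w' = begin
    sumFin {suc M ℕ.* suc N} (λ x → πS (sp w) (qx x) (rx x) * ιS (qx x) (rx x) (sp w'))
      ≈⟨ sumFin-tensor (suc M) (suc N) (λ i j → πS (sp w) i j * ιS i j (sp w')) ⟩
    ΣN (suc M) (λ i → ΣN (suc N) (λ j → πS (sp w) i j * ιS i j (sp w'))) ≈⟨ lem (sp w) (sp w') ⟩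
    blockEntry {suc K} {suc K} {suc m ℕ.* suc n} {suc m ℕ.* suc n} Id Id (sp w) (sp w')
        ≈⟨ blockMat-Id {suc K} {suc m ℕ.* suc n} w w' ⟩
    Id w w' ∎
    where
    lem : ∀ u u' → ΣN (suc M) (λ i → ΣN (suc N)
        (λ j → πS u i j * ιS i j u')) ≈ blockEntry {suc K} {suc K} {suc m ℕ.* suc n} {suc m ℕ.* suc n} Id Id u u'
    lem (inj₁ k) (inj₁ k') = πtop·ιtop (toℕ k) (toℕ k') (tk≤ k)
    lem (inj₁ k) (inj₂ v') = πtop·Ω (toℕ k) (qv v') (rv v') (qv≤ v') (rv≤ v')
    lem (inj₂ v) (inj₁ k') = πΩ·ιtop (qv v) (rv v) (toℕ k') (qv≤ v) (rv≤ v)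
    lem (inj₂ v) (inj₂ v') = trans (πΩ·Ω (qv v) (rv v) (qv v') (rv v') (qv≤ v) (rv≤ v) (qv≤ v') (rv≤ v'))
        (sym (Id-tensor (suc m) (suc n) v v'))

  ιπ : ιM · πM ≋ Id
  ιπ x y = begin
    sumFin {suc K ℕ.+ suc m ℕ.* suc n} (λ w → ιS (qx x) (rx x) (sp w) * πS (sp w) (qx y) (rx y))
      ≈⟨ sumFin-splitAt (suc K) (suc m ℕ.* suc n) (λ u → ιS (qx x) (rx x) u * πS u (qx y) (rx y)) ⟩
    sumFin {suc K} (λ k → ιtop i j (toℕ k) * πtop (toℕ k) i0 j0) + sumFin {suc m ℕ.* suc n}
        (λ v → Ω i j (qv v) (rv v) * πΩ (qv v) (rv v) i0 j0)
      ≈⟨ +-cong (sumFin-toℕ (suc K) (λ k → ιtop i j k * πtop k i0 j0))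
          (sumFin-tensor (suc m) (suc n) (λ a b → Ω i j a b * πΩ a b i0 j0)) ⟩
    ΣN (suc K) (λ k → ιtop i j k * πtop k i0 j0) + ΣN (suc m) (λ a → ΣN (suc n) (λ b → Ω i j a b * πΩ a b i0 j0))
      ≈⟨ ProjectionColumn.ιπ-entry i0 j0 (qx≤ y) (rx≤ y) i j (qx≤ x) (rx≤ x) ⟩
    δ i i0 * δ j j0 ≈⟨ sym (Id-tensor (suc M) (suc N) x y) ⟩
    Id x y ∎
    where
    i = qx x
    j = rx x
    i0 = qx y
    j0 = rx y

  module Intertwining (α β γ : Carrier) where
    open LinearCombination α β γ

    ρWᴺ : Fin (suc K) ⊎ Fin (suc m ℕ.* suc n) → Fin (suc K) ⊎ Fin (suc m ℕ.* suc n) → Carrier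
    ρWᴺ (inj₁ k) (inj₁ k') = A' K (toℕ k) (toℕ k')
    ρWᴺ (inj₁ k) (inj₂ v') = 0#
    ρWᴺ (inj₂ v) (inj₁ k') = 0#
    ρWᴺ (inj₂ v) (inj₂ v') = kronSum (A' m) (A' n) (qv v) (rv v) (qv v') (rv v')

    intertwines : (RV : Mat (dim Vr) (dim Vr)) (RW : Mat (dim Wr) (dim Wr)) →
            (∀ x y → RV x y ≈ kronSum (A' M) (A' N) (qx x) (rx x) (qx y) (rx y)) →
            (∀ w w' → RW w w' ≈ ρWᴺ (sp w) (sp w')) → RV · ιM ≋ ιM · RW
    intertwines RV RW hV hW x w = begin
      sumFin {suc M ℕ.* suc N} (λ y → RV x y * ιM y w)
        ≈⟨ sumFin-cong (suc M ℕ.* suc N) (λ y → *-congʳ {ιM y w} (hV x y)) ⟩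
      sumFin {suc M ℕ.* suc N} (λ y → kronSum (A' M) (A' N) i j (qx y) (rx y) * ιS (qx y) (rx y) u)
        ≈⟨ sumFin-tensor (suc M) (suc N) (λ i' j' → kronSum (A' M) (A' N) i j i' j' * ιS i' j' u) ⟩
      ΣN (suc M) (λ i' → ΣN (suc N) (λ j' → kronSum (A' M) (A' N) i j i' j' * ιS i' j' u))
        ≈⟨ ΣN-cong (suc M) (λ i' → ΣN-cong (suc N) (λ j' → linTl M N i j i' j' (ιS i' j' u))) ⟩
      ΣN (suc M) (λ i' → ΣN (suc N) (λ j' → α * (kronSum (Eᴺ M) (Eᴺ N) i j i' j' * ιS i' j' u) + β *
          (kronSum (Fᴺ M) (Fᴺ N) i j i' j' * ιS i' j' u) + γ * (kronSum (Hᴺ M) (Hᴺ N) i j i' j' * ιS i' j' u)))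
        ≈⟨ lin3² (suc M) (suc N) (λ i' j' → kronSum (Eᴺ M) (Eᴺ N) i j i' j' * ιS i' j' u)
            (λ i' j' → kronSum (Fᴺ M) (Fᴺ N) i j i' j' * ιS i' j' u) (λ i' j' → kronSum (Hᴺ M) (Hᴺ N) i j i' j' * ιS i' j' u) ⟩
      α * LG Eᴺ u + β * LG Fᴺ u + γ * LG Hᴺ u ≈⟨ mid u ⟩
      sumFin {suc K} (λ k → ιS i j (inj₁ k) * ρWᴺ (inj₁ k) u) + sumFin {suc m ℕ.* suc n} (λ v → ιS i j (inj₂ v) * ρWᴺ (inj₂ v) u)
        ≈⟨ sym (sumFin-splitAt (suc K) (suc m ℕ.* suc n) (λ u' → ιS i j u' * ρWᴺ u' u)) ⟩
      sumFin {suc K ℕ.+ suc m ℕ.* suc n} (λ w' → ιS i j (sp w') * ρWᴺ (sp w') u)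
        ≈⟨ sumFin-cong (suc K ℕ.+ suc m ℕ.* suc n) (λ w' → *-congˡ {ιS i j (sp w')} (sym (hW w' w))) ⟩
      sumFin {suc K ℕ.+ suc m ℕ.* suc n} (λ w' → ιM x w' * RW w' w) ∎
      where
      i = qx x
      j = rx x
      u = sp w
      LG : (ℕ → ℕ → ℕ → Carrier) → Fin (suc K) ⊎ Fin (suc m ℕ.* suc n) → Carrier
      LG X u = ΣN (suc M) (λ i' → ΣN (suc N) (λ j' → kronSum (X M) (X N) i j i' j' * ιS i' j' u))
      zs : ∀ k (f : Fin k → Carrier) → sumFin {k} (λ t → f t * 0#) ≈ 0#
      zs k f = trans (sumFin-cong k (λ t → zeroʳ (f t))) (sumFin-0 k)
      mid : ∀ u → α * LG Eᴺ u + β * LG Fᴺ u + γ * LG Hᴺ u ≈ sumFin {suc K}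
          (λ k → ιS i j (inj₁ k) * ρWᴺ (inj₁ k) u) + sumFin {suc m ℕ.* suc n} (λ v → ιS i j (inj₂ v) * ρWᴺ (inj₂ v) u)
      mid (inj₁ k0) = begin
        α * ρ⊗·ιtop Eᴺ i j k0' + β * ρ⊗·ιtop Fᴺ i j k0' + γ * ρ⊗·ιtop Hᴺ i j k0'
          ≈⟨ +-cong (+-cong (*-congˡ {α} (ιtop-E i j k0' (qx≤ x) (rx≤ x) (tk≤ k0)))
              (*-congˡ {β} (ιtop-F i j k0' (qx≤ x) (rx≤ x) (tk≤ k0)))) (*-congˡ {γ} (ιtop-H i j k0' (qx≤ x) (rx≤ x) (tk≤ k0))) ⟩
        α * ιtop·ρ Eᴺ i j k0' + β * ιtop·ρ Fᴺ i j k0' + γ * ιtop·ρ Hᴺ i j k0' ≈⟨ sym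
            (lin3 (suc K) (λ k → ιtop i j k * Eᴺ K k k0') (λ k → ιtop i j k * Fᴺ K k k0') (λ k → ιtop i j k * Hᴺ K k k0')) ⟩
        ΣN (suc K) (λ k → α * (ιtop i j k * Eᴺ K k k0') + β * (ιtop i j k * Fᴺ K k k0') + γ * (ιtop i j k * Hᴺ K k k0'))
          ≈⟨ sym (ΣN-cong (suc K) (λ k → linA K k k0' (ιtop i j k))) ⟩
        ΣN (suc K) (λ k → ιtop i j k * A' K k k0') ≈⟨ sym (sumFin-toℕ (suc K) (λ k → ιtop i j k * A' K k k0')) ⟩
        sumFin {suc K} (λ k → ιS i j (inj₁ k) * ρWᴺ (inj₁ k) (inj₁ k0)) ≈⟨ sym (+-identityʳ _) ⟩
        sumFin {suc K} (λ k → ιS i j (inj₁ k) * ρWᴺ (inj₁ k) (inj₁ k0)) + 0# ≈⟨ +-congˡ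
            (sym (zs (suc m ℕ.* suc n) (λ v → ιS i j (inj₂ v)))) ⟩
        sumFin {suc K} (λ k → ιS i j (inj₁ k) * ρWᴺ (inj₁ k) (inj₁ k0)) + sumFin {suc m ℕ.* suc n}
            (λ v → ιS i j (inj₂ v) * ρWᴺ (inj₂ v) (inj₁ k0)) ∎
        where k0' = toℕ k0
      mid (inj₂ v0) = begin
        α * ρ⊗·Ω Eᴺ i j a0 b0 + β * ρ⊗·Ω Fᴺ i j a0 b0 + γ * ρ⊗·Ω Hᴺ i j a0 b0
          ≈⟨ +-cong (+-cong (*-congˡ {α} (Ω-E i j a0 b0 (qx≤ x) (rx≤ x) (qv≤ v0) (rv≤ v0)))
              (*-congˡ {β} (Ω-F i j a0 b0 (qx≤ x) (rx≤ x) (qv≤ v0) (rv≤ v0))))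
              (*-congˡ {γ} (Ω-H i j a0 b0 (qx≤ x) (rx≤ x) (qv≤ v0) (rv≤ v0))) ⟩
        α * Ω·ρ⊗ Eᴺ i j a0 b0 + β * Ω·ρ⊗ Fᴺ i j a0 b0 + γ * Ω·ρ⊗ Hᴺ i j a0 b0 ≈⟨ sym
            (lin3² (suc m) (suc n) (λ a b → Ω i j a b * kronSum (Eᴺ m) (Eᴺ n) a b a0 b0)
            (λ a b → Ω i j a b * kronSum (Fᴺ m) (Fᴺ n) a b a0 b0) (λ a b → Ω i j a b * kronSum (Hᴺ m) (Hᴺ n) a b a0 b0)) ⟩
        ΣN (suc m) (λ a → ΣN (suc n) (λ b → α * (Ω i j a b * kronSum (Eᴺ m) (Eᴺ n) a b a0 b0) + β *
            (Ω i j a b * kronSum (Fᴺ m) (Fᴺ n) a b a0 b0) + γ * (Ω i j a b * kronSum (Hᴺ m) (Hᴺ n) a b a0 b0)))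
          ≈⟨ sym (ΣN-cong (suc m) (λ a → ΣN-cong (suc n) (λ b → linTr m n a b a0 b0 (Ω i j a b)))) ⟩
        ΣN (suc m) (λ a → ΣN (suc n) (λ b → Ω i j a b * kronSum (A' m) (A' n) a b a0 b0))
          ≈⟨ sym (sumFin-tensor (suc m) (suc n) (λ a b → Ω i j a b * kronSum (A' m) (A' n) a b a0 b0)) ⟩
        sumFin {suc m ℕ.* suc n} (λ v → ιS i j (inj₂ v) * ρWᴺ (inj₂ v) (inj₂ v0)) ≈⟨ sym (+-identityˡ _) ⟩
        0# + sumFin {suc m ℕ.* suc n} (λ v → ιS i j (inj₂ v) * ρWᴺ (inj₂ v) (inj₂ v0)) ≈⟨ +-congʳ
            (sym (zs (suc K) (λ k → ιS i j (inj₁ k)))) ⟩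
        sumFin {suc K} (λ k → ιS i j (inj₁ k) * ρWᴺ (inj₁ k) (inj₂ v0)) + sumFin {suc m ℕ.* suc n}
            (λ v → ιS i j (inj₂ v) * ρWᴺ (inj₂ v) (inj₂ v0)) ∎
        where
        a0 = qv v0
        b0 = rv v0

  module IntertwiningA = Intertwining (αA ω) (βA ω) (γA ω)
  module IntertwiningB = Intertwining 0# 0# ½

  cA : ρA Vr · ιM ≋ ιM · ρA Wr
  cA = IntertwiningA.intertwines (ρA Vr) (ρA Wr) (λ x y → refl)
      (λ w w' → trans (blockDiag≋blockMat (ρA (L ω K)) (ρA (L ω m ⊗ L ω n)) w w') (lem (sp w) (sp w')))
    where
    lem : ∀ u u' → blockEntry (ρA (L ω K)) (ρA (L ω m ⊗ L ω n)) u u' ≈ IntertwiningA.ρWᴺ u u'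
    lem (inj₁ _) (inj₁ _) = refl
    lem (inj₁ _) (inj₂ _) = refl
    lem (inj₂ _) (inj₁ _) = refl
    lem (inj₂ _) (inj₂ _) = refl

  cB : ρB Vr · ιM ≋ ιM · ρB Wr
  cB = IntertwiningB.intertwines (ρB Vr) (ρB Wr) (λ x y → ρB⊗≈kronSum M N (qx x) (rx x) (qx y) (rx y))
      (λ w w' → trans (blockDiag≋blockMat (ρB (L ω K)) (ρB (L ω m ⊗ L ω n)) w w') (lem (sp w) (sp w')))
    where
    lem : ∀ u u' → blockEntry (ρB (L ω K)) (ρB (L ω m ⊗ L ω n)) u u' ≈ IntertwiningB.ρWᴺ u u'
    lem (inj₁ k) (inj₁ k') = solve 4 (λ h e f x → h :* x :=
        (con (+ 0) :* e :+ con (+ 0) :* f) :+ h :* x) refl ½ (Eᴺ K (toℕ k) (toℕ k')) (Fᴺ K (toℕ k) (toℕ k'))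
        (Hᴺ K (toℕ k) (toℕ k'))
    lem (inj₁ _) (inj₂ _) = refl
    lem (inj₂ _) (inj₁ _) = refl
    lem (inj₂ v) (inj₂ v') = ρB⊗≈kronSum m n (qv v) (rv v) (qv v') (rv v')

  L⊗L≅L⊕L⊗L : Vr ≅ Wr
  L⊗L≅L⊕L⊗L = intertwiner⇒≅ Vr Wr ιM πM πι ιπ cA cB

module TrivialFactor {c ℓ : Level} (𝔽 : ACF0 c ℓ) (ω : ACF0.Carrier 𝔽) where
  open BinomialSums 𝔽 public

  Aᴺ-0 : ∀ α β γ → Aᴺ α β γ 0 0 0 ≈ 0#
  Aᴺ-0 α β γ = solve 3 (λ α β γ → (α :* con (+ 0) :+ β :* con (+ 0)) :+ γ :* (con (+ 0) :- con (+ 0)) := con (+ 0)) refl α β γ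

  toℕ-Fin1 : ∀ (x : Fin 1) → toℕ x ≡ 0
  toℕ-Fin1 zero = ≡.refl

  module TrivialLeft (n : ℕ) where
    Vr Wr : Rep
    Vr = L ω 0 ⊗ L ω n
    Wr = L ω n ⊕ zeroRep

    qx rx : Fin (1 ℕ.* suc n) → ℕ
    qx = fstIndex {1} (suc n)
    rx = sndIndex {1} (suc n)

    sp : Fin (suc n ℕ.+ 0) → Fin (suc n) ⊎ Fin 0
    sp = splitAt (suc n)

    ιS : ℕ → ℕ → Fin (suc n) ⊎ Fin 0 → Carrier
    ιS i j (inj₁ k) = δ j (toℕ k)
    πS : Fin (suc n) ⊎ Fin 0 → ℕ → ℕ → Carrier
    πS (inj₁ k) i j = δ (toℕ k) j

    ιM : Mat (dim Vr) (dim Wr)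
    ιM x w = ιS (qx x) (rx x) (sp w)
    πM : Mat (dim Wr) (dim Vr)
    πM w x = πS (sp w) (qx x) (rx x)

    qx0 : ∀ x → qx x ≡ 0
    qx0 x = toℕ-Fin1 _
    rx< : ∀ x → rx x < suc n
    rx< x = sndIndex< {1} (suc n) x

    πι : πM · ιM ≋ Id
    πι w w' = begin
      sumFin {1 ℕ.* suc n} (λ x → πS (sp w) (qx x) (rx x) * ιS (qx x) (rx x) (sp w'))
        ≈⟨ sumFin-tensor 1 (suc n) (λ i j → πS (sp w) i j * ιS i j (sp w')) ⟩
      ΣN 1 (λ i → ΣN (suc n) (λ j → πS (sp w) i j * ιS i j (sp w'))) ≈⟨ +-identityʳ _ ⟩
      ΣN (suc n) (λ j → πS (sp w) 0 j * ιS 0 j (sp w')) ≈⟨ lem (sp w) (sp w') ⟩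
      blockEntry {suc n} {suc n} {0} {0} Id Id (sp w) (sp w') ≈⟨ blockMat-Id {suc n} {0} w w' ⟩
      Id w w' ∎
      where
      lem : ∀ u u' → ΣN (suc n) (λ j → πS u 0 j * ιS 0 j u') ≈ blockEntry {suc n} {suc n} {0} {0} Id Id u u'
      lem (inj₁ k) (inj₁ k') = ΣN-δ (suc n) (toℕ k) (λ j → δ j (toℕ k')) (FinP.toℕ<n k)

    ιπ : ιM · πM ≋ Id
    ιπ x y = begin
      sumFin {suc n ℕ.+ 0} (λ w → ιS (qx x) (rx x) (sp w) * πS (sp w) (qx y) (rx y))
        ≈⟨ sumFin-splitAt (suc n) 0 (λ u → ιS (qx x) (rx x) u * πS u (qx y) (rx y)) ⟩
      sumFin {suc n} (λ k → δ (rx x) (toℕ k) * δ (toℕ k) (rx y)) + 0# ≈⟨ +-identityʳ _ ⟩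
      sumFin {suc n} (λ k → δ (rx x) (toℕ k) * δ (toℕ k) (rx y)) ≈⟨ sumFin-toℕ (suc n) (λ k → δ (rx x) k * δ k (rx y)) ⟩
      ΣN (suc n) (λ k → δ (rx x) k * δ k (rx y)) ≈⟨ ΣN-δ (suc n) (rx x) (λ k → δ k (rx y)) (rx< x) ⟩
      δ (rx x) (rx y) ≈⟨ sym (trans (*-congʳ (δ-eq (≡.trans (qx0 x) (≡.sym (qx0 y))))) (*-identityˡ _)) ⟩
      δ (qx x) (qx y) * δ (rx x) (rx y) ≈⟨ sym (Id-tensor 1 (suc n) x y) ⟩
      Id x y ∎

    module Intertwining (α β γ : Carrier) where
      A' = Aᴺ α β γ
      ρWᴺ : Fin (suc n) ⊎ Fin 0 → Fin (suc n) ⊎ Fin 0 → Carrier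
      ρWᴺ (inj₁ k) (inj₁ k') = A' n (toℕ k) (toℕ k')

      intertwines : (RV : Mat (dim Vr) (dim Vr)) (RW : Mat (dim Wr) (dim Wr)) →
              (∀ x y → RV x y ≈ kronSum (A' 0) (A' n) (qx x) (rx x) (qx y) (rx y)) →
              (∀ w w' → RW w w' ≈ ρWᴺ (sp w) (sp w')) → RV · ιM ≋ ιM · RW
      intertwines RV RW hV hW x w = begin
        sumFin {1 ℕ.* suc n} (λ y → RV x y * ιM y w)
          ≈⟨ sumFin-cong (1 ℕ.* suc n) (λ y → *-congʳ {ιM y w} (hV x y)) ⟩
        sumFin {1 ℕ.* suc n} (λ y → kronSum (A' 0) (A' n) (qx x) j (qx y) (rx y) * ιS (qx y) (rx y) (sp w))
          ≈⟨ sumFin-tensor 1 (suc n) (λ i' j' → kronSum (A' 0) (A' n) (qx x) j i' j' * ιS i' j' (sp w)) ⟩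
        ΣN 1 (λ i' → ΣN (suc n) (λ j' → kronSum (A' 0) (A' n) (qx x) j i' j' * ιS i' j' (sp w)))
          ≈⟨ reflexive (≡.cong (λ i → ΣN 1 (λ i' → ΣN (suc n)
              (λ j' → kronSum (A' 0) (A' n) i j i' j' * ιS i' j' (sp w)))) (qx0 x)) ⟩
        ΣN 1 (λ i' → ΣN (suc n) (λ j' → kronSum (A' 0) (A' n) 0 j i' j' * ιS i' j' (sp w))) ≈⟨ trans
            (+-identityʳ _) (lem (sp w)) ⟩
        sumFin {suc n} (λ k → ιS (qx x) j (inj₁ k) * ρWᴺ (inj₁ k) (sp w)) + 0# ≈⟨ sym
            (sumFin-splitAt (suc n) 0 (λ u' → ιS (qx x) j u' * ρWᴺ u' (sp w))) ⟩
        sumFin {suc n ℕ.+ 0} (λ w' → ιS (qx x) j (sp w') * ρWᴺ (sp w') (sp w))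
          ≈⟨ sumFin-cong (suc n ℕ.+ 0) (λ w' → *-congˡ {ιS (qx x) j (sp w')} (sym (hW w' w))) ⟩
        sumFin {suc n ℕ.+ 0} (λ w' → ιM x w' * RW w' w) ∎
        where
        j = rx x
        lem : ∀ u → ΣN (suc n) (λ j' → kronSum (A' 0) (A' n) 0 j 0 j' * ιS 0 j' u) ≈ sumFin {suc n}
            (λ k → ιS (qx x) j (inj₁ k) * ρWᴺ (inj₁ k) u) + 0#
        lem (inj₁ k0) = begin
          ΣN (suc n) (λ j' → (A' 0 0 0 * δ j j' + 1# * A' n j j') * δ j' k)
            ≈⟨ ΣN-cong (suc n) {g = λ j' → A' n j j' * δ j' k}
                (λ j' → *-congʳ {δ j' k} (trans (+-cong (trans (*-congʳ {δ j j'} (Aᴺ-0 α β γ)) (zeroˡ _))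
                (*-identityˡ _)) (+-identityˡ _))) ⟩
          ΣN (suc n) (λ j' → A' n j j' * δ j' k) ≈⟨ ΣN-δʳ (suc n) k (A' n j) (FinP.toℕ<n k0) ⟩
          A' n j k ≈⟨ sym (ΣN-δ (suc n) j (λ k' → A' n k' k) (rx< x)) ⟩
          ΣN (suc n) (λ k' → δ j k' * A' n k' k) ≈⟨ sym (sumFin-toℕ (suc n) (λ k' → δ j k' * A' n k' k)) ⟩
          sumFin {suc n} (λ k' → δ j (toℕ k') * A' n (toℕ k') k) ≈⟨ sym (+-identityʳ _) ⟩
          sumFin {suc n} (λ k' → ιS (qx x) j (inj₁ k') * ρWᴺ (inj₁ k') (inj₁ k0)) + 0# ∎
          where k = toℕ k0

    L₀⊗L≅L⊕0 : Vr ≅ Wr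
    L₀⊗L≅L⊕0 = intertwiner⇒≅ Vr Wr ιM πM πι ιπ
      (Intertwining.intertwines (αA ω) (βA ω) (γA ω) (ρA Vr) (ρA Wr) (λ x y → refl)
          (λ w w' → trans (blockDiag≋blockMat (ρA (L ω n)) (ρA zeroRep) w w') (lemA (sp w) (sp w'))))
      (Intertwining.intertwines 0# 0# ½ (ρB Vr) (ρB Wr) (λ x y → ρB⊗≈kronSum 0 n (qx x) (rx x) (qx y) (rx y))
          (λ w w' → trans (blockDiag≋blockMat (ρB (L ω n)) (ρB zeroRep) w w') (lemB (sp w) (sp w'))))
      where
      lemA : ∀ u u' → blockEntry (ρA (L ω n)) (ρA zeroRep) u u' ≈ Intertwining.ρWᴺ (αA ω) (βA ω) (γA ω) u u'
      lemA (inj₁ _) (inj₁ _) = refl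
      lemB : ∀ u u' → blockEntry (ρB (L ω n)) (ρB zeroRep) u u' ≈ Intertwining.ρWᴺ 0# 0# ½ u u'
      lemB (inj₁ k) (inj₁ k') = ρB≈Aᴺ n (toℕ k) (toℕ k')

  module TrivialRight (m : ℕ) where
    Vr Wr : Rep
    Vr = L ω m ⊗ L ω 0
    Wr = L ω m ⊕ zeroRep

    qx rx : Fin (suc m ℕ.* 1) → ℕ
    qx = fstIndex {suc m} 1
    rx = sndIndex {suc m} 1

    sp : Fin (suc m ℕ.+ 0) → Fin (suc m) ⊎ Fin 0
    sp = splitAt (suc m)

    ιS : ℕ → ℕ → Fin (suc m) ⊎ Fin 0 → Carrier
    ιS i j (inj₁ k) = δ i (toℕ k)
    πS : Fin (suc m) ⊎ Fin 0 → ℕ → ℕ → Carrier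
    πS (inj₁ k) i j = δ (toℕ k) i

    ιM : Mat (dim Vr) (dim Wr)
    ιM x w = ιS (qx x) (rx x) (sp w)
    πM : Mat (dim Wr) (dim Vr)
    πM w x = πS (sp w) (qx x) (rx x)

    rx0 : ∀ x → rx x ≡ 0
    rx0 x = toℕ-Fin1 _
    qx< : ∀ x → qx x < suc m
    qx< x = fstIndex< {suc m} 1 x

    πι : πM · ιM ≋ Id
    πι w w' = begin
      sumFin {suc m ℕ.* 1} (λ x → πS (sp w) (qx x) (rx x) * ιS (qx x) (rx x) (sp w'))
        ≈⟨ sumFin-tensor (suc m) 1 (λ i j → πS (sp w) i j * ιS i j (sp w')) ⟩
      ΣN (suc m) (λ i → ΣN 1 (λ j → πS (sp w) i j * ιS i j (sp w'))) ≈⟨ ΣN-cong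
          (suc m) {g = λ i → πS (sp w) i 0 * ιS i 0 (sp w')} (λ i → +-identityʳ _) ⟩
      ΣN (suc m) (λ i → πS (sp w) i 0 * ιS i 0 (sp w')) ≈⟨ lem (sp w) (sp w') ⟩
      blockEntry {suc m} {suc m} {0} {0} Id Id (sp w) (sp w') ≈⟨ blockMat-Id {suc m} {0} w w' ⟩
      Id w w' ∎
      where
      lem : ∀ u u' → ΣN (suc m) (λ i → πS u i 0 * ιS i 0 u') ≈ blockEntry {suc m} {suc m} {0} {0} Id Id u u'
      lem (inj₁ k) (inj₁ k') = ΣN-δ (suc m) (toℕ k) (λ i → δ i (toℕ k')) (FinP.toℕ<n k)

    ιπ : ιM · πM ≋ Id
    ιπ x y = begin
      sumFin {suc m ℕ.+ 0} (λ w → ιS (qx x) (rx x) (sp w) * πS (sp w) (qx y) (rx y))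
        ≈⟨ sumFin-splitAt (suc m) 0 (λ u → ιS (qx x) (rx x) u * πS u (qx y) (rx y)) ⟩
      sumFin {suc m} (λ k → δ (qx x) (toℕ k) * δ (toℕ k) (qx y)) + 0# ≈⟨ +-identityʳ _ ⟩
      sumFin {suc m} (λ k → δ (qx x) (toℕ k) * δ (toℕ k) (qx y)) ≈⟨ sumFin-toℕ (suc m) (λ k → δ (qx x) k * δ k (qx y)) ⟩
      ΣN (suc m) (λ k → δ (qx x) k * δ k (qx y)) ≈⟨ ΣN-δ (suc m) (qx x) (λ k → δ k (qx y)) (qx< x) ⟩
      δ (qx x) (qx y) ≈⟨ sym (trans (*-congˡ (δ-eq (≡.trans (rx0 x) (≡.sym (rx0 y))))) (*-identityʳ _)) ⟩
      δ (qx x) (qx y) * δ (rx x) (rx y) ≈⟨ sym (Id-tensor (suc m) 1 x y) ⟩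
      Id x y ∎

    module Intertwining (α β γ : Carrier) where
      A' = Aᴺ α β γ
      ρWᴺ : Fin (suc m) ⊎ Fin 0 → Fin (suc m) ⊎ Fin 0 → Carrier
      ρWᴺ (inj₁ k) (inj₁ k') = A' m (toℕ k) (toℕ k')

      intertwines : (RV : Mat (dim Vr) (dim Vr)) (RW : Mat (dim Wr) (dim Wr)) →
              (∀ x y → RV x y ≈ kronSum (A' m) (A' 0) (qx x) (rx x) (qx y) (rx y)) →
              (∀ w w' → RW w w' ≈ ρWᴺ (sp w) (sp w')) → RV · ιM ≋ ιM · RW
      intertwines RV RW hV hW x w = begin
        sumFin {suc m ℕ.* 1} (λ y → RV x y * ιM y w)
          ≈⟨ sumFin-cong (suc m ℕ.* 1) (λ y → *-congʳ {ιM y w} (hV x y)) ⟩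
        sumFin {suc m ℕ.* 1} (λ y → kronSum (A' m) (A' 0) i (rx x) (qx y) (rx y) * ιS (qx y) (rx y) (sp w))
          ≈⟨ sumFin-tensor (suc m) 1 (λ i' j' → kronSum (A' m) (A' 0) i (rx x) i' j' * ιS i' j' (sp w)) ⟩
        ΣN (suc m) (λ i' → ΣN 1 (λ j' → kronSum (A' m) (A' 0) i (rx x) i' j' * ιS i' j' (sp w)))
          ≈⟨ reflexive (≡.cong (λ j → ΣN (suc m) (λ i' → ΣN 1
              (λ j' → kronSum (A' m) (A' 0) i j i' j' * ιS i' j' (sp w)))) (rx0 x)) ⟩
        ΣN (suc m) (λ i' → ΣN 1 (λ j' → kronSum (A' m) (A' 0) i 0 i' j' * ιS i' j' (sp w))) ≈⟨ trans
            (ΣN-cong (suc m) {g = λ i' → kronSum (A' m) (A' 0) i 0 i' 0 * ιS i' 0 (sp w)} (λ i' → +-identityʳ _)) (lem (sp w)) ⟩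
        sumFin {suc m} (λ k → ιS i (rx x) (inj₁ k) * ρWᴺ (inj₁ k) (sp w)) + 0# ≈⟨ sym
            (sumFin-splitAt (suc m) 0 (λ u' → ιS i (rx x) u' * ρWᴺ u' (sp w))) ⟩
        sumFin {suc m ℕ.+ 0} (λ w' → ιS i (rx x) (sp w') * ρWᴺ (sp w') (sp w))
          ≈⟨ sumFin-cong (suc m ℕ.+ 0) (λ w' → *-congˡ {ιS i (rx x) (sp w')} (sym (hW w' w))) ⟩
        sumFin {suc m ℕ.+ 0} (λ w' → ιM x w' * RW w' w) ∎
        where
        i = qx x
        lem : ∀ u → ΣN (suc m) (λ i' → kronSum (A' m) (A' 0) i 0 i' 0 * ιS i' 0 u) ≈ sumFin {suc m}
            (λ k → ιS i (rx x) (inj₁ k) * ρWᴺ (inj₁ k) u) + 0#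
        lem (inj₁ k0) = begin
          ΣN (suc m) (λ i' → (A' m i i' * 1# + δ i i' * A' 0 0 0) * δ i' k)
            ≈⟨ ΣN-cong (suc m) {g = λ i' → A' m i i' * δ i' k}
                (λ i' → *-congʳ {δ i' k} (trans (+-cong (*-identityʳ _)
                (trans (*-congˡ {δ i i'} (Aᴺ-0 α β γ)) (zeroʳ _))) (+-identityʳ _))) ⟩
          ΣN (suc m) (λ i' → A' m i i' * δ i' k) ≈⟨ ΣN-δʳ (suc m) k (A' m i) (FinP.toℕ<n k0) ⟩
          A' m i k ≈⟨ sym (ΣN-δ (suc m) i (λ k' → A' m k' k) (qx< x)) ⟩
          ΣN (suc m) (λ k' → δ i k' * A' m k' k) ≈⟨ sym (sumFin-toℕ (suc m) (λ k' → δ i k' * A' m k' k)) ⟩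
          sumFin {suc m} (λ k' → δ i (toℕ k') * A' m (toℕ k') k) ≈⟨ sym (+-identityʳ _) ⟩
          sumFin {suc m} (λ k' → ιS i (rx x) (inj₁ k') * ρWᴺ (inj₁ k') (inj₁ k0)) + 0# ∎
          where k = toℕ k0

    L⊗L₀≅L⊕0 : Vr ≅ Wr
    L⊗L₀≅L⊕0 = intertwiner⇒≅ Vr Wr ιM πM πι ιπ
      (Intertwining.intertwines (αA ω) (βA ω) (γA ω) (ρA Vr) (ρA Wr) (λ x y → refl)
          (λ w w' → trans (blockDiag≋blockMat (ρA (L ω m)) (ρA zeroRep) w w') (lemA (sp w) (sp w'))))
      (Intertwining.intertwines 0# 0# ½ (ρB Vr) (ρB Wr) (λ x y → ρB⊗≈kronSum m 0 (qx x) (rx x) (qx y) (rx y))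
          (λ w w' → trans (blockDiag≋blockMat (ρB (L ω m)) (ρB zeroRep) w w') (lemB (sp w) (sp w'))))
      where
      lemA : ∀ u u' → blockEntry (ρA (L ω m)) (ρA zeroRep) u u' ≈ Intertwining.ρWᴺ (αA ω) (βA ω) (γA ω) u u'
      lemA (inj₁ _) (inj₁ _) = refl
      lemB : ∀ u u' → blockEntry (ρB (L ω m)) (ρB zeroRep) u u' ≈ Intertwining.ρWᴺ 0# 0# ½ u u'
      lemB (inj₁ k) (inj₁ k') = ρB≈Aᴺ m (toℕ k) (toℕ k')

open import Data.Nat using (_+_; _*_; _⊓_)
open import Data.List using (map; upTo; applyUpTo)
open import Data.List.Properties using (map-cong; map-∘; map-applyUpTo)

summands-shift : ∀ {a} {A : Set a} (f : ℕ → A) m n k →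
                 map (λ p → f (m + n ∸ 2 * p)) (upTo k) ≡ map (λ p → f (suc m + suc n ∸ 2 * p)) (applyUpTo suc k)
summands-shift f m n k = begin
  map (λ p → f (m + n ∸ 2 * p)) (upTo k)                 ≡⟨ map-cong (λ p → ≡.cong f (≡.sym (shift p))) (upTo k) ⟩
  map (λ p → f (suc m + suc n ∸ 2 * suc p)) (upTo k)     ≡⟨ map-∘ (upTo k) ⟩
  map (λ p → f (suc m + suc n ∸ 2 * p)) (map suc (upTo k)) ≡⟨ ≡.cong (map _) (map-applyUpTo id suc k) ⟩
  map (λ p → f (suc m + suc n ∸ 2 * p)) (applyUpTo suc k) ∎
  where
  open ≡.≡-Reasoning
  shift : ∀ p → suc m + suc n ∸ 2 * suc p ≡ m + n ∸ 2 * p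
  shift p = ≡.cong₂ _∸_ (ℕP.+-suc m n) (ℕP.+-suc p (p + 0))

theorem2p6 : ∀ {c ℓ} (𝔽 : ACF0 c ℓ) → let open Reps 𝔽 in
    (ω : ACF0.Carrier 𝔽) (m n : ℕ) →
    (L ω m ⊗ L ω n) ≅ ⨁ (map (λ p → L ω (m + n ∸ 2 * p)) (upTo (suc (m ⊓ n))))
theorem2p6 𝔽 ω zero n = TrivialLeft.L₀⊗L≅L⊕0 n
  where
  open Reps 𝔽
  open TrivialFactor 𝔽 ω using (module TrivialLeft; module TrivialRight)
theorem2p6 𝔽 ω (suc m) zero =
  ≡.subst (λ k → (L ω (suc m) ⊗ L ω 0) ≅ (L ω k ⊕ zeroRep)) (≡.sym (ℕP.+-identityʳ (suc m))) (TrivialRight.L⊗L₀≅L⊕0 (suc m))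
  where
  open Reps 𝔽
  open TrivialFactor 𝔽 ω using (module TrivialLeft; module TrivialRight)
theorem2p6 𝔽 ω (suc m) (suc n) =
  ≅-trans L⊗L≅L⊕L⊗L
          (⊕-congʳ (L ω (suc m + suc n)) (≡.subst (λ Vs → (L ω m ⊗ L ω n) ≅ ⨁ Vs)
              (summands-shift (L ω) m n (suc (m ⊓ n))) (theorem2p6 𝔽 ω m n)))
  where
  open Reps 𝔽
  open ClebschGordanStep 𝔽 ω m n using (L⊗L≅L⊕L⊗L; ≅-trans; ⊕-congʳ)
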